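{- Let $q=p^r$ with $p$ prime and let $a,b\in\mathbb F_q^*$. Let $c=ba^{ -3}$ and let $\mathcal X$ be the projective plane curve over $\mathbb F_q$ defined by (the homogenization of) $y^2+cy+xy=x^3$. Then $N_3(a,b)=|\mathcal X(\mathbb F_q)|$ and \[ P_3(a,b)=\tfrac13\bigl(|\mathcal X(\mathbb F_q)|-\epsilon\bigr), \] where $\epsilon=1$ if $p\ne3$ and $c=\frac1{27}$, and $\epsilon=0$ otherwise.
   Context: $N_3(a,b)$ is the number of $x\in\mathbb F_{q^3}^*$ with $\operatorname{Tr}_{\mathbb F_{q^3}/\mathbb F_q}(x)=a$ and $\operatorname{N}_{\mathbb F_{q^3}/\mathbb F_q}(x)=b$. $P_3(a,b)$ is the number of irreducible polynomials $x^3-ax^2+ux-b$ ($u\in\mathbb F_q$) in $\mathbb F_q[x]$. $\mathcal X(\mathbb F_q)$ is the set of $\mathbb F_q$-rational points of $\mathcal X$ (including points at infinity). -}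

module Defs where

open import Level using (0ℓ)
open import Data.Nat as ℕ using (ℕ; zero; suc)
open import Data.List using (List; []; _∷_; length; map)
open import Data.List.Membership.Propositional using (_∈_)
open import Data.List.Relation.Unary.Unique.Propositional using (Unique)
open import Data.Product using (Σ; _×_; _,_)
open import Data.Sum using (_⊎_)
open import Data.Unit using (⊤)
open import Function.Bundles using (_⇔_)
open import Relation.Nullary using (¬_; Dec)
open import Relation.Binary.PropositionalEquality using (_≡_; _≢_)
open import Algebra.Structures using (IsCommutativeRing)

IsCount : {A : Set} → (A → Set) → ℕ → Set
IsCount {A} P n =
  Σ (List A) λ l → Unique l × (∀ x → (x ∈ l) ⇔ P x) × length l ≡ n

-- Finite fields (propositional equality, total inverse with 0⁻¹ junk).

record FiniteField : Set₁ where
  infixl 6 _+_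
  infixl 7 _*_
  infixr 8 _^_
  field
    Carrier : Set
    _+_ _*_ : Carrier → Carrier → Carrier
    -_      : Carrier → Carrier
    0# 1#   : Carrier
    _⁻¹     : Carrier → Carrier
    isCommutativeRing : IsCommutativeRing _≡_ _+_ _*_ -_ 0# 1#
    0≢1     : 0# ≢ 1#
    inverse : ∀ x → x ≢ 0# → x * (x ⁻¹) ≡ 1#
    _≟_     : (x y : Carrier) → Dec (x ≡ y)
    elems   : List Carrier
    elems-unique   : Unique elems
    elems-complete : ∀ x → x ∈ elems

  card : ℕ
  card = length elems

  _^_ : Carrier → ℕ → Carrier
  x ^ zero  = 1#
  x ^ suc n = x * (x ^ n)

  ofℕ : ℕ → Carrier
  ofℕ zero    = 0#
  ofℕ (suc n) = 1# + ofℕ n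

open FiniteField public using (card) renaming (Carrier to Elt)

-- Ring homomorphism K → L (making L a field extension of K).
record Embedding (K L : FiniteField) : Set where
  private
    module K = FiniteField K
    module L = FiniteField L
  field
    ι     : K.Carrier → L.Carrier
    ι-0   : ι K.0# ≡ L.0#
    ι-1   : ι K.1# ≡ L.1#
    ι-+   : ∀ x y → ι (x K.+ y) ≡ ι x L.+ ι y
    ι-*   : ∀ x y → ι (x K.* y) ≡ ι x L.* ι y

-- Trace and norm of F_{q^3}/F_q, with q = |K| (Frobenius formulas).

module _ (K L : FiniteField) where
  private
    module L = FiniteField L
    q = card K

  Tr : L.Carrier → L.Carrier
  Tr x = x L.+ (x L.^ q) L.+ (x L.^ (q ℕ.* q))

  Nm : L.Carrier → L.Carrier
  Nm x = x L.^ (1 ℕ.+ q ℕ.+ q ℕ.* q)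

  N₃-is : Embedding K L → Elt K → Elt K → ℕ → Set
  N₃-is e a b n =
    IsCount (λ (x : L.Carrier) →
      (x ≢ L.0#) × (Tr x ≡ Embedding.ι e a) × (Nm x ≡ Embedding.ι e b)) n

-- Polynomials over a field: coefficient lists, lowest degree first.

module Poly (K : FiniteField) where
  open FiniteField K

  Pol : Set
  Pol = List Carrier

  coeff : Pol → ℕ → Carrier
  coeff []      _       = 0#
  coeff (c ∷ f) zero    = c
  coeff (c ∷ f) (suc n) = coeff f n

  -- equality of polynomials (trailing zeros ignored)
  _≃_ : Pol → Pol → Set
  f ≃ g = ∀ n → coeff f n ≡ coeff g n

  addP : Pol → Pol → Pol
  addP []      g       = g
  addP (c ∷ f) []      = c ∷ f
  addP (c ∷ f) (d ∷ g) = (c + d) ∷ addP f g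

  mulP : Pol → Pol → Pol
  mulP []      g = []
  mulP (c ∷ f) g = addP (map (c *_) g) (0# ∷ mulP f g)

  IsUnit : Pol → Set
  IsUnit g = (coeff g 0 ≢ 0#) × (∀ n → coeff g (suc n) ≡ 0#)

  Irreducible : Pol → Set
  Irreducible f =
    ¬ (f ≃ []) × ¬ IsUnit f ×
    (∀ g h → f ≃ mulP g h → IsUnit g ⊎ IsUnit h)

  cubic : Carrier → Carrier → Carrier → Pol
  cubic a u b = (- b) ∷ u ∷ (- a) ∷ 1# ∷ []

P₃-is : (K : FiniteField) → Elt K → Elt K → ℕ → Set
P₃-is K a b n = IsCount (λ u → Irreducible (cubic a u b)) n
  where open Poly K

-- Points of P^2(K) via normalized representatives:
--   inj₁ (x , y)        ↦ (x : y : 1)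
--   inj₂ (inj₁ x)       ↦ (x : 1 : 0)
--   inj₂ (inj₂ tt)      ↦ (1 : 0 : 0)

ℙ² : FiniteField → Set
ℙ² K = (Elt K × Elt K) ⊎ (Elt K ⊎ ⊤)

module _ (K : FiniteField) where
  open FiniteField K

  coords : ℙ² K → Carrier × Carrier × Carrier
  coords (Data.Sum.inj₁ (x , y))          = x , y , 1#
  coords (Data.Sum.inj₂ (Data.Sum.inj₁ x)) = x , 1# , 0#
  coords (Data.Sum.inj₂ (Data.Sum.inj₂ _)) = 1# , 0# , 0#

  OnCurve : Carrier → ℙ² K → Set
  OnCurve c P with coords P
  ... | X , Y , Z = (Y * Y * Z) + (c * Y * Z * Z) + (X * Y * Z) ≡ X * X * X

  #X-is : Carrier → ℕ → Set
  #X-is c n = IsCount (OnCurve c) n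

module Submission where

-- Both sides are compared with
--   T = #{(x , y) ∈ K² | x·y·(a - x - y) = b}   and   ε = #{t ∈ K | 3t = a, t³ = b}.
-- (1) TripleCount: sorting the triples (x , y , a - x - y) by the middle
--     coefficient u of the cubic with these roots gives 3·P + ε = T + 3,
--     where P counts the root-free (= irreducible, Cubic) cubics
--     x³ - a x² + u x - b; the per-cubic identity is proved in Splitting.
-- (2) Curve: (r , s) ↦ (- c a / s , c r / s) maps the T triples bijectively
--     onto the points of X off the line x = 0, and three points remain, so
--     |X(K)| = T + 3.
-- (3) NormTrace: x ∈ L^* with trace a and norm b is either t ∈ K with 3t = a,
--     t³ = b, or a root of a root-free cubic x³ - a x² + u x - b; every such
--     cubic has exactly three roots in L (Extension, IrreducibleCount), so
--     N₃ = 3·P + ε.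
-- (4) DiagonalCount: ε = 1 exactly when p ≠ 3 and c = 1/27.
-- The general tools come first: field algebra with an integer-coefficient
-- ring solver (Field), exact counting (Counting), and basic finite-field
-- theory (Fermat, characteristic, Frobenius, root bound).

open import Defs
import Data.Nat as ℕ
open import Data.Nat using (ℕ)
open import Data.Nat.Primality using (Prime)
open import Relation.Binary.PropositionalEquality using (_≡_; _≢_)

-- The coefficients matter: the identities of the
-- paper mention the constants 3 and 27, which a solver whose coefficients
-- live in F itself cannot compare.
module Field (F : FiniteField) where
  open import Data.Nat as ℕ using (ℕ; zero; suc)
  import Data.Nat.Properties as ℕP
  open import Data.Integer as ℤ using (ℤ; -[1+_]) renaming (+_ to pos)
  import Data.Integer.Properties as ℤP
  open import Data.Sign as Sign using (Sign)
  open import Data.Sum using (_⊎_; inj₁; inj₂)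
  open import Data.Product using (_×_; _,_)
  open import Data.Maybe using (nothing)
  open import Data.Empty using (⊥-elim)
  open import Relation.Nullary using (yes; no)
  open import Relation.Binary.PropositionalEquality
  open import Algebra.Bundles using (CommutativeRing; RawRing)
  import Tactic.RingSolver.Core.AlmostCommutativeRing as ACR
  open import Tactic.RingSolver.Core.Polynomial.Parameters using (Homomorphism)
  open import Tactic.RingSolver.Core.Expression using (Expr; Κ; Ι; _⊕_; _⊗_; _⊛_; ⊝_; module Eval)
  open import Data.Vec using (Vec)
  open import Data.Bool using (Bool; true; false; T)

  open FiniteField F public hiding (card)
  open ≡-Reasoning

  commutativeRing : CommutativeRing _ _
  commutativeRing = record { isCommutativeRing = isCommutativeRing }

  open CommutativeRing commutativeRing public
    using (+-assoc; +-comm; *-assoc; *-comm; +-identityˡ; +-identityʳ; *-identityˡ; *-identityʳ;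
           -‿inverseˡ; -‿inverseʳ; distribʳ; zeroˡ; zeroʳ; ring)
  open import Algebra.Properties.Ring ring public
    using (-‿involutive; -‿distribˡ-*; -‿distribʳ-*; -0#≈0#; -‿+-comm)

  infixl 6 _-_
  _-_ : Carrier → Carrier → Carrier
  x - y = x + (- y)

  ofℕ-+ : ∀ m n → ofℕ (m ℕ.+ n) ≡ ofℕ m + ofℕ n
  ofℕ-+ zero n = sym (+-identityˡ _)
  ofℕ-+ (suc m) n = trans (cong (1# +_) (ofℕ-+ m n)) (sym (+-assoc _ _ _))

  ofℕ-* : ∀ m n → ofℕ (m ℕ.* n) ≡ ofℕ m * ofℕ n
  ofℕ-* zero n = sym (zeroˡ _)
  ofℕ-* (suc m) n = begin
    ofℕ (n ℕ.+ m ℕ.* n)            ≡⟨ ofℕ-+ n (m ℕ.* n) ⟩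
    ofℕ n + ofℕ (m ℕ.* n)          ≡⟨ cong₂ _+_ (sym (*-identityˡ _)) (ofℕ-* m n) ⟩
    1# * ofℕ n + ofℕ m * ofℕ n     ≡⟨ sym (distribʳ _ _ _) ⟩
    (1# + ofℕ m) * ofℕ n           ∎

  ofℕ-^ : ∀ m n → ofℕ (m ℕ.^ n) ≡ ofℕ m ^ n
  ofℕ-^ m zero = +-identityʳ 1#
  ofℕ-^ m (suc n) = trans (ofℕ-* m (m ℕ.^ n)) (cong (ofℕ m *_) (ofℕ-^ m n))

  ⟦_⟧ℤ : ℤ → Carrier
  ⟦ pos n ⟧ℤ = ofℕ n
  ⟦ -[1+ n ] ⟧ℤ = - ofℕ (suc n)

  private
    shift-sub : ∀ m n → (1# + m) - (1# + n) ≡ m - n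
    shift-sub m n = begin
      (1# + m) + - (1# + n)          ≡⟨ cong ((1# + m) +_) (sym (-‿+-comm 1# n)) ⟩
      (1# + m) + (- 1# + - n)        ≡⟨ +-assoc 1# m _ ⟩
      1# + (m + (- 1# + - n))        ≡⟨ cong (1# +_) (sym (+-assoc m (- 1#) _)) ⟩
      1# + ((m + - 1#) + - n)        ≡⟨ cong (λ z → 1# + (z + - n)) (+-comm m (- 1#)) ⟩
      1# + ((- 1# + m) + - n)        ≡⟨ cong (1# +_) (+-assoc (- 1#) m _) ⟩
      1# + (- 1# + (m + - n))        ≡⟨ sym (+-assoc 1# (- 1#) _) ⟩
      (1# + - 1#) + (m + - n)        ≡⟨ cong (_+ (m + - n)) (-‿inverseʳ 1#) ⟩
      0# + (m + - n)                 ≡⟨ +-identityˡ _ ⟩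
      m - n                          ∎

  ⊖-hom : ∀ m n → ⟦ m ℤ.⊖ n ⟧ℤ ≡ ofℕ m - ofℕ n
  ⊖-hom zero zero = sym (trans (cong (0# +_) -0#≈0#) (+-identityʳ _))
  ⊖-hom zero (suc n) = sym (+-identityˡ _)
  ⊖-hom (suc m) zero = trans (cong ⟦_⟧ℤ (ℤP.⊖-≥ {suc m} {zero} ℕ.z≤n))
                             (sym (trans (cong (ofℕ (suc m) +_) -0#≈0#) (+-identityʳ _)))
  ⊖-hom (suc m) (suc n) = begin
    ⟦ suc m ℤ.⊖ suc n ⟧ℤ              ≡⟨ cong ⟦_⟧ℤ (ℤP.[1+m]⊖[1+n]≡m⊖n m n) ⟩
    ⟦ m ℤ.⊖ n ⟧ℤ                      ≡⟨ ⊖-hom m n ⟩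
    ofℕ m - ofℕ n                     ≡⟨ sym (shift-sub (ofℕ m) (ofℕ n)) ⟩
    (1# + ofℕ m) - (1# + ofℕ n)       ∎

  neg-hom : ∀ i → ⟦ ℤ.- i ⟧ℤ ≡ - ⟦ i ⟧ℤ
  neg-hom (pos zero) = sym -0#≈0#
  neg-hom (pos (suc n)) = refl
  neg-hom -[1+ n ] = sym (-‿involutive _)

  +-hom : ∀ i j → ⟦ i ℤ.+ j ⟧ℤ ≡ ⟦ i ⟧ℤ + ⟦ j ⟧ℤ
  +-hom -[1+ m ] -[1+ n ] = begin
    - (1# + ofℕ (suc (m ℕ.+ n)))          ≡⟨ cong (λ z → - (1# + z)) (ofℕ-+ (suc m) n) ⟩
    - (1# + (ofℕ (suc m) + ofℕ n))        ≡⟨ cong -_ (sym (+-assoc 1# _ _)) ⟩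
    - ((1# + ofℕ (suc m)) + ofℕ n)        ≡⟨ cong (λ z → - (z + ofℕ n)) (+-comm 1# _) ⟩
    - ((ofℕ (suc m) + 1#) + ofℕ n)        ≡⟨ cong -_ (+-assoc (ofℕ (suc m)) 1# _) ⟩
    - (ofℕ (suc m) + ofℕ (suc n))         ≡⟨ sym (-‿+-comm _ _) ⟩
    - ofℕ (suc m) + - ofℕ (suc n)         ∎
  +-hom -[1+ m ] (pos n) = trans (⊖-hom n (suc m)) (+-comm _ _)
  +-hom (pos m) -[1+ n ] = ⊖-hom m (suc n)
  +-hom (pos m) (pos n) = ofℕ-+ m n

  private
    signed : Sign → Carrier → Carrier
    signed Sign.+ x = x
    signed Sign.- x = - x

    ◃-hom : ∀ s n → ⟦ s ℤ.◃ n ⟧ℤ ≡ signed s (ofℕ n)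
    ◃-hom Sign.- zero = sym -0#≈0#
    ◃-hom Sign.+ zero = refl
    ◃-hom Sign.- (suc n) = refl
    ◃-hom Sign.+ (suc n) = refl

    sign-abs : ∀ i → ⟦ i ⟧ℤ ≡ signed (ℤ.sign i) (ofℕ ℤ.∣ i ∣)
    sign-abs (pos n) = refl
    sign-abs -[1+ n ] = refl

    signed-* : ∀ s t x y → signed (s Sign.* t) (x * y) ≡ signed s x * signed t y
    signed-* Sign.- Sign.- x y = sym (trans (sym (-‿distribˡ-* x (- y)))
                                         (trans (cong -_ (sym (-‿distribʳ-* x y))) (-‿involutive _)))
    signed-* Sign.- Sign.+ x y = -‿distribˡ-* x y
    signed-* Sign.+ Sign.- x y = -‿distribʳ-* x y
    signed-* Sign.+ Sign.+ x y = refl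

  *-hom : ∀ i j → ⟦ i ℤ.* j ⟧ℤ ≡ ⟦ i ⟧ℤ * ⟦ j ⟧ℤ
  *-hom i j = begin
    ⟦ (s Sign.* t) ℤ.◃ (∣i∣ ℕ.* ∣j∣) ⟧ℤ           ≡⟨ ◃-hom (s Sign.* t) (∣i∣ ℕ.* ∣j∣) ⟩
    signed (s Sign.* t) (ofℕ (∣i∣ ℕ.* ∣j∣))       ≡⟨ cong (signed (s Sign.* t)) (ofℕ-* ∣i∣ ∣j∣) ⟩
    signed (s Sign.* t) (ofℕ ∣i∣ * ofℕ ∣j∣)       ≡⟨ signed-* s t (ofℕ ∣i∣) (ofℕ ∣j∣) ⟩
    signed s (ofℕ ∣i∣) * signed t (ofℕ ∣j∣)       ≡⟨ sym (cong₂ _*_ (sign-abs i) (sign-abs j)) ⟩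
    ⟦ i ⟧ℤ * ⟦ j ⟧ℤ                               ∎
    where
    s t : Sign
    s = ℤ.sign i
    t = ℤ.sign j
    ∣i∣ ∣j∣ : ℕ
    ∣i∣ = ℤ.∣ i ∣
    ∣j∣ = ℤ.∣ j ∣

  -- The solver needs fromℤ 1 = 1# definitionally, which ofℕ 1 = 1# + 0# is
  -- not; 'numeral' is the variant of ofℕ without the trailing + 0#.
  numeral : ℕ → Carrier
  numeral zero = 0#
  numeral (suc zero) = 1#
  numeral (suc (suc n)) = 1# + numeral (suc n)

  numeral≡ofℕ : ∀ n → numeral n ≡ ofℕ n
  numeral≡ofℕ zero = refl
  numeral≡ofℕ (suc zero) = sym (+-identityʳ 1#)
  numeral≡ofℕ (suc (suc n)) = cong (1# +_) (numeral≡ofℕ (suc n))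

  fromℤ : ℤ → Carrier
  fromℤ (pos n) = numeral n
  fromℤ -[1+ n ] = - numeral (suc n)

  private
    fromℤ≡⟦⟧ℤ : ∀ i → fromℤ i ≡ ⟦ i ⟧ℤ
    fromℤ≡⟦⟧ℤ (pos n) = numeral≡ofℕ n
    fromℤ≡⟦⟧ℤ -[1+ n ] = cong -_ (numeral≡ofℕ (suc n))

    intRing : RawRing _ _
    intRing = record { Carrier = ℤ ; _≈_ = _≡_ ; _+_ = ℤ._+_ ; _*_ = ℤ._*_ ; -_ = ℤ.-_
                     ; 0# = pos 0 ; 1# = pos 1 }

    isZero : ℤ → Bool
    isZero (pos zero) = true
    isZero _ = false

    solverRing : ACR.AlmostCommutativeRing _ _
    solverRing = ACR.fromCommutativeRing commutativeRing (λ _ → nothing)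

    intHom : Homomorphism _ _ _ _
    intHom = record
      { from = record { rawRing = intRing ; isZero = isZero }
      ; to = solverRing
      ; morphism = record
        { ⟦_⟧ = fromℤ
        ; +-homo = λ i j → trans (fromℤ≡⟦⟧ℤ (i ℤ.+ j)) (trans (+-hom i j) (sym (cong₂ _+_ (fromℤ≡⟦⟧ℤ i) (fromℤ≡⟦⟧ℤ j))))
        ; *-homo = λ i j → trans (fromℤ≡⟦⟧ℤ (i ℤ.* j)) (trans (*-hom i j) (sym (cong₂ _*_ (fromℤ≡⟦⟧ℤ i) (fromℤ≡⟦⟧ℤ j))))
        ; -‿homo = λ i → trans (fromℤ≡⟦⟧ℤ (ℤ.- i)) (trans (neg-hom i) (sym (cong -_ (fromℤ≡⟦⟧ℤ i))))
        ; 0-homo = refl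
        ; 1-homo = refl }
      ; Zero-C⟶Zero-R = zero-hom }
      where
      zero-hom : ∀ x → T (isZero x) → 0# ≡ fromℤ x
      zero-hom (pos zero) _ = refl

    open import Tactic.RingSolver.Core.Polynomial.Base (Homomorphism.from intHom)
    open Eval (ACR.AlmostCommutativeRing.rawRing solverRing) fromℤ

    norm : ∀ {n} → Expr ℤ n → Poly n
    norm (Κ x)   = κ x
    norm (Ι x)   = ι x
    norm (x ⊕ y) = norm x ⊞ norm y
    norm (x ⊗ y) = norm x ⊠ norm y
    norm (⊝ x)   = ⊟ norm x
    norm (x ⊛ i) = norm x ⊡ i

    ⟦_⇓⟧ : ∀ {n} → Expr ℤ n → Vec Carrier n → Carrier
    ⟦ expr ⇓⟧ = ⟦ norm expr ⟧ₚ where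
      open import Tactic.RingSolver.Core.Polynomial.Semantics intHom renaming (⟦_⟧ to ⟦_⟧ₚ)

    correct : ∀ {n} (expr : Expr ℤ n) ρ → ⟦ expr ⇓⟧ ρ ≡ ⟦ expr ⟧ ρ
    correct {n = n} = go
      where
      open import Tactic.RingSolver.Core.Polynomial.Homomorphism intHom
      open import Algebra.Properties.Semiring.Exp.TCOptimised (ACR.AlmostCommutativeRing.semiring solverRing)
        using (^-congˡ)
      go : ∀ (expr : Expr ℤ n) ρ → ⟦ expr ⇓⟧ ρ ≡ ⟦ expr ⟧ ρ
      go (Κ x)   ρ = κ-hom x ρ
      go (Ι x)   ρ = ι-hom x ρ
      go (x ⊕ y) ρ = trans (⊞-hom (norm x) (norm y) ρ) (cong₂ _+_ (go x ρ) (go y ρ))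
      go (x ⊗ y) ρ = trans (⊠-hom (norm x) (norm y) ρ) (cong₂ _*_ (go x ρ) (go y ρ))
      go (⊝ x)   ρ = trans (⊟-hom (norm x) ρ) (cong -_ (go x ρ))
      go (x ⊛ i) ρ = trans (⊡-hom (norm x) i ρ) (^-congˡ i (go x ρ))

  -- 'solve n (λ x₁ … xₙ → lhs := rhs) refl' proves a polynomial identity
  -- with integer coefficients ('con') in n variables.
  open import Relation.Binary.Reflection (setoid Carrier) Ι ⟦_⟧ ⟦_⇓⟧ correct public using (solve)

  infixl 6 _:+_ _:-_
  infixl 7 _:*_
  infix 8 :-_
  infix 4 _:=_
  _:+_ _:*_ _:-_ : ∀ {n} → Expr ℤ n → Expr ℤ n → Expr ℤ n
  _:+_ = _⊕_
  _:*_ = _⊗_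
  x :- y = x ⊕ (⊝ y)
  :-_ : ∀ {n} → Expr ℤ n → Expr ℤ n
  :-_ = ⊝_
  con : ∀ {n} → ℤ → Expr ℤ n
  con = Κ
  _:=_ : ∀ {n} → Expr ℤ n → Expr ℤ n → Expr ℤ n × Expr ℤ n
  _:=_ = _,_

  1≢0 : 1# ≢ 0#
  1≢0 e = 0≢1 (sym e)

  inverseˡ : ∀ x → x ≢ 0# → (x ⁻¹) * x ≡ 1#
  inverseˡ x nz = trans (*-comm _ _) (inverse x nz)

  cancelˡ : ∀ {x y z} → x ≢ 0# → x * y ≡ x * z → y ≡ z
  cancelˡ {x} {y} {z} nx e = begin
    y                  ≡⟨ sym (*-identityˡ y) ⟩
    1# * y             ≡⟨ cong (_* y) (sym (inverseˡ x nx)) ⟩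
    (x ⁻¹ * x) * y     ≡⟨ *-assoc _ _ _ ⟩
    x ⁻¹ * (x * y)     ≡⟨ cong (x ⁻¹ *_) e ⟩
    x ⁻¹ * (x * z)     ≡⟨ sym (*-assoc _ _ _) ⟩
    (x ⁻¹ * x) * z     ≡⟨ cong (_* z) (inverseˡ x nx) ⟩
    1# * z             ≡⟨ *-identityˡ z ⟩
    z                  ∎

  zero-divisor : ∀ x y → x * y ≡ 0# → x ≡ 0# ⊎ y ≡ 0#
  zero-divisor x y e with x ≟ 0#
  ... | yes x0 = inj₁ x0
  ... | no nx = inj₂ (cancelˡ nx (trans e (sym (zeroʳ x))))

  mul-nz : ∀ {x y} → x ≢ 0# → y ≢ 0# → x * y ≢ 0#
  mul-nz {x} {y} nx ny e with zero-divisor x y e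
  ... | inj₁ e' = nx e'
  ... | inj₂ e' = ny e'

  zero-divisor₃ : ∀ x y z → x * y * z ≡ 0# → x ≡ 0# ⊎ y ≡ 0# ⊎ z ≡ 0#
  zero-divisor₃ x y z e with zero-divisor (x * y) z e
  ... | inj₂ z0 = inj₂ (inj₂ z0)
  ... | inj₁ xy0 with zero-divisor x y xy0
  ...   | inj₁ x0 = inj₁ x0
  ...   | inj₂ y0 = inj₂ (inj₁ y0)

  inverse-unique : ∀ {x z} → x * z ≡ 1# → x ⁻¹ ≡ z
  inverse-unique {x} {z} e = cancelˡ x≢0 (trans (inverse x x≢0) (sym e))
    where
    x≢0 : x ≢ 0#
    x≢0 x0 = 1≢0 (trans (sym e) (trans (cong (_* z) x0) (zeroˡ z)))

  neg≡0⇒≡0 : ∀ {z} → - z ≡ 0# → z ≡ 0#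
  neg≡0⇒≡0 {z} e = trans (sym (-‿involutive z)) (trans (cong -_ e) -0#≈0#)

  ⁻¹-nz : ∀ {x} → x ≢ 0# → x ⁻¹ ≢ 0#
  ⁻¹-nz {x} nx e = 1≢0 (trans (sym (inverse x nx)) (trans (cong (x *_) e) (zeroʳ x)))

  neg-nz : ∀ {x} → x ≢ 0# → - x ≢ 0#
  neg-nz nx e = nx (neg≡0⇒≡0 e)

  sub≡0⇒≡ : ∀ {x y} → x - y ≡ 0# → x ≡ y
  sub≡0⇒≡ {x} {y} e = begin
    x                  ≡⟨ sym (+-identityʳ x) ⟩
    x + 0#             ≡⟨ cong (x +_) (sym (-‿inverseˡ y)) ⟩
    x + (- y + y)      ≡⟨ sym (+-assoc _ _ _) ⟩
    (x - y) + y        ≡⟨ cong (_+ y) e ⟩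
    0# + y             ≡⟨ +-identityˡ y ⟩
    y                  ∎

  sub-self : ∀ x → x - x ≡ 0#
  sub-self x = -‿inverseʳ x

  sub-nz : ∀ {x y} → x ≢ y → x - y ≢ 0#
  sub-nz ne e = ne (sub≡0⇒≡ e)

  ^-+ : ∀ x m n → x ^ (m ℕ.+ n) ≡ x ^ m * x ^ n
  ^-+ x zero n = sym (*-identityˡ _)
  ^-+ x (suc m) n = trans (cong (x *_) (^-+ x m n)) (sym (*-assoc _ _ _))

  *-^ : ∀ x y n → (x * y) ^ n ≡ x ^ n * y ^ n
  *-^ x y zero = sym (*-identityˡ 1#)
  *-^ x y (suc n) = trans (cong ((x * y) *_) (*-^ x y n))
    (solve 4 (λ x y a b → (x :* y) :* (a :* b) := (x :* a) :* (y :* b)) refl x y (x ^ n) (y ^ n))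

  ^-* : ∀ x m n → x ^ (m ℕ.* n) ≡ (x ^ m) ^ n
  ^-* x m zero = cong (x ^_) (ℕP.*-zeroʳ m)
  ^-* x m (suc n) = begin
    x ^ (m ℕ.* suc n)          ≡⟨ cong (x ^_) (ℕP.*-suc m n) ⟩
    x ^ (m ℕ.+ m ℕ.* n)        ≡⟨ ^-+ x m (m ℕ.* n) ⟩
    x ^ m * x ^ (m ℕ.* n)      ≡⟨ cong (x ^ m *_) (^-* x m n) ⟩
    x ^ m * (x ^ m) ^ n        ∎

  ^-nz : ∀ {x} n → x ≢ 0# → x ^ n ≢ 0#
  ^-nz zero nx = 1≢0
  ^-nz (suc n) nx = mul-nz nx (^-nz n nx)

  ^≡0⇒≡0 : ∀ {x} n → x ^ n ≡ 0# → x ≡ 0#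
  ^≡0⇒≡0 {x} n e with x ≟ 0#
  ... | yes x0 = x0
  ... | no nx = ⊥-elim (^-nz n nx e)

  cube : ∀ x → x ^ 3 ≡ x * x * x
  cube x = solve 1 (λ x → x :* (x :* (x :* con (pos 1))) := x :* x :* x) refl x

module Counting where
  open import Data.Nat as ℕ using (ℕ; _+_)
  import Data.Nat.Properties as ℕP
  open import Data.List using (List; []; _∷_; length; map; _++_; cartesianProduct; filter)
  open import Data.List.Properties using (length-++; length-map)
  open import Data.List.Membership.Propositional using (_∈_; lose)
  open import Data.List.Membership.Propositional.Properties
    using (∈-map⁺; ∈-map⁻; ∈-++⁺ˡ; ∈-++⁺ʳ; ∈-++⁻; ∈-cartesianProduct⁺; ∈-cartesianProduct⁻; ∈-filter⁺; ∈-filter⁻)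
  open import Data.List.Membership.Propositional.Properties.WithK using (unique∧set⇒bag)
  open import Data.List.Relation.Binary.BagAndSetEquality using (∼bag⇒↭)
  open import Data.List.Relation.Binary.Permutation.Propositional.Properties using (↭-length)
  open import Data.List.Relation.Unary.Unique.Propositional using (Unique)
  import Data.List.Relation.Unary.Unique.Propositional.Properties as Unique
  open import Data.List.Relation.Unary.AllPairs using ([]; _∷_)
  open import Data.List.Relation.Unary.All as All using ([])
  open import Data.List.Relation.Unary.Any using (here; there; any?; satisfied)
  open import Data.Product using (Σ; _×_; _,_; proj₁; proj₂)
  open import Data.Sum using (_⊎_; inj₁; inj₂)
  open import Data.Unit using (⊤; tt)
  open import Data.Empty using (⊥; ⊥-elim)
  open import Function.Bundles using (_⇔_; mk⇔; Equivalence)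
  open import Relation.Nullary using (¬_; Dec; yes; no)
  open import Relation.Nullary.Decidable using (map′)
  open import Relation.Binary.PropositionalEquality
  open import Data.Nat.Tactic.RingSolver using (solve-∀)

  Enum : Set → Set
  Enum A = Σ (List A) λ l → Unique l × (∀ x → x ∈ l)

  private
    to : ∀ {A B : Set} → A ⇔ B → A → B
    to = Equivalence.to
    from : ∀ {A B : Set} → A ⇔ B → B → A
    from = Equivalence.from

  -- Two duplicate-free lists with the same members are permutations of
  -- each other, so a count is unique.
  count-unique : ∀ {A : Set} {P : A → Set} {m n} → IsCount P m → IsCount P n → m ≡ n
  count-unique (l , ul , el , refl) (l' , ul' , el' , refl) =
    ↭-length (∼bag⇒↭ (unique∧set⇒bag ul ul'
      (λ {x} → mk⇔ (λ i → from (el' x) (to (el x) i)) (λ i → from (el x) (to (el' x) i)))))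

  count-⇔ : ∀ {A : Set} {P Q : A → Set} {n} → (∀ x → P x → Q x) → (∀ x → Q x → P x) →
    IsCount P n → IsCount Q n
  count-⇔ f g (l , u , e , len) = l , u , (λ x → mk⇔ (λ i → f x (to (e x) i)) (λ q → from (e x) (g x q))) , len

  count-list : ∀ {A : Set} {P : A → Set} (l : List A) → Unique l →
    (∀ x → x ∈ l → P x) → (∀ x → P x → x ∈ l) → IsCount P (length l)
  count-list l u f g = l , u , (λ x → mk⇔ (f x) (g x)) , refl

  count-empty : ∀ {A : Set} {P : A → Set} → (∀ x → ¬ P x) → IsCount P 0
  count-empty np = [] , [] , (λ x → mk⇔ (λ ()) (λ p → ⊥-elim (np x p))) , refl

  count-zero : ∀ {A : Set} {P : A → Set} → IsCount P 0 → ∀ x → ¬ P x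
  count-zero ([] , u , e , refl) x p with from (e x) p
  ... | ()

  count-single : ∀ {A : Set} {P : A → Set} (a : A) → (∀ x → P x → x ≡ a) → P a → IsCount P 1
  count-single a h pa = a ∷ [] , [] ∷ [] , (λ x → mk⇔ (λ { (here refl) → pa }) (λ p → here (h x p))) , refl

  count-dec : ∀ {A : Set} {P : A → Set} (P? : ∀ x → Dec (P x)) → Enum A → Σ ℕ (IsCount P)
  count-dec P? (l , u , c) = length (filter P? l) , filter P? l , Unique.filter⁺ P? u ,
    (λ x → mk⇔ (λ i → proj₂ (∈-filter⁻ P? {xs = l} i)) (∈-filter⁺ P? (c x))) , refl

  search : ∀ {A : Set} {P : A → Set} → Enum A → (∀ x → Dec (P x)) → Dec (Σ A P)
  search (l , _ , c) P? = map′ satisfied (λ { (x , p) → lose (c x) p }) (any? P? l)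

  ind : ∀ {A : Set} → Dec A → ℕ
  ind (yes _) = 1
  ind (no _) = 0

  count-⊎ : ∀ {A : Set} {P Q : A → Set} {m n} → IsCount P m → IsCount Q n → (∀ x → P x → Q x → ⊥) →
    IsCount (λ x → P x ⊎ Q x) (m + n)
  count-⊎ {A} {P} {Q} (l , u , e , refl) (l' , u' , e' , refl) disjoint =
    l ++ l' , append-unique l u (λ i → to (e _) i) , members , length-++ l
    where
    append-unique : ∀ k → Unique k → (∀ {x} → x ∈ k → P x) → Unique (k ++ l')
    append-unique [] _ _ = u'
    append-unique (x ∷ k) (a ∷ uk) inP = All.tabulate (distinct _) ∷ append-unique k uk (λ i → inP (there i))
      where
      distinct : ∀ y → y ∈ k ++ l' → x ≢ y
      distinct y i with ∈-++⁻ k i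
      ... | inj₁ ik = All.lookup a ik
      ... | inj₂ il = λ { refl → disjoint x (inP (here refl)) (to (e' x) il) }
    members : ∀ x → (x ∈ l ++ l') ⇔ (P x ⊎ Q x)
    members x = mk⇔ split (λ { (inj₁ p) → ∈-++⁺ˡ (from (e x) p) ; (inj₂ q) → ∈-++⁺ʳ l (from (e' x) q) })
      where
      split : x ∈ l ++ l' → P x ⊎ Q x
      split i with ∈-++⁻ l i
      ... | inj₁ il = inj₁ (to (e x) il)
      ... | inj₂ il = inj₂ (to (e' x) il)

  count-bij : ∀ {A B : Set} {P : A → Set} {Q : B → Set} {n} (f : A → B) (g : B → A) →
    (∀ x → P x → Q (f x)) → (∀ y → Q y → P (g y)) →
    (∀ x → P x → g (f x) ≡ x) → (∀ y → Q y → f (g y) ≡ y) →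
    IsCount P n → IsCount Q n
  count-bij {P = P} {Q} f g pq qp gf fg (l , u , e , refl) =
    map f l , map-unique l u (λ i → to (e _) i) , members , length-map f l
    where
    map-unique : ∀ k → Unique k → (∀ {x} → x ∈ k → P x) → Unique (map f k)
    map-unique [] _ _ = []
    map-unique (x ∷ k) (a ∷ uk) inP = All.tabulate (distinct _) ∷ map-unique k uk (λ i → inP (there i))
      where
      distinct : ∀ y → y ∈ map f k → f x ≢ y
      distinct y i eq with ∈-map⁻ f i
      ... | z , zk , refl = All.lookup a zk
        (trans (sym (gf x (inP (here refl)))) (trans (cong g eq) (gf z (inP (there zk)))))
    members : ∀ y → (y ∈ map f l) ⇔ Q y
    members y = mk⇔ image (λ q → subst (_∈ map f l) (fg y q) (∈-map⁺ f (from (e (g y)) (qp y q))))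
      where
      image : y ∈ map f l → Q y
      image i with ∈-map⁻ f i
      ... | z , zl , refl = pq z (to (e z) zl)

  count-slice : ∀ {A B : Set} {P : B → Set} {Q : A × B → Set} {n} (a : A) →
    (∀ p → Q p → proj₁ p ≡ a) → (∀ p → Q p → P (proj₂ p)) → (∀ y → P y → Q (a , y)) →
    IsCount P n → IsCount Q n
  count-slice a on-slice down up =
    count-bij (a ,_) proj₂ up down (λ _ _ → refl) (λ { (a' , y) q → cong (_, y) (sym (on-slice (a' , y) q)) })

  count-× : ∀ {A B : Set} {P : A → Set} {Q : B → Set} {m n} → IsCount P m → IsCount Q n →
    IsCount (λ (p : A × B) → P (proj₁ p) × Q (proj₂ p)) (m ℕ.* n)
  count-× (lP , uP , eP , refl) (lQ , uQ , eQ , refl) =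
    cartesianProduct lP lQ , Unique.cartesianProduct⁺ uP uQ ,
    (λ { (x , y) → mk⇔ (λ i → let (i₁ , i₂) = ∈-cartesianProduct⁻ lP lQ i in to (eP x) i₁ , to (eQ y) i₂)
                       (λ { (px , qy) → ∈-cartesianProduct⁺ (from (eP x) px) (from (eQ y) qy) }) }) ,
    length-cartesianProduct lP lQ
    where
    length-cartesianProduct : ∀ {A B : Set} (xs : List A) (ys : List B) →
      length (cartesianProduct xs ys) ≡ length xs ℕ.* length ys
    length-cartesianProduct [] ys = refl
    length-cartesianProduct (x ∷ xs) ys = trans (length-++ (map (x ,_) ys))
      (cong₂ _+_ (length-map (x ,_) ys) (length-cartesianProduct xs ys))

  enum-⊤ : Enum ⊤
  enum-⊤ = (tt ∷ []) , ([] ∷ []) , (λ { tt → here refl })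

  enum-× : ∀ {A B : Set} → Enum A → Enum B → Enum (A × B)
  enum-× (la , ua , ca) (lb , ub , cb) =
    cartesianProduct la lb , Unique.cartesianProduct⁺ ua ub , λ { (x , y) → ∈-cartesianProduct⁺ (ca x) (cb y) }

  count-all : ∀ {A : Set} (E : Enum A) → IsCount (λ (_ : A) → ⊤) (length (proj₁ E))
  count-all (l , u , c) = count-list l u (λ _ _ → tt) (λ x _ → c x)

  count-split : ∀ {A : Set} {P Q : A → Set} {m n k} → (∀ x → Dec (P x)) →
    IsCount (λ x → Q x × P x) m → IsCount (λ x → Q x × ¬ P x) n → IsCount Q k → m + n ≡ k
  count-split {P = P} {Q} P? cP cN cQ =
    count-unique (count-⇔ (λ x → λ { (inj₁ h) → proj₁ h ; (inj₂ h) → proj₁ h }) split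
                   (count-⊎ cP cN (λ x h₁ h₂ → proj₂ h₂ (proj₂ h₁)))) cQ
    where
    split : ∀ x → Q x → (Q x × P x) ⊎ (Q x × ¬ P x)
    split x q with P? x
    ... | yes p = inj₁ (q , p)
    ... | no np = inj₂ (q , np)

  module _ {A : Set} {P Q : A → Set} (E : Enum A) (P? : ∀ x → Dec (P x)) (P⊆Q : ∀ x → P x → Q x) where
    private
      rest? : (∀ x → Dec (Q x)) → ∀ x → Dec (Q x × ¬ P x)
      rest? Q? x with Q? x | P? x
      ... | yes q | no np = yes (q , np)
      ... | yes _ | yes p = no (λ r → proj₂ r p)
      ... | no nq | _ = no (λ r → nq (proj₁ r))

      restricted : ∀ {m} → IsCount P m → IsCount (λ x → Q x × P x) m
      restricted = count-⇔ (λ x p → P⊆Q x p , p) (λ x → proj₂)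

    count-mono : ∀ {m n} → (∀ x → Dec (Q x)) → IsCount P m → IsCount Q n → m ℕ.≤ n
    count-mono {m} Q? cP cQ = subst (m ℕ.≤_) (count-split P? (restricted cP) (proj₂ cR) cQ) (ℕP.m≤m+n m _)
      where
      cR : Σ ℕ (IsCount (λ x → Q x × ¬ P x))
      cR = count-dec (rest? Q?) E

    count-fill : ∀ {n} → (∀ x → Dec (Q x)) → IsCount P n → IsCount Q n → ∀ x → Q x → P x
    count-fill {n} Q? cP cQ x qx with P? x
    ... | yes p = p
    ... | no np = ⊥-elim (count-zero rest-empty x (qx , np))
      where
      cR : Σ ℕ (IsCount (λ x → Q x × ¬ P x))
      cR = count-dec (rest? Q?) E
      rest-empty : IsCount (λ y → Q y × ¬ P y) 0
      rest-empty = subst (IsCount _)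
        (ℕP.+-cancelˡ-≡ n _ _ (trans (count-split P? (restricted cP) (proj₂ cR) cQ) (sym (ℕP.+-identityʳ n))))
        (proj₂ cR)

  Σl : ∀ {B : Set} → List B → (B → ℕ) → ℕ
  Σl [] N = 0
  Σl (b ∷ l) N = N b + Σl l N

  Σl-+ : ∀ {B : Set} (L : List B) (M N : B → ℕ) → Σl L (λ b → M b + N b) ≡ Σl L M + Σl L N
  Σl-+ [] M N = refl
  Σl-+ (b ∷ L) M N = trans (cong (M b + N b +_) (Σl-+ L M N)) (interchange (M b) (N b) (Σl L M) (Σl L N))
    where
    interchange : ∀ x y z w → x + y + (z + w) ≡ x + z + (y + w)
    interchange = solve-∀

  Σl-ext : ∀ {B : Set} (L : List B) (M N : B → ℕ) → (∀ b → M b ≡ N b) → Σl L M ≡ Σl L N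
  Σl-ext [] M N h = refl
  Σl-ext (b ∷ L) M N h = cong₂ _+_ (h b) (Σl-ext L M N h)

  Σl-*ˡ : ∀ {B : Set} (L : List B) (N : B → ℕ) c → Σl L (λ b → c ℕ.* N b) ≡ c ℕ.* Σl L N
  Σl-*ˡ [] N c = sym (ℕP.*-zeroʳ c)
  Σl-*ˡ (b ∷ L) N c = trans (cong (c ℕ.* N b +_) (Σl-*ˡ L N c)) (sym (ℕP.*-distribˡ-+ c (N b) _))

  count-fibers : ∀ {A B : Set} {P : A → Set} (f : A → B) (N : B → ℕ) →
    (∀ b → IsCount (λ x → P x × f x ≡ b) (N b)) →
    (E : Enum B) → IsCount P (Σl (proj₁ E) N)
  count-fibers {P = P} f N fibre (L , u , c) =
    count-⇔ (λ x → proj₁) (λ x p → p , c (f x)) (over L u)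
    where
    over : ∀ L → Unique L → IsCount (λ x → P x × f x ∈ L) (Σl L N)
    over [] _ = count-empty (λ x → λ { (_ , ()) })
    over (b ∷ L) (a ∷ u) =
      count-⇔ (λ x → λ { (inj₁ (p , refl)) → p , here refl ; (inj₂ (p , i)) → p , there i })
              (λ x → λ { (p , here eq) → inj₁ (p , eq) ; (p , there i) → inj₂ (p , i) })
              (count-⊎ (fibre b) (over L u) (λ x → λ { (_ , refl) (_ , i) → All.lookup a i refl }))

  count-indicator : ∀ {A B : Set} {P : A → Set} (f : A → B) {Q : B → Set} (Q? : ∀ b → Dec (Q b)) →
    (∀ b → Q b → IsCount (λ x → P x × f x ≡ b) 1) → (∀ b → ¬ Q b → IsCount (λ x → P x × f x ≡ b) 0) →
    (E : Enum B) → IsCount P (Σl (proj₁ E) (λ b → ind (Q? b)))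
  count-indicator f Q? one none = count-fibers f (λ b → ind (Q? b)) fibre
    where
    fibre : ∀ b → IsCount _ (ind (Q? b))
    fibre b with Q? b
    ... | yes q = one b q
    ... | no nq = none b nq

module FiniteFieldFacts (F : FiniteField) where
  open import Data.Nat as ℕ using (ℕ; suc)
  open import Data.List using (List; []; _∷_; length; map; foldr; filter)
  open import Data.List.Membership.Propositional using (_∈_)
  open import Data.List.Membership.Propositional.Properties using (∈-map⁺; ∈-map⁻; ∈-filter⁺; ∈-filter⁻)
  open import Data.List.Membership.Propositional.Properties.WithK using (unique∧set⇒bag)
  open import Data.List.Relation.Binary.BagAndSetEquality using (∼bag⇒↭)
  open import Data.List.Relation.Binary.Permutation.Propositional using (_↭_; ↭⇒↭ₛ)
  open import Algebra.Bundles using (CommutativeRing)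
  open import Data.List.Relation.Unary.Unique.Propositional using (Unique)
  import Data.List.Relation.Unary.Unique.Propositional.Properties as Unique
  open import Data.List.Relation.Unary.Any using (here; there)
  open import Data.Integer using () renaming (+_ to pos)
  open import Data.Product using (Σ; _×_; _,_; proj₂)
  open import Function.Bundles using (mk⇔)
  open import Relation.Nullary using (¬?; yes; no)
  open import Relation.Binary.PropositionalEquality as P using (_≡_; _≢_; cong; module ≡-Reasoning)
  open Field F
  open CommutativeRing commutativeRing using (+-isCommutativeMonoid; *-isCommutativeMonoid)
  import Data.List.Relation.Binary.Permutation.Setoid.Properties (P.setoid Carrier) as Permutation
  open Counting
  open ≡-Reasoning

  enum : Enum Carrier
  enum = elems , elems-unique , elems-complete

  units : List Carrier
  units = filter (λ x → ¬? (x ≟ 0#)) elems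

  units-unique : Unique units
  units-unique = Unique.filter⁺ (λ x → ¬? (x ≟ 0#)) elems-unique

  unit-nz : ∀ {x} → x ∈ units → x ≢ 0#
  unit-nz i = proj₂ (∈-filter⁻ (λ x → ¬? (x ≟ 0#)) {xs = elems} i)

  ∈-units : ∀ {x} → x ≢ 0# → x ∈ units
  ∈-units {x} = ∈-filter⁺ (λ x → ¬? (x ≟ 0#)) (elems-complete x)

  count-units : IsCount (λ x → x ≢ 0#) (length units)
  count-units = count-list units units-unique (λ x → unit-nz) (λ x → ∈-units)

  units-card : suc (length units) ≡ card F
  units-card = count-split (_≟ 0#)
    (count-⇔ (λ x e → _ , e) (λ x → proj₂) (count-single 0# (λ _ e → e) P.refl))
    (count-⇔ (λ x n → _ , n) (λ x → proj₂) count-units)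
    (count-all enum)

  private
    sum prod : List Carrier → Carrier
    sum = foldr _+_ 0#
    prod = foldr _*_ 1#

    ↭-sum : ∀ {l l'} → l ↭ l' → sum l ≡ sum l'
    ↭-sum p = Permutation.foldr-commMonoid +-isCommutativeMonoid (↭⇒↭ₛ p)

    ↭-prod : ∀ {l l'} → l ↭ l' → prod l ≡ prod l'
    ↭-prod p = Permutation.foldr-commMonoid *-isCommutativeMonoid (↭⇒↭ₛ p)

    map-↭ : ∀ (f : Carrier → Carrier) (l : List Carrier) → Unique l →
      (∀ {x y} → f x ≡ f y → x ≡ y) → (∀ {x} → x ∈ l → f x ∈ l) →
      (∀ {y} → y ∈ l → Σ Carrier λ x → x ∈ l × f x ≡ y) → map f l ↭ l
    map-↭ f l u inj into onto = ∼bag⇒↭ (unique∧set⇒bag (Unique.map⁺ inj u) u (mk⇔ image preimage))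
      where
      image : ∀ {y} → y ∈ map f l → y ∈ l
      image i with ∈-map⁻ f i
      ... | z , zl , P.refl = into zl
      preimage : ∀ {y} → y ∈ l → y ∈ map f l
      preimage i with onto i
      ... | x , xl , P.refl = ∈-map⁺ f xl

    sum-shift : ∀ l → sum (map (_+ 1#) l) ≡ sum l + ofℕ (length l)
    sum-shift [] = P.sym (+-identityˡ 0#)
    sum-shift (x ∷ l) = P.trans (cong ((x + 1#) +_) (sum-shift l))
      (solve 3 (λ x s n → (x :+ con (pos 1)) :+ (s :+ n) := (x :+ s) :+ (con (pos 1) :+ n)) P.refl
             x (sum l) (ofℕ (length l)))

    prod-scale : ∀ a l → prod (map (a *_) l) ≡ a ^ length l * prod l
    prod-scale a [] = P.sym (*-identityˡ 1#)
    prod-scale a (x ∷ l) = P.trans (cong ((a * x) *_) (prod-scale a l))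
      (solve 4 (λ a x p q → (a :* x) :* (p :* q) := (a :* p) :* (x :* q)) P.refl a x (a ^ length l) (prod l))

    prod-nz : ∀ l → (∀ {x} → x ∈ l → x ≢ 0#) → prod l ≢ 0#
    prod-nz [] _ = 1≢0
    prod-nz (x ∷ l) h = mul-nz (h (here P.refl)) (prod-nz l (λ i → h (there i)))

  -- |F| = 0 in F: translation by 1 permutes F, so Σ x = Σ (x + 1) = Σ x + |F|.
  card≡0 : ofℕ (card F) ≡ 0#
  card≡0 = begin
    ofℕ (card F)                           ≡⟨ solve 2 (λ s n → n := (s :+ n) :- s) P.refl (sum elems) (ofℕ (card F)) ⟩
    (sum elems + ofℕ (card F)) - sum elems ≡⟨ cong (_- sum elems) (P.sym (sum-shift elems)) ⟩
    sum (map (_+ 1#) elems) - sum elems ≡⟨ cong (_- sum elems) (↭-sum shift-perm) ⟩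
    sum elems - sum elems              ≡⟨ sub-self (sum elems) ⟩
    0#                                 ∎
    where
    shift-perm : map (_+ 1#) elems ↭ elems
    shift-perm = map-↭ (_+ 1#) elems elems-unique
      (λ {x} {y} e → P.trans (solve 1 (λ x → x := (x :+ con (pos 1)) :- con (pos 1)) P.refl x)
                    (P.trans (cong (_- 1#) e) (solve 1 (λ y → (y :+ con (pos 1)) :- con (pos 1) := y) P.refl y)))
      (λ _ → elems-complete _)
      (λ {y} _ → (y - 1#) , elems-complete _ , solve 1 (λ y → (y :- con (pos 1)) :+ con (pos 1) := y) P.refl y)

  -- a ^ |F^*| = 1 for a ≠ 0: multiplication by a permutes F^*.
  fermat-units : ∀ a → a ≢ 0# → a ^ length units ≡ 1#
  fermat-units a na = P.sym (cancelˡ (prod-nz units unit-nz) (begin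
    prod units * 1#                    ≡⟨ *-identityʳ _ ⟩
    prod units                         ≡⟨ P.sym (↭-prod scale-perm) ⟩
    prod (map (a *_) units)            ≡⟨ prod-scale a units ⟩
    a ^ length units * prod units      ≡⟨ *-comm _ _ ⟩
    prod units * a ^ length units      ∎))
    where
    scale-perm : map (a *_) units ↭ units
    scale-perm = map-↭ (a *_) units units-unique (cancelˡ na)
      (λ i → ∈-units (mul-nz na (unit-nz i)))
      (λ {y} i → (a ⁻¹ * y) , ∈-units (mul-nz (⁻¹-nz na) (unit-nz i)) ,
                 P.trans (P.sym (*-assoc _ _ _)) (P.trans (cong (_* y) (inverse a na)) (*-identityˡ y)))

  fermat : ∀ x → x ^ card F ≡ x
  fermat x with x ≟ 0#
  ... | yes P.refl = P.subst (λ n → 0# ^ n ≡ 0#) units-card (zeroˡ _)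
  ... | no nx = P.subst (λ n → x ^ n ≡ x) units-card (P.trans (cong (x *_) (fermat-units x nx)) (*-identityʳ x))

  characteristic : ∀ p r → card F ≡ p ℕ.^ r → ofℕ p ≡ 0#
  characteristic p r cF = ^≡0⇒≡0 r (P.trans (P.sym (ofℕ-^ p r)) (P.trans (cong ofℕ (P.sym cF)) card≡0))

  card-≥2 : Σ ℕ λ m → card F ≡ suc (suc m)
  card-≥2 with units | ∈-units {1#} 1≢0 | units-card
  ... | _ ∷ l | _ | e = length l , P.sym e

module Binomial where
  open import Data.Nat as ℕ using (ℕ; zero; suc)
  import Data.Nat.Properties as ℕP
  open import Data.Nat.Combinatorics using (_C_; nC1≡n; k>n⇒nCk≡0) renaming (nCk+nC[k+1]≡[n+1]C[k+1] to pascal)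
  open import Data.Nat.Divisibility using (_∣_; divides; ∣⇒≤)
  open import Data.Nat.Primality using (Prime; euclidsLemma)
  open import Data.Nat.Tactic.RingSolver using (solve-∀)
  open import Data.Sum using (inj₁; inj₂)
  open import Data.Empty using (⊥-elim)
  open import Relation.Binary.PropositionalEquality

  absorption : ∀ n k → suc k ℕ.* (suc n C suc k) ≡ suc n ℕ.* (n C k)
  absorption zero zero = refl
  absorption zero (suc k) =
    trans (cong (suc (suc k) ℕ.*_) (k>n⇒nCk≡0 {1} {suc (suc k)} (ℕ.s≤s (ℕ.s≤s ℕ.z≤n))))
          (trans (ℕP.*-zeroʳ (suc (suc k))) (sym (cong (1 ℕ.*_) (k>n⇒nCk≡0 {0} {suc k} (ℕ.s≤s ℕ.z≤n)))))
  absorption (suc n) zero = trans (ℕP.*-identityˡ _) (trans (nC1≡n (suc (suc n))) (sym (ℕP.*-identityʳ (suc (suc n)))))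
  absorption (suc n) (suc j) = begin
    suc (suc j) ℕ.* (suc (suc n) C suc (suc j))       ≡⟨ cong (suc (suc j) ℕ.*_) (sym (pascal (suc n) (suc j))) ⟩
    suc (suc j) ℕ.* (A ℕ.+ B)                         ≡⟨ expand (suc j) A B ⟩
    A ℕ.+ suc j ℕ.* A ℕ.+ suc (suc j) ℕ.* B           ≡⟨ cong₂ (λ u v → A ℕ.+ u ℕ.+ v) (absorption n j) (absorption n (suc j)) ⟩
    A ℕ.+ suc n ℕ.* (n C j) ℕ.+ suc n ℕ.* (n C suc j) ≡⟨ collect A (suc n) (n C j) (n C suc j) ⟩
    A ℕ.+ suc n ℕ.* ((n C j) ℕ.+ (n C suc j))         ≡⟨ cong (λ z → A ℕ.+ suc n ℕ.* z) (pascal n j) ⟩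
    suc (suc n) ℕ.* A                                 ∎
    where
    open ≡-Reasoning
    A B : ℕ
    A = suc n C suc j
    B = suc n C suc (suc j)
    expand : ∀ m A B → suc m ℕ.* (A ℕ.+ B) ≡ A ℕ.+ m ℕ.* A ℕ.+ suc m ℕ.* B
    expand = solve-∀
    collect : ∀ A m x y → A ℕ.+ m ℕ.* x ℕ.+ m ℕ.* y ≡ A ℕ.+ m ℕ.* (x ℕ.+ y)
    collect = solve-∀

  prime∣binomial : ∀ {p} → Prime p → ∀ k → 0 ℕ.< k → k ℕ.< p → p ∣ (p C k)
  prime∣binomial {suc n} pp (suc j) _ lt
    with euclidsLemma (suc j) (suc n C suc j) pp (divides (n C j) (trans (absorption n j) (ℕP.*-comm (suc n) (n C j))))
  ... | inj₂ d = d
  ... | inj₁ d = ⊥-elim (ℕP.<⇒≱ lt (∣⇒≤ d))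

module Frobenius (F : FiniteField) (p : ℕ) (p-prime : Prime p) (char : FiniteField.ofℕ F p ≡ FiniteField.0# F) where
  open import Data.Nat as ℕ using (ℕ; zero; suc)
  import Data.Nat.Properties as ℕP
  open import Data.Nat.Combinatorics using (_C_; nCn≡1)
  open import Data.Nat.Divisibility using (divides)
  open import Data.Nat.Primality using (¬prime[0])
  open import Data.Fin using (Fin; zero; suc; toℕ; fromℕ)
  import Data.Fin.Properties as FinP
  import Data.Vec.Functional as Vec
  open import Data.Integer using () renaming (+_ to pos)
  open import Data.Empty using (⊥-elim)
  open import Relation.Binary.PropositionalEquality
  open import Level using (0ℓ)
  open import Algebra.Bundles using (CommutativeRing; CommutativeSemiring; Semiring)
  import Algebra.Properties.CommutativeSemiring.Binomial as Binomial-Theorem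
  import Algebra.Properties.Semiring.Exp as Exponentiation
  import Algebra.Properties.Semiring.Mult as Multiples
  open Field F
  open ≡-Reasoning

  private
    semiring : Semiring 0ℓ 0ℓ
    semiring = CommutativeSemiring.semiring (CommutativeRing.commutativeSemiring commutativeRing)
    module Binom = Binomial-Theorem (CommutativeRing.commutativeSemiring commutativeRing)
    module Exp = Exponentiation semiring
    module Mult = Multiples semiring

    exp≡ : ∀ x n → x Exp.^ n ≡ x ^ n
    exp≡ x zero = refl
    exp≡ x (suc n) = cong (x *_) (exp≡ x n)

    mult≡ : ∀ n z → n Mult.× z ≡ ofℕ n * z
    mult≡ zero z = sym (zeroˡ z)
    mult≡ (suc n) z = trans (cong (z +_) (mult≡ n z))
      (trans (cong (_+ ofℕ n * z) (sym (*-identityˡ z))) (sym (distribʳ z 1# (ofℕ n))))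

    sum-last : ∀ m (g : Fin (suc m) → Carrier) → (∀ i → toℕ i ℕ.< m → g i ≡ 0#) → Vec.foldr _+_ 0# g ≡ g (fromℕ m)
    sum-last zero g h = +-identityʳ _
    sum-last (suc m) g h = trans (cong (_+ Vec.foldr _+_ 0# (λ i → g (suc i))) (h zero (ℕ.s≤s ℕ.z≤n)))
      (trans (+-identityˡ _) (sum-last m (λ i → g (suc i)) (λ i lt → h (suc i) (ℕ.s≤s lt))))

    binomial≡0 : ∀ k → 0 ℕ.< k → k ℕ.< p → ofℕ (p C k) ≡ 0#
    binomial≡0 k lo hi with Binomial.prime∣binomial p-prime k lo hi
    ... | divides m e = trans (cong ofℕ e) (trans (ofℕ-* m p) (trans (cong (ofℕ m *_) char) (zeroʳ _)))

    -- (x + y) ^ (1 + n) when 1 + n = p: only the outer binomial terms survive.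
    dream : ∀ n → suc n ≡ p → ∀ x y → (x + y) ^ suc n ≡ x ^ suc n + y ^ suc n
    dream n n+1≡p x y = begin
      (x + y) ^ suc n                                       ≡⟨ sym (exp≡ (x + y) (suc n)) ⟩
      (x + y) Exp.^ suc n                                   ≡⟨ Binom.theorem (suc n) x y ⟩
      term zero + Vec.foldr _+_ 0# (λ i → term (suc i))     ≡⟨ cong (term zero +_) (sum-last n (λ i → term (suc i)) middle) ⟩
      term zero + term (suc (fromℕ n))                      ≡⟨ cong₂ _+_ first last ⟩
      y ^ suc n + x ^ suc n                                 ≡⟨ +-comm _ _ ⟩
      x ^ suc n + y ^ suc n                                 ∎
      where
      monomial : ℕ → Carrier
      monomial k = x Exp.^ k * y Exp.^ (suc n ℕ.∸ k)
      term : Fin (suc (suc n)) → Carrier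
      term k = (suc n C toℕ k) Mult.× monomial (toℕ k)
      term≡ : ∀ k → term k ≡ ofℕ (suc n C toℕ k) * monomial (toℕ k)
      term≡ k = mult≡ (suc n C toℕ k) (monomial (toℕ k))
      middle : ∀ i → toℕ i ℕ.< n → term (suc i) ≡ 0#
      middle i lt = begin
        term (suc i)                                     ≡⟨ term≡ (suc i) ⟩
        ofℕ (suc n C suc (toℕ i)) * monomial (suc (toℕ i)) ≡⟨ cong (λ m → ofℕ (m C suc (toℕ i)) * monomial (suc (toℕ i))) n+1≡p ⟩
        ofℕ (p C suc (toℕ i)) * monomial (suc (toℕ i))   ≡⟨ cong (_* monomial (suc (toℕ i)))
                                                              (binomial≡0 (suc (toℕ i)) (ℕ.s≤s ℕ.z≤n) (subst (suc (toℕ i) ℕ.<_) n+1≡p (ℕ.s≤s lt))) ⟩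
        0# * monomial (suc (toℕ i))                      ≡⟨ zeroˡ _ ⟩
        0#                                               ∎
      first : term zero ≡ y ^ suc n
      first = begin
        term zero                          ≡⟨ term≡ zero ⟩
        ofℕ 1 * (1# * y Exp.^ suc n)       ≡⟨ solve 1 (λ z → (con (pos 1) :+ con (pos 0)) :* (con (pos 1) :* z) := z) refl (y Exp.^ suc n) ⟩
        y Exp.^ suc n                      ≡⟨ exp≡ y (suc n) ⟩
        y ^ suc n                          ∎
      last : term (suc (fromℕ n)) ≡ x ^ suc n
      last = begin
        term (suc (fromℕ n))                                  ≡⟨ term≡ (suc (fromℕ n)) ⟩
        ofℕ (suc n C suc (toℕ (fromℕ n))) * monomial (suc (toℕ (fromℕ n))) ≡⟨ cong (λ m → ofℕ (suc n C suc m) * monomial (suc m)) (FinP.toℕ-fromℕ n) ⟩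
        ofℕ (suc n C suc n) * (x Exp.^ suc n * y Exp.^ (n ℕ.∸ n)) ≡⟨ cong₂ (λ a m → ofℕ a * (x Exp.^ suc n * y Exp.^ m)) (nCn≡1 (suc n)) (ℕP.n∸n≡0 n) ⟩
        ofℕ 1 * (x Exp.^ suc n * 1#)                          ≡⟨ solve 1 (λ z → (con (pos 1) :+ con (pos 0)) :* (z :* con (pos 1)) := z) refl (x Exp.^ suc n) ⟩
        x Exp.^ suc n                                         ≡⟨ exp≡ x (suc n) ⟩
        x ^ suc n                                             ∎

  frobenius-p : ∀ x y → (x + y) ^ p ≡ x ^ p + y ^ p
  frobenius-p x y = at p refl
    where
    at : ∀ n → n ≡ p → (x + y) ^ n ≡ x ^ n + y ^ n
    at zero 0≡p = ⊥-elim (¬prime[0] (subst Prime (sym 0≡p) p-prime))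
    at (suc n) n+1≡p = dream n n+1≡p x y

  frobenius : ∀ r x y → (x + y) ^ (p ℕ.^ r) ≡ x ^ (p ℕ.^ r) + y ^ (p ℕ.^ r)
  frobenius zero x y = trans (*-identityʳ _) (sym (cong₂ _+_ (*-identityʳ x) (*-identityʳ y)))
  frobenius (suc r) x y = begin
    (x + y) ^ (p ℕ.* p ℕ.^ r)                     ≡⟨ ^-* (x + y) p (p ℕ.^ r) ⟩
    ((x + y) ^ p) ^ (p ℕ.^ r)                     ≡⟨ cong (_^ (p ℕ.^ r)) (frobenius-p x y) ⟩
    (x ^ p + y ^ p) ^ (p ℕ.^ r)                   ≡⟨ frobenius r (x ^ p) (y ^ p) ⟩
    (x ^ p) ^ (p ℕ.^ r) + (y ^ p) ^ (p ℕ.^ r)     ≡⟨ sym (cong₂ _+_ (^-* x p (p ℕ.^ r)) (^-* y p (p ℕ.^ r))) ⟩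
    x ^ (p ℕ.* p ℕ.^ r) + y ^ (p ℕ.* p ℕ.^ r)     ∎

-- A nonzero polynomial of degree n has at most n roots; we only need it
-- for x ^ (m + 2) - x, so monic polynomials suffice.
module RootBound (F : FiniteField) where
  open import Data.Nat using (ℕ; zero; suc; _≤_; z≤n; s≤s)
  open import Data.List using (List; []; _∷_; length)
  open import Data.List.Membership.Propositional using (_∈_)
  open import Data.List.Relation.Unary.Unique.Propositional using (Unique)
  open import Data.List.Relation.Unary.AllPairs using (_∷_)
  import Data.List.Relation.Unary.All as All
  open import Data.List.Relation.Unary.Any using (here; there)
  open import Data.Integer using () renaming (+_ to pos)
  open import Data.Unit using (⊤; tt)
  open import Data.Product using (_×_; _,_)
  open import Data.Sum using (inj₁; inj₂)
  open import Data.Empty using (⊥-elim)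
  open import Relation.Binary.PropositionalEquality
  open Field F
  open ≡-Reasoning

  -- A monic polynomial of degree n, by its n lower coefficients.
  Monic : ℕ → Set
  Monic zero = ⊤
  Monic (suc n) = Carrier × Monic n

  eval : ∀ {n} → Monic n → Carrier → Carrier
  eval {zero} _ x = 1#
  eval {suc n} (c , f) x = c + x * eval f x

  _÷_ : ∀ {n} → Monic (suc n) → Carrier → Monic n
  _÷_ {zero} _ r = tt
  _÷_ {suc n} (c , f) r = eval f r , f ÷ r

  division : ∀ {n} (f : Monic (suc n)) r x → eval f x ≡ (x - r) * eval (f ÷ r) x + eval f r
  division {zero} (c , tt) r x =
    solve 3 (λ c r x → c :+ x :* con (pos 1) := (x :- r) :* con (pos 1) :+ (c :+ r :* con (pos 1))) refl c r x
  division {suc n} (c , g) r x = begin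
    c + x * eval g x                                         ≡⟨ cong (λ z → c + x * z) (division g r x) ⟩
    c + x * ((x - r) * eval (g ÷ r) x + eval g r)            ≡⟨ solve 5 (λ c x r Q G → c :+ x :* ((x :- r) :* Q :+ G) := (x :- r) :* (G :+ x :* Q) :+ (c :+ r :* G))
                                                                  refl c x r (eval (g ÷ r) x) (eval g r) ⟩
    (x - r) * (eval g r + x * eval (g ÷ r) x) + (c + r * eval g r) ∎

  root-bound : ∀ n (f : Monic n) (l : List Carrier) → Unique l → (∀ {y} → y ∈ l → eval f y ≡ 0#) → length l ≤ n
  root-bound zero f [] u h = z≤n
  root-bound zero f (y ∷ l) u h = ⊥-elim (1≢0 (h (here refl)))
  root-bound (suc n) f [] u h = z≤n
  root-bound (suc n) f (r ∷ l) (r∉l ∷ u) h = s≤s (root-bound n (f ÷ r) l u quotient-root)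
    where
    quotient-root : ∀ {y} → y ∈ l → eval (f ÷ r) y ≡ 0#
    quotient-root {y} i with zero-divisor (y - r) (eval (f ÷ r) y) (begin
      (y - r) * eval (f ÷ r) y             ≡⟨ sym (+-identityʳ _) ⟩
      (y - r) * eval (f ÷ r) y + 0#        ≡⟨ cong ((y - r) * eval (f ÷ r) y +_) (sym (h (here refl))) ⟩
      (y - r) * eval (f ÷ r) y + eval f r  ≡⟨ sym (division f r y) ⟩
      eval f y                             ≡⟨ h (there i) ⟩
      0#                                   ∎)
    ... | inj₁ z = ⊥-elim (All.lookup r∉l i (sym (sub≡0⇒≡ z)))
    ... | inj₂ z = z

  private
    zeros : ∀ n → Monic n
    zeros zero = tt
    zeros (suc n) = 0# , zeros n

  power-minus-x : ∀ m → Monic (suc (suc m))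
  power-minus-x m = 0# , (- 1#) , zeros m

  eval-power-minus-x : ∀ m x → eval (power-minus-x m) x ≡ x ^ suc (suc m) - x
  eval-power-minus-x m x = begin
    0# + x * (- 1# + x * eval (zeros m) x)    ≡⟨ cong (λ z → 0# + x * (- 1# + x * z)) (eval-zeros m) ⟩
    0# + x * (- 1# + x * x ^ m)               ≡⟨ solve 2 (λ x p → con (pos 0) :+ x :* (:- con (pos 1) :+ x :* p) := x :* (x :* p) :- x) refl x (x ^ m) ⟩
    x * (x * x ^ m) - x                       ∎
    where
    eval-zeros : ∀ n → eval (zeros n) x ≡ x ^ n
    eval-zeros zero = refl
    eval-zeros (suc n) = trans (+-identityˡ _) (cong (x *_) (eval-zeros n))

-- The cubic x³ - a x² + u x - b over a field K: a cubic is irreducible in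
-- K[x] exactly when it has no root in K (a factorisation of a cubic has a
-- factor of degree 0 or 1, and a linear factor has a root).
module Cubic (K : FiniteField) where
  open import Data.Nat as ℕ using (ℕ; zero; suc; _<_; s≤s; z≤n)
  import Data.Nat.Properties as ℕP
  open import Data.List using ([]; _∷_; map)
  open import Data.Sum using (_⊎_; inj₁; inj₂)
  open import Data.Integer using () renaming (+_ to pos)
  open import Data.Product using (_×_; _,_; proj₁; proj₂; Σ)
  open import Data.Empty using (⊥; ⊥-elim)
  open import Relation.Nullary using (¬_; Dec; yes; no)
  open import Relation.Binary using (tri<; tri≈; tri>)
  open import Relation.Binary.PropositionalEquality
  open Field K
  open Poly K
  open ≡-Reasoning

  cub : Carrier → Carrier → Carrier → Carrier → Carrier
  cub a u b x = x * x * x - a * (x * x) + u * x - b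

  Root : Carrier → Carrier → Carrier → Carrier → Set
  Root a u b x = cub a u b x ≡ 0#

  HasRoot : Carrier → Carrier → Carrier → Set
  HasRoot a u b = Σ Carrier (Root a u b)

  hasRoot? : ∀ a u b → Dec (HasRoot a u b)
  hasRoot? a u b = Counting.search (FiniteFieldFacts.enum K) (λ x → cub a u b x ≟ 0#)

  eval : Pol → Carrier → Carrier
  eval [] x = 0#
  eval (c ∷ f) x = c + x * eval f x

  eval-addP : ∀ f g x → eval (addP f g) x ≡ eval f x + eval g x
  eval-addP [] g x = sym (+-identityˡ _)
  eval-addP (c ∷ f) [] x = sym (+-identityʳ _)
  eval-addP (c ∷ f) (d ∷ g) x = begin
    (c + d) + x * eval (addP f g) x             ≡⟨ cong (λ z → (c + d) + x * z) (eval-addP f g x) ⟩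
    (c + d) + x * (eval f x + eval g x)         ≡⟨ solve 5 (λ c d x F G → (c :+ d) :+ x :* (F :+ G) := (c :+ x :* F) :+ (d :+ x :* G))
                                                       refl c d x (eval f x) (eval g x) ⟩
    (c + x * eval f x) + (d + x * eval g x)     ∎

  eval-scale : ∀ c g x → eval (map (c *_) g) x ≡ c * eval g x
  eval-scale c [] x = sym (zeroʳ c)
  eval-scale c (d ∷ g) x = begin
    c * d + x * eval (map (c *_) g) x           ≡⟨ cong (λ z → c * d + x * z) (eval-scale c g x) ⟩
    c * d + x * (c * eval g x)                  ≡⟨ solve 4 (λ c d x G → c :* d :+ x :* (c :* G) := c :* (d :+ x :* G)) refl c d x (eval g x) ⟩
    c * (d + x * eval g x)                      ∎

  eval-mulP : ∀ g h x → eval (mulP g h) x ≡ eval g x * eval h x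
  eval-mulP [] h x = sym (zeroˡ _)
  eval-mulP (c ∷ g) h x = begin
    eval (addP (map (c *_) h) (0# ∷ mulP g h)) x              ≡⟨ eval-addP (map (c *_) h) (0# ∷ mulP g h) x ⟩
    eval (map (c *_) h) x + (0# + x * eval (mulP g h) x)      ≡⟨ cong₂ (λ z w → z + (0# + x * w)) (eval-scale c h x) (eval-mulP g h x) ⟩
    c * eval h x + (0# + x * (eval g x * eval h x))           ≡⟨ solve 4 (λ c H x G → c :* H :+ (con (pos 0) :+ x :* (G :* H)) := (c :+ x :* G) :* H)
                                                                     refl c (eval h x) x (eval g x) ⟩
    (c + x * eval g x) * eval h x                             ∎

  AllZero : Pol → Set
  AllZero g = ∀ n → coeff g n ≡ 0#

  eval-zero : ∀ g x → AllZero g → eval g x ≡ 0#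
  eval-zero [] x z = refl
  eval-zero (c ∷ g) x z = begin
    c + x * eval g x       ≡⟨ cong₂ (λ a b → a + x * b) (z 0) (eval-zero g x (λ n → z (suc n))) ⟩
    0# + x * 0#            ≡⟨ solve 1 (λ x → con (pos 0) :+ x :* con (pos 0) := con (pos 0)) refl x ⟩
    0#                     ∎

  eval-≃ : ∀ f g x → f ≃ g → eval f x ≡ eval g x
  eval-≃ [] g x e = sym (eval-zero g x (λ n → sym (e n)))
  eval-≃ (c ∷ f) [] x e = eval-zero (c ∷ f) x e
  eval-≃ (c ∷ f) (d ∷ g) x e = cong₂ (λ a b → a + x * b) (e 0) (eval-≃ f g x (λ n → e (suc n)))

  eval-cubic : ∀ a u b x → eval (cubic a u b) x ≡ cub a u b x
  eval-cubic = solve 4 (λ a u b x → (:- b) :+ x :* (u :+ x :* ((:- a) :+ x :* (con (pos 1) :+ x :* con (pos 0))))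
                                     := x :* x :* x :- a :* (x :* x) :+ u :* x :- b) refl

  private
    coeff-addP : ∀ f g n → coeff (addP f g) n ≡ coeff f n + coeff g n
    coeff-addP [] g n = sym (+-identityˡ _)
    coeff-addP (c ∷ f) [] n = sym (+-identityʳ _)
    coeff-addP (c ∷ f) (d ∷ g) zero = refl
    coeff-addP (c ∷ f) (d ∷ g) (suc n) = coeff-addP f g n

    coeff-scale : ∀ c g n → coeff (map (c *_) g) n ≡ c * coeff g n
    coeff-scale c [] n = sym (zeroʳ c)
    coeff-scale c (d ∷ g) zero = refl
    coeff-scale c (d ∷ g) (suc n) = coeff-scale c g n

  coeff-mulP : ∀ c g h n → coeff (mulP (c ∷ g) h) n ≡ c * coeff h n + coeff (0# ∷ mulP g h) n
  coeff-mulP c g h n = trans (coeff-addP (map (c *_) h) (0# ∷ mulP g h) n)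
                             (cong (_+ coeff (0# ∷ mulP g h) n) (coeff-scale c h n))

  mulP-zeroˡ : ∀ g h → AllZero g → AllZero (mulP g h)
  mulP-zeroˡ [] h z n = refl
  mulP-zeroˡ (c ∷ g) h z n = begin
    coeff (mulP (c ∷ g) h) n                       ≡⟨ coeff-mulP c g h n ⟩
    c * coeff h n + coeff (0# ∷ mulP g h) n        ≡⟨ cong (λ w → w * coeff h n + coeff (0# ∷ mulP g h) n) (z 0) ⟩
    0# * coeff h n + coeff (0# ∷ mulP g h) n       ≡⟨ cong (_+ coeff (0# ∷ mulP g h) n) (zeroˡ _) ⟩
    0# + coeff (0# ∷ mulP g h) n                   ≡⟨ +-identityˡ _ ⟩
    coeff (0# ∷ mulP g h) n                        ≡⟨ shifted n ⟩
    0#                                             ∎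
    where
    shifted : ∀ n → coeff (0# ∷ mulP g h) n ≡ 0#
    shifted zero = refl
    shifted (suc n) = mulP-zeroˡ g h (λ i → z (suc i)) n

  mulP-zeroʳ : ∀ g h → AllZero h → AllZero (mulP g h)
  mulP-zeroʳ [] h z n = refl
  mulP-zeroʳ (c ∷ g) h z n = begin
    coeff (mulP (c ∷ g) h) n                       ≡⟨ coeff-mulP c g h n ⟩
    c * coeff h n + coeff (0# ∷ mulP g h) n        ≡⟨ cong (λ w → c * w + coeff (0# ∷ mulP g h) n) (z n) ⟩
    c * 0# + coeff (0# ∷ mulP g h) n               ≡⟨ cong (_+ coeff (0# ∷ mulP g h) n) (zeroʳ c) ⟩
    0# + coeff (0# ∷ mulP g h) n                   ≡⟨ +-identityˡ _ ⟩
    coeff (0# ∷ mulP g h) n                        ≡⟨ shifted n ⟩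
    0#                                             ∎
    where
    shifted : ∀ n → coeff (0# ∷ mulP g h) n ≡ 0#
    shifted zero = refl
    shifted (suc n) = mulP-zeroʳ g h z n

  Degree : Pol → ℕ → Set
  Degree g m = (coeff g m ≢ 0#) × (∀ i → m < i → coeff g i ≡ 0#)

  degree? : ∀ g → AllZero g ⊎ Σ ℕ (Degree g)
  degree? [] = inj₁ (λ n → refl)
  degree? (c ∷ g) with degree? g
  ... | inj₂ (m , nz , above) = inj₂ (suc m , nz , λ { zero () ; (suc i) (s≤s lt) → above i lt })
  ... | inj₁ z with c ≟ 0#
  ...   | yes c0 = inj₁ (λ { zero → c0 ; (suc n) → z n })
  ...   | no nc = inj₂ (0 , nc , λ { zero () ; (suc i) _ → z i })

  degree-unique : ∀ g m n → Degree g m → Degree g n → m ≡ n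
  degree-unique g m n (nzm , abm) (nzn , abn) with ℕP.<-cmp m n
  ... | tri< lt _ _ = ⊥-elim (nzn (abm n lt))
  ... | tri≈ _ e _ = e
  ... | tri> _ _ gt = ⊥-elim (nzm (abn m gt))

  degree-≃ : ∀ f g m → f ≃ g → Degree f m → Degree g m
  degree-≃ f g m e (nz , ab) = (λ z → nz (trans (e m) z)) , (λ i lt → trans (sym (e i)) (ab i lt))

  -- deg (g h) = deg g + deg h, since K has no zero divisors.
  degree-mul : ∀ g h m k → Degree g m → Degree h k → Degree (mulP g h) (m ℕ.+ k)
  degree-mul [] h m k (nz , _) _ = ⊥-elim (nz refl)
  degree-mul (c ∷ g) h zero k (nz , ab) (nzh , abh) = top , above
    where
    rest : ∀ n → coeff (0# ∷ mulP g h) n ≡ 0#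
    rest zero = refl
    rest (suc n) = mulP-zeroˡ g h (λ i → ab (suc i) (s≤s z≤n)) n
    scaled : ∀ n → coeff (mulP (c ∷ g) h) n ≡ c * coeff h n
    scaled n = trans (coeff-mulP c g h n) (trans (cong (c * coeff h n +_) (rest n)) (+-identityʳ _))
    top : coeff (mulP (c ∷ g) h) k ≢ 0#
    top e = mul-nz nz nzh (trans (sym (scaled k)) e)
    above : ∀ i → k < i → coeff (mulP (c ∷ g) h) i ≡ 0#
    above i lt = trans (scaled i) (trans (cong (c *_) (abh i lt)) (zeroʳ c))
  degree-mul (c ∷ g) h (suc m) k (nz , ab) dh@(nzh , abh) = top , above
    where
    dgh : Degree (mulP g h) (m ℕ.+ k)
    dgh = degree-mul g h m k (nz , λ i lt → ab (suc i) (s≤s lt)) dh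
    shifted : ∀ n → k < suc n → coeff (mulP (c ∷ g) h) (suc n) ≡ coeff (mulP g h) n
    shifted n lt = trans (coeff-mulP c g h (suc n))
      (trans (cong (_+ coeff (mulP g h) n) (trans (cong (c *_) (abh (suc n) lt)) (zeroʳ c))) (+-identityˡ _))
    k<1+n : ∀ n → m ℕ.+ k ℕ.≤ n → k < suc n
    k<1+n n le = s≤s (ℕP.≤-trans (ℕP.m≤n+m k m) le)
    top : coeff (mulP (c ∷ g) h) (suc (m ℕ.+ k)) ≢ 0#
    top e = proj₁ dgh (trans (sym (shifted (m ℕ.+ k) (k<1+n _ ℕP.≤-refl))) e)
    above : ∀ i → suc (m ℕ.+ k) < i → coeff (mulP (c ∷ g) h) i ≡ 0#
    above zero ()
    above (suc i) (s≤s lt) = trans (shifted i (k<1+n i (ℕP.<⇒≤ lt))) (proj₂ dgh i lt)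

  degree-cubic : ∀ a u b → Degree (cubic a u b) 3
  degree-cubic a u b = (λ e → 1≢0 e) ,
    λ { 0 () ; 1 (s≤s ()) ; 2 (s≤s (s≤s ())) ; 3 (s≤s (s≤s (s≤s ()))) ; (suc (suc (suc (suc i)))) _ → refl }

  linear-root : ∀ g → Degree g 1 → Σ Carrier λ x → eval g x ≡ 0#
  linear-root g (nz , ab) = x₀ , (begin
    eval g x₀                        ≡⟨ eval-≃ g (g₀ ∷ g₁ ∷ []) x₀ linear ⟩
    g₀ + x₀ * (g₁ + x₀ * 0#)         ≡⟨ solve 3 (λ g₀ g₁ i → g₀ :+ (:- (g₀ :* i)) :* (g₁ :+ (:- (g₀ :* i)) :* con (pos 0)) := g₀ :- g₀ :* (i :* g₁))
                                           refl g₀ g₁ (g₁ ⁻¹) ⟩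
    g₀ - g₀ * (g₁ ⁻¹ * g₁)           ≡⟨ cong (λ w → g₀ - g₀ * w) (inverseˡ g₁ nz) ⟩
    g₀ - g₀ * 1#                     ≡⟨ cong (λ w → g₀ - w) (*-identityʳ g₀) ⟩
    g₀ - g₀                          ≡⟨ sub-self g₀ ⟩
    0#                               ∎)
    where
    g₀ g₁ x₀ : Carrier
    g₀ = coeff g 0
    g₁ = coeff g 1
    x₀ = - (g₀ * g₁ ⁻¹)
    linear : g ≃ (g₀ ∷ g₁ ∷ [])
    linear zero = refl
    linear (suc zero) = refl
    linear (suc (suc n)) = ab (suc (suc n)) (s≤s (s≤s z≤n))

  factor-at-root : ∀ a u b r → cub a u b r ≡ 0# →
    cubic a u b ≃ mulP ((- r) ∷ 1# ∷ []) ((r * r - a * r + u) ∷ (r - a) ∷ 1# ∷ [])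
  factor-at-root a u b r e = λ
    { zero → trans (cong -_ b≡) (solve 3 (λ r a u → :- (r :* r :* r :- a :* (r :* r) :+ u :* r) := (:- r) :* (r :* r :- a :* r :+ u) :+ con (pos 0)) refl r a u)
    ; (suc zero) → solve 3 (λ r a u → u := (:- r) :* (r :- a) :+ (con (pos 1) :* (r :* r :- a :* r :+ u) :+ con (pos 0))) refl r a u
    ; (suc (suc zero)) → solve 2 (λ r a → :- a := (:- r) :* con (pos 1) :+ con (pos 1) :* (r :- a)) refl r a
    ; (suc (suc (suc zero))) → sym (*-identityˡ 1#)
    ; (suc (suc (suc (suc n)))) → refl }
    where
    b≡ : b ≡ r * r * r - a * (r * r) + u * r
    b≡ = sym (sub≡0⇒≡ e)

  irreducible⇒no-root : ∀ a u b → Irreducible (cubic a u b) → ¬ HasRoot a u b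
  irreducible⇒no-root a u b (_ , _ , factors) (r , e)
    with factors ((- r) ∷ 1# ∷ []) ((r * r - a * r + u) ∷ (r - a) ∷ 1# ∷ []) (factor-at-root a u b r e)
  ... | inj₁ (_ , z) = 1≢0 (z 0)
  ... | inj₂ (_ , z) = 1≢0 (z 1)

  no-root⇒irreducible : ∀ a u b → ¬ HasRoot a u b → Irreducible (cubic a u b)
  no-root⇒irreducible a u b no-root = (λ e → 1≢0 (e 3)) , (λ { (_ , z) → 1≢0 (z 2) }) , factors
    where
    f : Pol
    f = cubic a u b
    no-factor-root : ∀ g h → f ≃ mulP g h → ∀ x → eval g x ≡ 0# ⊎ eval h x ≡ 0# → ⊥
    no-factor-root g h e x vanishes = no-root (x , (begin
      cub a u b x                ≡⟨ sym (eval-cubic a u b x) ⟩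
      eval f x                   ≡⟨ eval-≃ f (mulP g h) x e ⟩
      eval (mulP g h) x          ≡⟨ eval-mulP g h x ⟩
      eval g x * eval h x        ≡⟨ product-zero vanishes ⟩
      0#                         ∎))
      where
      product-zero : eval g x ≡ 0# ⊎ eval h x ≡ 0# → eval g x * eval h x ≡ 0#
      product-zero (inj₁ z) = trans (cong (_* eval h x) z) (zeroˡ _)
      product-zero (inj₂ z) = trans (cong (eval g x *_) z) (zeroʳ _)
    -- degrees m + k = 3 with no linear factor force m = 0 or k = 0
    by-degree : ∀ g h → f ≃ mulP g h → ∀ m k → Degree g m → Degree h k → m ℕ.+ k ≡ 3 → IsUnit g ⊎ IsUnit h
    by-degree g h e zero k (nz , ab) dh _ = inj₁ (nz , λ n → ab (suc n) (s≤s z≤n))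
    by-degree g h e (suc zero) k dg dh _ =
      ⊥-elim (no-factor-root g h e (proj₁ (linear-root g dg)) (inj₁ (proj₂ (linear-root g dg))))
    by-degree g h e (suc (suc zero)) (suc zero) dg dh _ =
      ⊥-elim (no-factor-root g h e (proj₁ (linear-root h dh)) (inj₂ (proj₂ (linear-root h dh))))
    by-degree g h e (suc (suc (suc zero))) zero dg (nz , ab) _ = inj₂ (nz , λ n → ab (suc n) (s≤s z≤n))
    by-degree g h e (suc (suc zero)) zero _ _ ()
    by-degree g h e (suc (suc zero)) (suc (suc k)) _ _ ()
    by-degree g h e (suc (suc (suc zero))) (suc k) _ _ ()
    by-degree g h e (suc (suc (suc (suc m)))) k _ _ ()
    factors : ∀ g h → f ≃ mulP g h → IsUnit g ⊎ IsUnit h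
    factors g h e with degree? g | degree? h
    ... | inj₁ gz | _ = ⊥-elim (1≢0 (trans (e 3) (mulP-zeroˡ g h gz 3)))
    ... | inj₂ _ | inj₁ hz = ⊥-elim (1≢0 (trans (e 3) (mulP-zeroʳ g h hz 3)))
    ... | inj₂ (m , dg) | inj₂ (k , dh) = by-degree g h e m k dg dh
      (degree-unique (mulP g h) (m ℕ.+ k) 3 (degree-mul g h m k dg dh) (degree-≃ f (mulP g h) 3 e (degree-cubic a u b)))

-- Besides the
-- roots we count
--   * ordered pairs (x , y) such that (x , y , a - x - y) are the roots
--     with multiplicity, i.e. the cubic is (t - x)(t - y)(t - (a - x - y)),
--   * triple roots t, i.e. the cubic is (t' - t)³.
-- The main result 'profile' is 3·[no root] + 3·#roots + #triple = #pairs + 3,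
-- checked case by case on how the cubic splits.
module Splitting (K : FiniteField) where
  open import Data.Nat as ℕ using (ℕ)
  open import Data.List using (List; []; _∷_)
  open import Data.List.Membership.Propositional using (_∈_)
  open import Data.List.Relation.Unary.Any using (here; there)
  open import Data.List.Relation.Unary.All as All using ([]; _∷_)
  open import Data.List.Relation.Unary.AllPairs using ([]; _∷_)
  open import Data.Integer using () renaming (+_ to pos)
  open import Data.Sum using (_⊎_; inj₁; inj₂)
  open import Data.Product using (_×_; _,_; proj₁; proj₂; Σ)
  open import Data.Unit using (⊤; tt)
  open import Data.Empty using (⊥; ⊥-elim)
  open import Relation.Nullary using (¬_; Dec; yes; no)
  open import Relation.Binary.PropositionalEquality
  open Field K
  open Cubic K
  open Counting
  open ≡-Reasoning

  three : Carrier
  three = numeral 3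

  Vieta : Carrier → Carrier → Carrier → Carrier → Carrier → Carrier → Set
  Vieta A U B r s w = (A ≡ r + s + w) × (U ≡ r * s + r * w + s * w) × (B ≡ r * s * w)

  vieta-factor : ∀ {A U B r s w} → Vieta A U B r s w → ∀ x → cub A U B x ≡ (x - r) * (x - s) * (x - w)
  vieta-factor {r = r} {s} {w} (refl , refl , refl) =
    solve 4 (λ r s w x → x :* x :* x :- (r :+ s :+ w) :* (x :* x) :+ (r :* s :+ r :* w :+ s :* w) :* x :- r :* s :* w
                         := (x :- r) :* (x :- s) :* (x :- w)) refl r s w

  roots : Carrier → Carrier → Carrier → List Carrier
  roots r s w = r ∷ s ∷ w ∷ []

  vieta-roots : ∀ {A U B r s w} → Vieta A U B r s w → ∀ x → Root A U B x → x ∈ roots r s w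
  vieta-roots v x e with zero-divisor₃ _ _ _ (trans (sym (vieta-factor v x)) e)
  ... | inj₁ z = here (sub≡0⇒≡ z)
  ... | inj₂ (inj₁ z) = there (here (sub≡0⇒≡ z))
  ... | inj₂ (inj₂ z) = there (there (here (sub≡0⇒≡ z)))

  roots-vieta : ∀ {A U B r s w} → Vieta A U B r s w → ∀ x → x ∈ roots r s w → Root A U B x
  roots-vieta {r = r} {s} {w} v x i = trans (vieta-factor v x) (vanish i)
    where
    vanish : x ∈ roots r s w → (x - r) * (x - s) * (x - w) ≡ 0#
    vanish (here refl) = solve 3 (λ x s w → (x :- x) :* (x :- s) :* (x :- w) := con (pos 0)) refl x s w
    vanish (there (here refl)) = solve 3 (λ x r w → (x :- r) :* (x :- x) :* (x :- w) := con (pos 0)) refl x r w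
    vanish (there (there (here refl))) = solve 3 (λ x r s → (x :- r) :* (x :- s) :* (x :- x) := con (pos 0)) refl x r s

  vieta-swap₁₂ : ∀ {A U B r s w} → Vieta A U B r s w → Vieta A U B s r w
  vieta-swap₁₂ {r = r} {s} {w} (ea , eu , eb) =
    trans ea (solve 3 (λ r s w → r :+ s :+ w := s :+ r :+ w) refl r s w) ,
    trans eu (solve 3 (λ r s w → r :* s :+ r :* w :+ s :* w := s :* r :+ s :* w :+ r :* w) refl r s w) ,
    trans eb (solve 3 (λ r s w → r :* s :* w := s :* r :* w) refl r s w)

  vieta-swap₂₃ : ∀ {A U B r s w} → Vieta A U B r s w → Vieta A U B r w s
  vieta-swap₂₃ {r = r} {s} {w} (ea , eu , eb) =
    trans ea (solve 3 (λ r s w → r :+ s :+ w := r :+ w :+ s) refl r s w) ,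
    trans eu (solve 3 (λ r s w → r :* s :+ r :* w :+ s :* w := r :* w :+ r :* s :+ w :* s) refl r s w) ,
    trans eb (solve 3 (λ r s w → r :* s :* w := r :* w :* s) refl r s w)

  σ₂ : Carrier → Carrier → Carrier → Carrier
  σ₂ A x y = x * y + (x + y) * (A - x - y)

  RootPair : Carrier → Carrier → Carrier → Carrier × Carrier → Set
  RootPair A U B (x , y) = (x * y * (A - x - y) ≡ B) × (σ₂ A x y ≡ U)

  TripleRoot : Carrier → Carrier → Carrier → Carrier → Set
  TripleRoot A U B t = (three * t ≡ A) × (t * t * t ≡ B) × (three * (t * t) ≡ U)

  vieta⇒pair : ∀ {A U B x y z} → Vieta A U B x y z → RootPair A U B (x , y)
  vieta⇒pair {x = x} {y} {z} (refl , refl , refl) =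
    solve 3 (λ x y z → x :* y :* (x :+ y :+ z :- x :- y) := x :* y :* z) refl x y z ,
    solve 3 (λ x y z → x :* y :+ (x :+ y) :* (x :+ y :+ z :- x :- y) := x :* y :+ x :* z :+ y :* z) refl x y z

  pair⇒vieta : ∀ {A U B x y} → RootPair A U B (x , y) → Vieta A U B x y (A - x - y)
  pair⇒vieta {A} {x = x} {y} (refl , refl) =
    solve 3 (λ A x y → A := x :+ y :+ (A :- x :- y)) refl A x y ,
    solve 3 (λ A x y → x :* y :+ (x :+ y) :* (A :- x :- y) := x :* y :+ x :* (A :- x :- y) :+ y :* (A :- x :- y)) refl A x y ,
    refl

  triple⇒vieta : ∀ {A U B t} → TripleRoot A U B t → Vieta A U B t t t
  triple⇒vieta {t = t} (refl , refl , refl) =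
    solve 1 (λ t → con (pos 3) :* t := t :+ t :+ t) refl t ,
    solve 1 (λ t → con (pos 3) :* (t :* t) := t :* t :+ t :* t :+ t :* t) refl t ,
    refl

  vieta⇒triple : ∀ {A U B t} → Vieta A U B t t t → TripleRoot A U B t
  vieta⇒triple {t = t} (refl , refl , refl) =
    solve 1 (λ t → con (pos 3) :* t := t :+ t :+ t) refl t , refl ,
    solve 1 (λ t → con (pos 3) :* (t :* t) := t :* t :+ t :* t :+ t :* t) refl t

  vieta-root : ∀ {A U B r s w} → Vieta A U B r s w → Root A U B r
  vieta-root v = roots-vieta v _ (here refl)

  pairs : Carrier → Carrier → Carrier → List (Carrier × Carrier)
  pairs r s w = (r , s) ∷ (s , r) ∷ (r , w) ∷ (w , r) ∷ (s , w) ∷ (w , s) ∷ []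

  pairs-pair : ∀ {A U B r s w} → Vieta A U B r s w → ∀ p → p ∈ pairs r s w → RootPair A U B p
  pairs-pair v p (here refl) = vieta⇒pair v
  pairs-pair v p (there (here refl)) = vieta⇒pair (vieta-swap₁₂ v)
  pairs-pair v p (there (there (here refl))) = vieta⇒pair (vieta-swap₂₃ v)
  pairs-pair v p (there (there (there (here refl)))) = vieta⇒pair (vieta-swap₁₂ (vieta-swap₂₃ v))
  pairs-pair v p (there (there (there (there (here refl))))) = vieta⇒pair (vieta-swap₂₃ (vieta-swap₁₂ v))
  pairs-pair v p (there (there (there (there (there (here refl)))))) = vieta⇒pair (vieta-swap₁₂ (vieta-swap₂₃ (vieta-swap₁₂ v)))

  second-root : ∀ {A U B r s w} → Vieta A U B r s w → ∀ y → RootPair A U B (r , y) → y ≡ s ⊎ y ≡ w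
  second-root {A} {U} {B} {r} {s} {w} v@(refl , refl , refl) y (_ , eu) with zero-divisor (y - s) (y - w) (begin
    (y - s) * (y - w)                                  ≡⟨ solve 4 (λ r s w y → (y :- s) :* (y :- w)
                                                            := (r :* s :+ r :* w :+ s :* w) :- (r :* y :+ (r :+ y) :* ((r :+ s :+ w) :- r :- y))) refl r s w y ⟩
    (r * s + r * w + s * w) - σ₂ (r + s + w) r y      ≡⟨ cong (λ v → (r * s + r * w + s * w) - v) eu ⟩
    (r * s + r * w + s * w) - (r * s + r * w + s * w) ≡⟨ sub-self _ ⟩
    0#                                                 ∎)
  ... | inj₁ z = inj₁ (sub≡0⇒≡ z)
  ... | inj₂ z = inj₂ (sub≡0⇒≡ z)

  pair-pairs : ∀ {A U B r s w} → Vieta A U B r s w → ∀ p → RootPair A U B p → p ∈ pairs r s w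
  pair-pairs {A} {U} {B} v (x , y) h = first v (vieta-roots v x (vieta-root (pair⇒vieta h))) h
    where
    first : ∀ {r s w} → Vieta A U B r s w → x ∈ roots r s w → RootPair A U B (x , y) → (x , y) ∈ pairs r s w
    first v (here refl) h with second-root v y h
    ... | inj₁ refl = here refl
    ... | inj₂ refl = there (there (here refl))
    first v (there (here refl)) h with second-root (vieta-swap₁₂ v) y h
    ... | inj₁ refl = there (here refl)
    ... | inj₂ refl = there (there (there (there (here refl))))
    first v (there (there (here refl))) h with second-root (vieta-swap₁₂ (vieta-swap₂₃ v)) y h
    ... | inj₁ refl = there (there (there (here refl)))
    ... | inj₂ refl = there (there (there (there (there (here refl)))))

  record Profile (A U B : Carrier) (k e R : ℕ) : Set where
    field
      #roots   : IsCount (Root A U B) k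
      #triples : IsCount (TripleRoot A U B) e
      #pairs   : IsCount (RootPair A U B) R

  private
    ∈-constant : ∀ {A : Set} {a x : A} {l} → All.All (_≡ a) l → x ∈ l → x ≡ a
    ∈-constant all i = All.lookup all i

    triple-equal : ∀ {A U B r s w t} → Vieta A U B r s w → TripleRoot A U B t → r ≡ t × s ≡ t
    triple-equal v tr =
      ∈-constant (refl ∷ refl ∷ refl ∷ []) (vieta-roots (triple⇒vieta tr) _ (roots-vieta v _ (here refl))) ,
      ∈-constant (refl ∷ refl ∷ refl ∷ []) (vieta-roots (triple⇒vieta tr) _ (roots-vieta v _ (there (here refl))))

    ≢-fst : ∀ {a b c d : Carrier} → a ≢ c → (a , b) ≢ (c , d)
    ≢-fst n e = n (cong proj₁ e)
    ≢-snd : ∀ {a b c d : Carrier} → b ≢ d → (a , b) ≢ (c , d)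
    ≢-snd n e = n (cong proj₂ e)

  profile-distinct : ∀ {A U B r s w} → Vieta A U B r s w → r ≢ s → r ≢ w → s ≢ w → Profile A U B 3 0 6
  profile-distinct v rs rw sw = record
    { #roots = count-list (roots _ _ _) ((rs ∷ rw ∷ []) ∷ (sw ∷ []) ∷ [] ∷ []) (roots-vieta v) (vieta-roots v)
    ; #triples = count-empty (λ t tr → rs (trans (proj₁ (triple-equal v tr)) (sym (proj₂ (triple-equal v tr)))))
    ; #pairs = count-list (pairs _ _ _) distinct-pairs (pairs-pair v) (pair-pairs v)
    }
    where
    distinct-pairs =
      (≢-fst rs ∷ ≢-snd sw ∷ ≢-fst rw ∷ ≢-fst rs ∷ ≢-fst rw ∷ []) ∷
      (≢-fst (≢-sym rs) ∷ ≢-fst sw ∷ ≢-snd rw ∷ ≢-fst sw ∷ []) ∷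
      (≢-fst rw ∷ ≢-fst rs ∷ ≢-fst rw ∷ []) ∷
      (≢-fst (≢-sym sw) ∷ ≢-snd rs ∷ []) ∷
      (≢-fst sw ∷ []) ∷ [] ∷ []

  profile-double : ∀ {A U B r s} → Vieta A U B r s s → r ≢ s → Profile A U B 2 0 3
  profile-double {r = r} {s} v rs = record
    { #roots = count-list (r ∷ s ∷ []) ((rs ∷ []) ∷ [] ∷ [])
        (λ x i → roots-vieta v x (widen i)) (λ x h → narrow (vieta-roots v x h))
    ; #triples = count-empty (λ t tr → rs (trans (proj₁ (triple-equal v tr)) (sym (proj₂ (triple-equal v tr)))))
    ; #pairs = count-list ((r , s) ∷ (s , r) ∷ (s , s) ∷ []) ((≢-fst rs ∷ ≢-fst rs ∷ []) ∷ (≢-snd rs ∷ []) ∷ [] ∷ [])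
        (λ p i → pairs-pair v p (widen₂ i)) (λ p h → narrow₂ (pair-pairs v p h))
    }
    where
    widen : ∀ {x} → x ∈ r ∷ s ∷ [] → x ∈ roots r s s
    widen (here e) = here e
    widen (there (here e)) = there (here e)
    narrow : ∀ {x} → x ∈ roots r s s → x ∈ r ∷ s ∷ []
    narrow (here e) = here e
    narrow (there (here e)) = there (here e)
    narrow (there (there (here e))) = there (here e)
    widen₂ : ∀ {p} → p ∈ (r , s) ∷ (s , r) ∷ (s , s) ∷ [] → p ∈ pairs r s s
    widen₂ (here e) = here e
    widen₂ (there (here e)) = there (here e)
    widen₂ (there (there (here e))) = there (there (there (there (here e))))
    narrow₂ : ∀ {p} → p ∈ pairs r s s → p ∈ (r , s) ∷ (s , r) ∷ (s , s) ∷ []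
    narrow₂ (here e) = here e
    narrow₂ (there (here e)) = there (here e)
    narrow₂ (there (there (here e))) = here e
    narrow₂ (there (there (there (here e)))) = there (here e)
    narrow₂ (there (there (there (there (here e))))) = there (there (here e))
    narrow₂ (there (there (there (there (there (here e)))))) = there (there (here e))

  profile-triple : ∀ {A U B r} → Vieta A U B r r r → Profile A U B 1 1 1
  profile-triple {r = r} v = record
    { #roots = count-single r (λ x h → ∈-constant (refl ∷ refl ∷ refl ∷ []) (vieta-roots v x h)) (vieta-root v)
    ; #triples = count-single r (λ t tr → sym (proj₁ (triple-equal v tr))) (vieta⇒triple v)
    ; #pairs = count-single (r , r)
        (λ p h → ∈-constant (refl ∷ refl ∷ refl ∷ refl ∷ refl ∷ refl ∷ []) (pair-pairs v p h)) (vieta⇒pair v)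
    }

  profile-law : ∀ {A U B k' e' R'} → Profile A U B k' e' R' → 3 ℕ.* k' ℕ.+ e' ≡ R' ℕ.+ 3 → ∀ {k e R} →
    IsCount (Root A U B) k → IsCount (TripleRoot A U B) e → IsCount (RootPair A U B) R → 3 ℕ.* k ℕ.+ e ≡ R ℕ.+ 3
  profile-law prof law ck ce cR =
    trans (cong₂ (λ k e → 3 ℕ.* k ℕ.+ e) (count-unique ck (Profile.#roots prof)) (count-unique ce (Profile.#triples prof)))
          (trans law (cong (ℕ._+ 3) (count-unique (Profile.#pairs prof) cR)))

  profile-split : ∀ {A U B r s w} → Vieta A U B r s w → ∀ {k e R} →
    IsCount (Root A U B) k → IsCount (TripleRoot A U B) e → IsCount (RootPair A U B) R → 3 ℕ.* k ℕ.+ e ≡ R ℕ.+ 3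
  profile-split {r = r} {s} {w} v with r ≟ s | s ≟ w | r ≟ w
  ... | yes refl | yes refl | _ = profile-law (profile-triple v) refl
  ... | yes refl | no sw | _ = profile-law (profile-double (vieta-swap₁₂ (vieta-swap₂₃ v)) (≢-sym sw)) refl
  ... | no rs | yes refl | _ = profile-law (profile-double v rs) refl
  ... | no rs | no sw | yes refl = profile-law (profile-double (vieta-swap₁₂ v) (≢-sym rs)) refl
  ... | no rs | no sw | no rw = profile-law (profile-distinct v rs rw sw) refl

  quotient : Carrier → Carrier → Carrier → Carrier → Carrier
  quotient A U r t = t * t + (r - A) * t + (r * r - A * r + U)

  factor-root : ∀ A U B r t → Root A U B r → cub A U B t ≡ (t - r) * quotient A U r t
  factor-root A U B r t e = begin
    cub A U B t                      ≡⟨ sym (+-identityʳ _) ⟩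
    cub A U B t + 0#                 ≡⟨ cong (cub A U B t +_) (sym (trans (cong -_ e) -0#≈0#)) ⟩
    cub A U B t - cub A U B r        ≡⟨ solve 5 (λ A U B r t → (t :* t :* t :- A :* (t :* t) :+ U :* t :- B) :- (r :* r :* r :- A :* (r :* r) :+ U :* r :- B)
                                             := (t :- r) :* (t :* t :+ (r :- A) :* t :+ (r :* r :- A :* r :+ U))) refl A U B r t ⟩
    (t - r) * quotient A U r t       ∎

  quotient-root : ∀ {A U B r y w} → Vieta A U B r y w → quotient A U r y ≡ 0#
  quotient-root {r = r} {y} {w} (refl , refl , refl) =
    solve 3 (λ r y w → y :* y :+ (r :- (r :+ y :+ w)) :* y :+ (r :* r :- (r :+ y :+ w) :* r :+ (r :* y :+ r :* w :+ y :* w))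
                       := con (pos 0)) refl r y w

  split-vieta : ∀ A U B r s → Root A U B r → quotient A U r s ≡ 0# → Vieta A U B r s (A - r - s)
  split-vieta A U B r s er es = solve 3 (λ A r s → A := r :+ s :+ (A :- r :- s)) refl A r s , U≡ , B≡
    where
    U≡ : U ≡ r * s + r * (A - r - s) + s * (A - r - s)
    U≡ = begin
      U                              ≡⟨ sym (+-identityʳ U) ⟩
      U + 0#                         ≡⟨ cong (U +_) (sym (trans (cong -_ es) -0#≈0#)) ⟩
      U - quotient A U r s           ≡⟨ solve 4 (λ A U r s → U :- (s :* s :+ (r :- A) :* s :+ (r :* r :- A :* r :+ U))
                                               := r :* s :+ r :* (A :- r :- s) :+ s :* (A :- r :- s)) refl A U r s ⟩
      r * s + r * (A - r - s) + s * (A - r - s) ∎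
    B≡ : B ≡ r * s * (A - r - s)
    B≡ = begin
      B                                                   ≡⟨ sym (+-identityʳ B) ⟩
      B + 0#                                              ≡⟨ cong (B +_) (sym er) ⟩
      B + cub A U B r                                     ≡⟨ solve 4 (λ A U B r → B :+ (r :* r :* r :- A :* (r :* r) :+ U :* r :- B)
                                                                  := r :* r :* r :- A :* (r :* r) :+ U :* r) refl A U B r ⟩
      r * r * r - A * (r * r) + U * r                     ≡⟨ cong (λ v → r * r * r - A * (r * r) + v * r) U≡ ⟩
      r * r * r - A * (r * r) + (r * s + r * (A - r - s) + s * (A - r - s)) * r
                                                          ≡⟨ solve 3 (λ A r s → r :* r :* r :- A :* (r :* r) :+ (r :* s :+ r :* (A :- r :- s) :+ s :* (A :- r :- s)) :* r
                                                                  := r :* s :* (A :- r :- s)) refl A r s ⟩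
      r * s * (A - r - s)                                 ∎

  profile-one-root : ∀ {A U B r} → Root A U B r → ¬ Σ Carrier (λ s → quotient A U r s ≡ 0#) → Profile A U B 1 0 0
  profile-one-root {A} {U} {B} {r} er no-split = record
    { #roots = count-single r only-r er
    ; #triples = count-empty (λ t tr → no-pair (vieta⇒pair (triple⇒vieta tr)))
    ; #pairs = count-empty (λ { (x , y) → no-pair })
    }
    where
    only-r : ∀ x → Root A U B x → x ≡ r
    only-r x h with zero-divisor (x - r) (quotient A U r x) (trans (sym (factor-root A U B r x er)) h)
    ... | inj₁ z = sub≡0⇒≡ z
    ... | inj₂ q = ⊥-elim (no-split (x , q))
    no-pair : ∀ {x y} → RootPair A U B (x , y) → ⊥
    no-pair {x} {y} h with only-r x (vieta-root (pair⇒vieta h))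
    ... | refl = no-split (y , quotient-root (pair⇒vieta h))

  profile-no-root : ∀ {A U B} → ¬ HasRoot A U B → Profile A U B 0 0 0
  profile-no-root no-root = record
    { #roots = count-empty (λ x h → no-root (x , h))
    ; #triples = count-empty (λ t tr → no-root (t , vieta-root (triple⇒vieta tr)))
    ; #pairs = count-empty (λ { (x , y) h → no-root (x , vieta-root (pair⇒vieta h)) })
    }

  profile : ∀ A U B {z k e R} → IsCount (λ (_ : ⊤) → ¬ HasRoot A U B) z →
    IsCount (Root A U B) k → IsCount (TripleRoot A U B) e → IsCount (RootPair A U B) R →
    3 ℕ.* z ℕ.+ 3 ℕ.* k ℕ.+ e ≡ R ℕ.+ 3
  profile A U B {z} {k} {e} {R} cz ck ce cR with hasRoot? A U B
  ... | no nr = arithmetic (count-unique cz (count-single tt (λ _ _ → refl) nr)) (count-unique ck #roots)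
                           (count-unique ce #triples) (count-unique cR #pairs)
    where
    open Profile (profile-no-root nr)
    arithmetic : z ≡ 1 → k ≡ 0 → e ≡ 0 → R ≡ 0 → 3 ℕ.* z ℕ.+ 3 ℕ.* k ℕ.+ e ≡ R ℕ.+ 3
    arithmetic refl refl refl refl = refl
  ... | yes (r , er) = subst (λ z → 3 ℕ.* z ℕ.+ 3 ℕ.* k ℕ.+ e ≡ R ℕ.+ 3)
                             (count-unique (count-empty (λ _ nr → nr (r , er))) cz)
                             (with-root (search (FiniteFieldFacts.enum K) (λ s → quotient A U r s ≟ 0#)))
    where
    with-root : Dec (Σ Carrier λ s → quotient A U r s ≡ 0#) → 3 ℕ.* k ℕ.+ e ≡ R ℕ.+ 3
    with-root (yes (s , es)) = profile-split (split-vieta A U B r s er es) ck ce cR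
    with-root (no ns) = profile-law (profile-one-root er ns) refl ck ce cR

-- Summing the per-cubic profile over the middle coefficient u gives,
-- for b ≠ 0,
--   3·P + ε = T + 3,
-- where P = #{u | x³ - a x² + u x - b has no root},
--       ε = #{t | 3t = a, t³ = b}              (diagonal triples (t,t,t)),
--       T = #{(x , y) | x·y·(a - x - y) = b}     (triples with sum a, product b).
-- The number of pairs (u , r) with r a root is |K^*|, since for b ≠ 0 every
-- nonzero r is a root of exactly one of the cubics.
module TripleCount (K : FiniteField) where
  open import Data.Nat as ℕ using (ℕ; suc)
  import Data.Nat.Properties as ℕP
  open import Data.Nat.Tactic.RingSolver using (solve-∀)
  open import Data.List using ([]; _∷_; length)
  open import Data.Integer using () renaming (+_ to pos)
  open import Data.Product using (Σ; _×_; _,_; proj₁; proj₂)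
  open import Data.Unit using (⊤; tt)
  open import Relation.Nullary using (¬_; ¬?)
  open import Relation.Nullary.Decidable using (_×-dec_)
  open import Relation.Binary.PropositionalEquality
  open Field K
  open FiniteFieldFacts K
  open Cubic K
  open Splitting K
  open Counting
  open ≡-Reasoning

  SumProduct : Carrier → Carrier → Carrier × Carrier → Set
  SumProduct a b (x , y) = x * y * (a - x - y) ≡ b

  Diagonal : Carrier → Carrier → Carrier → Set
  Diagonal a b t = (three * t ≡ a) × (t * t * t ≡ b)

  diagonal-count : ∀ a b → Σ ℕ (IsCount (Diagonal a b))
  diagonal-count a b = count-dec (λ t → ((three * t) ≟ a) ×-dec ((t * t * t) ≟ b)) enum

  sumProduct-count : ∀ a b → Σ ℕ (IsCount (SumProduct a b))
  sumProduct-count a b = count-dec (λ { (x , y) → (x * y * (a - x - y)) ≟ b }) (enum-× enum enum)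

  coefficient : Carrier → Carrier → Carrier → Carrier
  coefficient a b r = (b + a * (r * r) - r * r * r) * r ⁻¹

  root⇒coefficient : ∀ a u b r → Root a u b r → r ≢ 0# → u ≡ coefficient a b r
  root⇒coefficient a u b r e nz = cancelˡ nz (begin
    r * u                          ≡⟨ solve 4 (λ a u b r → r :* u := (b :+ a :* (r :* r) :- r :* r :* r) :+ (r :* r :* r :- a :* (r :* r) :+ u :* r :- b))
                                            refl a u b r ⟩
    c + cub a u b r                ≡⟨ cong (c +_) e ⟩
    c + 0#                         ≡⟨ +-identityʳ _ ⟩
    c                              ≡⟨ sym (*-identityʳ _) ⟩
    c * 1#                         ≡⟨ cong (c *_) (sym (inverseˡ r nz)) ⟩
    c * (r ⁻¹ * r)                 ≡⟨ solve 3 (λ c i r → c :* (i :* r) := r :* (c :* i)) refl c (r ⁻¹) r ⟩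
    r * coefficient a b r          ∎)
    where
    c : Carrier
    c = b + a * (r * r) - r * r * r

  coefficient-root : ∀ a b r → r ≢ 0# → Root a (coefficient a b r) b r
  coefficient-root a b r nz = begin
    cub a (c * r ⁻¹) b r                                   ≡⟨ solve 5 (λ a b r c i → r :* r :* r :- a :* (r :* r) :+ (c :* i) :* r :- b
                                                                    := r :* r :* r :- a :* (r :* r) :+ c :* (i :* r) :- b) refl a b r c (r ⁻¹) ⟩
    r * r * r - a * (r * r) + c * (r ⁻¹ * r) - b           ≡⟨ cong (λ z → r * r * r - a * (r * r) + c * z - b) (inverseˡ r nz) ⟩
    r * r * r - a * (r * r) + c * 1# - b                   ≡⟨ solve 3 (λ a b r → r :* r :* r :- a :* (r :* r) :+ (b :+ a :* (r :* r) :- r :* r :* r) :* con (pos 1) :- b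
                                                                    := con (pos 0)) refl a b r ⟩
    0#                                                     ∎
    where
    c : Carrier
    c = b + a * (r * r) - r * r * r

  root-nz : ∀ a u b r → b ≢ 0# → Root a u b r → r ≢ 0#
  root-nz a u b r b≢0 e refl = b≢0 (begin
    b              ≡⟨ solve 3 (λ a u b → b := :- (con (pos 0) :* con (pos 0) :* con (pos 0) :- a :* (con (pos 0) :* con (pos 0)) :+ u :* con (pos 0) :- b))
                            refl a u b ⟩
    - cub a u b 0# ≡⟨ cong -_ e ⟩
    - 0#           ≡⟨ -0#≈0# ⟩
    0#             ∎)

  count-rooted : ∀ a b → b ≢ 0# → IsCount (λ (p : Carrier × Carrier) → Root a (proj₁ p) b (proj₂ p)) (length units)
  count-rooted a b b≢0 = count-bij (λ r → coefficient a b r , r) proj₂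
    (λ r nz → coefficient-root a b r nz) (λ { (u , r) h → root-nz a u b r b≢0 h }) (λ _ _ → refl)
    (λ { (u , r) h → cong (_, r) (sym (root⇒coefficient a u b r h (root-nz a u b r b≢0 h))) })
    count-units

  Σl-profile : ∀ {B : Set} (z k e R : B → ℕ) → (∀ u → 3 ℕ.* z u ℕ.+ 3 ℕ.* k u ℕ.+ e u ≡ R u ℕ.+ 3) →
    ∀ L → 3 ℕ.* Σl L z ℕ.+ 3 ℕ.* Σl L k ℕ.+ Σl L e ≡ Σl L R ℕ.+ 3 ℕ.* length L
  Σl-profile z k e R h [] = refl
  Σl-profile z k e R h (u ∷ L) = begin
    3 ℕ.* (z u ℕ.+ Σl L z) ℕ.+ 3 ℕ.* (k u ℕ.+ Σl L k) ℕ.+ (e u ℕ.+ Σl L e)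
      ≡⟨ regroup (z u) (k u) (e u) (Σl L z) (Σl L k) (Σl L e) ⟩
    (3 ℕ.* z u ℕ.+ 3 ℕ.* k u ℕ.+ e u) ℕ.+ (3 ℕ.* Σl L z ℕ.+ 3 ℕ.* Σl L k ℕ.+ Σl L e)
      ≡⟨ cong₂ ℕ._+_ (h u) (Σl-profile z k e R h L) ⟩
    (R u ℕ.+ 3) ℕ.+ (Σl L R ℕ.+ 3 ℕ.* length L)
      ≡⟨ regroup′ (R u) (Σl L R) (length L) ⟩
    R u ℕ.+ Σl L R ℕ.+ 3 ℕ.* suc (length L) ∎
    where
    regroup : ∀ z k e Z K E → 3 ℕ.* (z ℕ.+ Z) ℕ.+ 3 ℕ.* (k ℕ.+ K) ℕ.+ (e ℕ.+ E)
                              ≡ (3 ℕ.* z ℕ.+ 3 ℕ.* k ℕ.+ e) ℕ.+ (3 ℕ.* Z ℕ.+ 3 ℕ.* K ℕ.+ E)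
    regroup = solve-∀
    regroup′ : ∀ R S n → (R ℕ.+ 3) ℕ.+ (S ℕ.+ 3 ℕ.* n) ≡ R ℕ.+ S ℕ.+ 3 ℕ.* suc n
    regroup′ = solve-∀

  module _ (a b : Carrier) (b≢0 : b ≢ 0#) where
    private
      no-root-count : ∀ u → Σ ℕ (IsCount (λ (_ : ⊤) → ¬ HasRoot a u b))
      no-root-count u = count-dec (λ _ → ¬? (hasRoot? a u b)) enum-⊤
      root-count : ∀ u → Σ ℕ (IsCount (Root a u b))
      root-count u = count-dec (λ x → cub a u b x ≟ 0#) enum
      triple-root-count : ∀ u → Σ ℕ (IsCount (TripleRoot a u b))
      triple-root-count u = count-dec (λ t → ((three * t) ≟ a) ×-dec (((t * t * t) ≟ b) ×-dec ((three * (t * t)) ≟ u))) enum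
      pair-count : ∀ u → Σ ℕ (IsCount (RootPair a u b))
      pair-count u = count-dec (λ { (x , y) → ((x * y * (a - x - y)) ≟ b) ×-dec (σ₂ a x y ≟ u) }) (enum-× enum enum)

      #no-root #roots #triples #pairs : Carrier → ℕ
      #no-root u = proj₁ (no-root-count u)
      #roots u = proj₁ (root-count u)
      #triples u = proj₁ (triple-root-count u)
      #pairs u = proj₁ (pair-count u)

      per-u : ∀ u → 3 ℕ.* #no-root u ℕ.+ 3 ℕ.* #roots u ℕ.+ #triples u ≡ #pairs u ℕ.+ 3
      per-u u = profile a u b (proj₂ (no-root-count u)) (proj₂ (root-count u)) (proj₂ (triple-root-count u)) (proj₂ (pair-count u))

      sum-no-root : IsCount (λ u → ¬ HasRoot a u b) (Σl elems #no-root)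
      sum-no-root = count-fibers (λ u → u) #no-root
        (λ u → count-bij (λ _ → u) (λ _ → tt) (λ _ nr → nr , refl) (λ { _ (nr , refl) → nr })
                         (λ { tt _ → refl }) (λ { _ (_ , refl) → refl }) (proj₂ (no-root-count u))) enum

      sum-roots : IsCount (λ (p : Carrier × Carrier) → Root a (proj₁ p) b (proj₂ p)) (Σl elems #roots)
      sum-roots = count-fibers proj₁ #roots
        (λ u → count-slice u (λ p h → proj₂ h) (λ { (u' , r) (h , refl) → h }) (λ r h → h , refl) (proj₂ (root-count u))) enum

      sum-triples : IsCount (Diagonal a b) (Σl elems #triples)
      sum-triples = count-fibers (λ t → three * (t * t)) #triples
        (λ u → count-⇔ (λ t → λ { (e₁ , e₂ , e₃) → (e₁ , e₂) , e₃ }) (λ t → λ { ((e₁ , e₂) , e₃) → e₁ , e₂ , e₃ })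
                       (proj₂ (triple-root-count u))) enum

      sum-pairs : IsCount (SumProduct a b) (Σl elems #pairs)
      sum-pairs = count-fibers (λ p → σ₂ a (proj₁ p) (proj₂ p)) #pairs
        (λ u → count-⇔ (λ { (x , y) h → h }) (λ { (x , y) h → h }) (proj₂ (pair-count u))) enum

      cancel : ∀ P m ε T → 3 ℕ.* P ℕ.+ 3 ℕ.* m ℕ.+ ε ≡ T ℕ.+ 3 ℕ.* suc m → 3 ℕ.* P ℕ.+ ε ≡ T ℕ.+ 3
      cancel P m ε T h = ℕP.+-cancelʳ-≡ (3 ℕ.* m) _ _ (trans (move P m ε) (trans h (split T m)))
        where
        move : ∀ P m ε → 3 ℕ.* P ℕ.+ ε ℕ.+ 3 ℕ.* m ≡ 3 ℕ.* P ℕ.+ 3 ℕ.* m ℕ.+ ε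
        move = solve-∀
        split : ∀ T m → T ℕ.+ 3 ℕ.* suc m ≡ T ℕ.+ 3 ℕ.+ 3 ℕ.* m
        split = solve-∀

    triple-count : ∀ {P ε T} → IsCount (λ u → ¬ HasRoot a u b) P → IsCount (Diagonal a b) ε →
      IsCount (SumProduct a b) T → 3 ℕ.* P ℕ.+ ε ≡ T ℕ.+ 3
    triple-count {P} {ε} {T} cP cε cT = cancel P (length units) ε T (begin
      3 ℕ.* P ℕ.+ 3 ℕ.* length units ℕ.+ ε
        ≡⟨ cong₂ (λ x y → 3 ℕ.* x ℕ.+ 3 ℕ.* y ℕ.+ ε) (count-unique cP sum-no-root) (count-unique (count-rooted a b b≢0) sum-roots) ⟩
      3 ℕ.* Σl elems #no-root ℕ.+ 3 ℕ.* Σl elems #roots ℕ.+ ε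
        ≡⟨ cong (3 ℕ.* Σl elems #no-root ℕ.+ 3 ℕ.* Σl elems #roots ℕ.+_) (count-unique cε sum-triples) ⟩
      3 ℕ.* Σl elems #no-root ℕ.+ 3 ℕ.* Σl elems #roots ℕ.+ Σl elems #triples
        ≡⟨ Σl-profile #no-root #roots #triples #pairs per-u elems ⟩
      Σl elems #pairs ℕ.+ 3 ℕ.* card K
        ≡⟨ cong₂ (λ x y → x ℕ.+ 3 ℕ.* y) (count-unique sum-pairs cT) (sym units-card) ⟩
      T ℕ.+ 3 ℕ.* suc (length units) ∎)

-- The curve X : Y² Z + c Y Z² + X Y Z = X³ with c = b / a³ has T + 3
-- rational points, T = #{(r , s) | r·s·(a - r - s) = b}: the map
--   (r , s) ↦ (x , y) = (- c a / s , c r / s)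
-- is a bijection onto the affine points with x ≠ 0, with inverse
--   (x , y) ↦ (- a y / x , - c a / x),
-- and the remaining points are (0 : 0 : 1), (0 : -c : 1) and (0 : 1 : 0).
module Curve (K : FiniteField) (a b : Elt K) (a≢0 : a ≢ FiniteField.0# K) (b≢0 : b ≢ FiniteField.0# K) where
  open import Data.Nat as ℕ using (ℕ)
  open import Data.List using ([]; _∷_)
  open import Data.List.Relation.Unary.Any using (here; there)
  open import Data.List.Relation.Unary.AllPairs using ([]; _∷_)
  open import Data.List.Relation.Unary.All using ([]; _∷_)
  open import Data.Integer using () renaming (+_ to pos)
  open import Data.Sum using (_⊎_; inj₁; inj₂)
  open import Data.Product using (_×_; _,_; proj₁; proj₂)
  open import Data.Unit using (tt)
  open import Data.Empty using (⊥; ⊥-elim)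
  open import Relation.Nullary using (yes; no)
  open import Relation.Binary.PropositionalEquality
  open Field K
  open Counting
  open TripleCount K using (SumProduct)
  open ≡-Reasoning

  c : Carrier
  c = b * (a ^ 3) ⁻¹

  c-cube : c * (a * a * a) ≡ b
  c-cube = begin
    c * (a * a * a)            ≡⟨ cong (c *_) (sym (cube a)) ⟩
    b * (a ^ 3) ⁻¹ * a ^ 3     ≡⟨ *-assoc _ _ _ ⟩
    b * ((a ^ 3) ⁻¹ * a ^ 3)   ≡⟨ cong (b *_) (inverseˡ _ (^-nz 3 a≢0)) ⟩
    b * 1#                     ≡⟨ *-identityʳ b ⟩
    b                          ∎

  c≢0 : c ≢ 0#
  c≢0 e = b≢0 (trans (sym c-cube) (trans (cong (_* (a * a * a)) e) (zeroˡ _)))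

  ca≢0 : c * a ≢ 0#
  ca≢0 = mul-nz c≢0 a≢0

  Affine : Carrier → Carrier → Set
  Affine x y = OnCurve K c (inj₁ (x , y))

  to-curve : Carrier × Carrier → Carrier × Carrier
  to-curve (r , s) = (- (c * a) * s ⁻¹) , (c * r * s ⁻¹)

  from-curve : Carrier × Carrier → Carrier × Carrier
  from-curve (x , y) = (- (a * y) * x ⁻¹) , (- (c * a) * x ⁻¹)

  sumProduct-s≢0 : ∀ r s → SumProduct a b (r , s) → s ≢ 0#
  sumProduct-s≢0 r s h refl = b≢0 (trans (sym h)
    (solve 2 (λ r a → r :* con (pos 0) :* (a :- r :- con (pos 0)) := con (pos 0)) refl r a))

  -- Both maps are given by rational functions; each equation is verified
  -- after multiplying by a suitable power of the denominator.
  to-curve-affine : ∀ r s → SumProduct a b (r , s) → Affine (proj₁ (to-curve (r , s))) (proj₂ (to-curve (r , s)))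
  to-curve-affine r s h = cancelˡ (^-nz 3 s≢0) (begin
    s ^ 3 * (y * y * 1# + c * y * 1# * 1# + x * y * 1#)
      ≡⟨ solve 5 (λ c a r s i → (s :* (s :* (s :* con (pos 1)))) :* ((c :* r :* i) :* (c :* r :* i) :* con (pos 1) :+ c :* (c :* r :* i) :* con (pos 1) :* con (pos 1) :+ (:- (c :* a) :* i) :* (c :* r :* i) :* con (pos 1))
                  := c :* c :* (r :* r) :* s :* ((s :* i) :* (s :* i)) :+ c :* c :* r :* (s :* s) :* (s :* i) :- c :* c :* a :* r :* s :* ((s :* i) :* (s :* i))) refl c a r s i ⟩
    lhs (s * i)       ≡⟨ cong lhs (inverse s s≢0) ⟩
    lhs 1#
      ≡⟨ solve 4 (λ c a r s → c :* c :* (r :* r) :* s :* (con (pos 1) :* con (pos 1)) :+ c :* c :* r :* (s :* s) :* con (pos 1) :- c :* c :* a :* r :* s :* (con (pos 1) :* con (pos 1))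
                  := :- (c :* c) :* (r :* s :* (a :- r :- s))) refl c a r s ⟩
    - (c * c) * (r * s * (a - r - s))   ≡⟨ cong (λ z → - (c * c) * z) (trans h (sym c-cube)) ⟩
    - (c * c) * (c * (a * a * a))
      ≡⟨ solve 2 (λ c a → :- (c :* c) :* (c :* (a :* a :* a)) := :- ((c :* a) :* (c :* a) :* (c :* a)) :* (con (pos 1) :* con (pos 1) :* con (pos 1))) refl c a ⟩
    rhs 1#            ≡⟨ cong rhs (sym (inverse s s≢0)) ⟩
    rhs (s * i)
      ≡⟨ solve 4 (λ c a s i → :- ((c :* a) :* (c :* a) :* (c :* a)) :* ((s :* i) :* (s :* i) :* (s :* i))
                  := (s :* (s :* (s :* con (pos 1)))) :* ((:- (c :* a) :* i) :* (:- (c :* a) :* i) :* (:- (c :* a) :* i))) refl c a s i ⟩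
    s ^ 3 * (x * x * x) ∎)
    where
    s≢0 : s ≢ 0#
    s≢0 = sumProduct-s≢0 r s h
    i x y : Carrier
    i = s ⁻¹
    x = - (c * a) * i
    y = c * r * i
    lhs rhs : Carrier → Carrier
    lhs w = c * c * (r * r) * s * (w * w) + c * c * r * (s * s) * w - c * c * a * r * s * (w * w)
    rhs w = - ((c * a) * (c * a) * (c * a)) * (w * w * w)

  to-curve-x≢0 : ∀ r s → SumProduct a b (r , s) → proj₁ (to-curve (r , s)) ≢ 0#
  to-curve-x≢0 r s h e =
    neg-nz (mul-nz ca≢0 (⁻¹-nz (sumProduct-s≢0 r s h))) (trans (-‿distribˡ-* (c * a) (s ⁻¹)) e)

  from-curve-sumProduct : ∀ x y → x ≢ 0# → Affine x y → SumProduct a b (from-curve (x , y))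
  from-curve-sumProduct x y x≢0 e = cancelˡ (^-nz 3 x≢0) (begin
    x ^ 3 * (r * s * (a - r - s))
      ≡⟨ solve 5 (λ c a x y j → (x :* (x :* (x :* con (pos 1)))) :* ((:- (a :* y) :* j) :* (:- (c :* a) :* j) :* (a :- (:- (a :* y) :* j) :- (:- (c :* a) :* j)))
                  := c :* (a :* a :* a) :* y :* ((x :* j) :* (x :* j)) :* (x :+ y :* (x :* j) :+ c :* (x :* j))) refl c a x y j ⟩
    G (x * j)         ≡⟨ cong G (inverse x x≢0) ⟩
    G 1#
      ≡⟨ solve 4 (λ c a x y → c :* (a :* a :* a) :* y :* (con (pos 1) :* con (pos 1)) :* (x :+ y :* con (pos 1) :+ c :* con (pos 1))
                  := c :* (a :* a :* a) :* (y :* y :* con (pos 1) :+ c :* y :* con (pos 1) :* con (pos 1) :+ x :* y :* con (pos 1))) refl c a x y ⟩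
    c * (a * a * a) * (y * y * 1# + c * y * 1# * 1# + x * y * 1#) ≡⟨ cong₂ _*_ c-cube e ⟩
    b * (x * x * x)   ≡⟨ solve 2 (λ b x → b :* (x :* x :* x) := (x :* (x :* (x :* con (pos 1)))) :* b) refl b x ⟩
    x ^ 3 * b         ∎)
    where
    j r s : Carrier
    j = x ⁻¹
    r = - (a * y) * j
    s = - (c * a) * j
    G : Carrier → Carrier
    G w = c * (a * a * a) * y * (w * w) * (x + y * w + c * w)

  private
    k : Carrier
    k = (c * a) ⁻¹

    cak : (c * a) * k ≡ 1#
    cak = inverse (c * a) ca≢0

    inverse-of-quotient : ∀ t → t ≢ 0# → (- (c * a) * t ⁻¹) ⁻¹ ≡ - t * k
    inverse-of-quotient t t≢0 = inverse-unique (begin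
      (- (c * a) * t ⁻¹) * (- t * k)   ≡⟨ solve 4 (λ ca i t k → (:- ca :* i) :* (:- t :* k) := (ca :* k) :* (t :* i)) refl (c * a) (t ⁻¹) t k ⟩
      ((c * a) * k) * (t * t ⁻¹)       ≡⟨ cong₂ _*_ cak (inverse t t≢0) ⟩
      1# * 1#                          ≡⟨ *-identityˡ 1# ⟩
      1#                               ∎)

  from-to : ∀ r s → SumProduct a b (r , s) → from-curve (to-curve (r , s)) ≡ (r , s)
  from-to r s h = cong₂ _,_ first second
    where
    s≢0 : s ≢ 0#
    s≢0 = sumProduct-s≢0 r s h
    i : Carrier
    i = s ⁻¹
    first : - (a * (c * r * i)) * (- (c * a) * i) ⁻¹ ≡ r
    first = begin
      - (a * (c * r * i)) * (- (c * a) * i) ⁻¹ ≡⟨ cong (- (a * (c * r * i)) *_) (inverse-of-quotient s s≢0) ⟩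
      - (a * (c * r * i)) * (- s * k)         ≡⟨ solve 6 (λ a c r i s k → :- (a :* (c :* r :* i)) :* (:- s :* k) := r :* ((c :* a) :* k) :* (s :* i)) refl a c r i s k ⟩
      r * ((c * a) * k) * (s * i)             ≡⟨ cong₂ (λ u v → r * u * v) cak (inverse s s≢0) ⟩
      r * 1# * 1#                             ≡⟨ trans (*-identityʳ _) (*-identityʳ _) ⟩
      r                                       ∎
    second : - (c * a) * (- (c * a) * i) ⁻¹ ≡ s
    second = begin
      - (c * a) * (- (c * a) * i) ⁻¹          ≡⟨ cong (- (c * a) *_) (inverse-of-quotient s s≢0) ⟩
      - (c * a) * (- s * k)                   ≡⟨ solve 3 (λ ca s k → :- ca :* (:- s :* k) := s :* (ca :* k)) refl (c * a) s k ⟩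
      s * ((c * a) * k)                       ≡⟨ cong (s *_) cak ⟩
      s * 1#                                  ≡⟨ *-identityʳ s ⟩
      s                                       ∎

  to-from : ∀ x y → x ≢ 0# → to-curve (from-curve (x , y)) ≡ (x , y)
  to-from x y x≢0 = cong₂ _,_ first second
    where
    j : Carrier
    j = x ⁻¹
    first : - (c * a) * (- (c * a) * j) ⁻¹ ≡ x
    first = begin
      - (c * a) * (- (c * a) * j) ⁻¹          ≡⟨ cong (- (c * a) *_) (inverse-of-quotient x x≢0) ⟩
      - (c * a) * (- x * k)                   ≡⟨ solve 3 (λ ca x k → :- ca :* (:- x :* k) := x :* (ca :* k)) refl (c * a) x k ⟩
      x * ((c * a) * k)                       ≡⟨ cong (x *_) cak ⟩
      x * 1#                                  ≡⟨ *-identityʳ x ⟩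
      x                                       ∎
    second : c * (- (a * y) * j) * (- (c * a) * j) ⁻¹ ≡ y
    second = begin
      c * (- (a * y) * j) * (- (c * a) * j) ⁻¹ ≡⟨ cong (c * (- (a * y) * j) *_) (inverse-of-quotient x x≢0) ⟩
      c * (- (a * y) * j) * (- x * k)         ≡⟨ solve 6 (λ a c y j x k → c :* (:- (a :* y) :* j) :* (:- x :* k) := y :* ((c :* a) :* k) :* (x :* j)) refl a c y j x k ⟩
      y * ((c * a) * k) * (x * j)             ≡⟨ cong₂ (λ u v → y * u * v) cak (inverse x x≢0) ⟩
      y * 1# * 1#                             ≡⟨ trans (*-identityʳ _) (*-identityʳ _) ⟩
      y                                       ∎

  OffAxis : ℙ² K → Set
  OffAxis (inj₁ (x , y)) = x ≢ 0# × Affine x y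
  OffAxis (inj₂ _) = ⊥

  OnAxis : ℙ² K → Set
  OnAxis P = P ≡ inj₁ (0# , 0#) ⊎ P ≡ inj₁ (0# , - c) ⊎ P ≡ inj₂ (inj₁ 0#)

  count-off-axis : ∀ {T} → IsCount (SumProduct a b) T → IsCount OffAxis T
  count-off-axis = count-bij (λ p → inj₁ (to-curve p)) back
    (λ { (r , s) h → to-curve-x≢0 r s h , to-curve-affine r s h }) back-sp
    (λ { (r , s) h → from-to r s h }) to-back
    where
    back : ℙ² K → Carrier × Carrier
    back (inj₁ q) = from-curve q
    back (inj₂ _) = (0# , 0#)
    back-sp : ∀ P → OffAxis P → SumProduct a b (back P)
    back-sp (inj₁ (x , y)) (x≢0 , e) = from-curve-sumProduct x y x≢0 e
    to-back : ∀ P → OffAxis P → inj₁ (to-curve (back P)) ≡ P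
    to-back (inj₁ (x , y)) (x≢0 , e) = cong inj₁ (to-from x y x≢0)

  count-on-axis : IsCount OnAxis 3
  count-on-axis = count-list (inj₁ (0# , 0#) ∷ inj₁ (0# , - c) ∷ inj₂ (inj₁ 0#) ∷ [])
    ((0≢-c ∷ (λ ()) ∷ []) ∷ ((λ ()) ∷ []) ∷ [] ∷ [])
    (λ { P (here e) → inj₁ e ; P (there (here e)) → inj₂ (inj₁ e) ; P (there (there (here e))) → inj₂ (inj₂ e) })
    (λ { P (inj₁ e) → here e ; P (inj₂ (inj₁ e)) → there (here e) ; P (inj₂ (inj₂ e)) → there (there (here e)) })
    where
    0≢-c : inj₁ (0# , 0#) ≢ inj₁ (0# , - c)
    0≢-c e = neg-nz c≢0 (sym (cong (λ { (inj₁ (_ , y)) → y ; (inj₂ _) → 0# }) e))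

  -- On the line x = 0 the equation reads y (y + c) = 0.
  axis-y : ∀ y → Affine 0# y → y ≡ 0# ⊎ y ≡ - c
  axis-y y e with zero-divisor y (y + c) (begin
    y * (y + c)      ≡⟨ solve 2 (λ y c → y :* (y :+ c) := (y :* y :* con (pos 1) :+ c :* y :* con (pos 1) :* con (pos 1) :+ con (pos 0) :* y :* con (pos 1)) :- con (pos 0) :* con (pos 0) :* con (pos 0)) refl y c ⟩
    (y * y * 1# + c * y * 1# * 1# + 0# * y * 1#) - 0# * 0# * 0# ≡⟨ cong (_- 0# * 0# * 0#) e ⟩
    0# * 0# * 0# - 0# * 0# * 0#       ≡⟨ sub-self _ ⟩
    0#               ∎)
  ... | inj₁ y≡0 = inj₁ y≡0
  ... | inj₂ y+c≡0 = inj₂ (begin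
    y                ≡⟨ solve 2 (λ y c → y := (y :+ c) :- c) refl y c ⟩
    (y + c) - c      ≡⟨ cong (_- c) y+c≡0 ⟩
    0# - c           ≡⟨ +-identityˡ _ ⟩
    - c              ∎)

  -- At infinity (Z = 0) the equation forces X = 0.
  classify : ∀ P → OnCurve K c P → OffAxis P ⊎ OnAxis P
  classify (inj₁ (x , y)) e with x ≟ 0#
  ... | no x≢0 = inj₁ (x≢0 , e)
  ... | yes refl with axis-y y e
  ...   | inj₁ refl = inj₂ (inj₁ refl)
  ...   | inj₂ refl = inj₂ (inj₂ (inj₁ refl))
  classify (inj₂ (inj₁ x)) e = inj₂ (inj₂ (inj₂ (cong (λ z → inj₂ (inj₁ z)) (^≡0⇒≡0 3 (begin
    x ^ 3            ≡⟨ cube x ⟩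
    x * x * x        ≡⟨ sym e ⟩
    1# * 1# * 0# + c * 1# * 0# * 0# + x * 1# * 0#
                     ≡⟨ solve 2 (λ c x → con (pos 1) :* con (pos 1) :* con (pos 0) :+ c :* con (pos 1) :* con (pos 0) :* con (pos 0) :+ x :* con (pos 1) :* con (pos 0)
                                  := con (pos 0)) refl c x ⟩
    0#               ∎)))))
  classify (inj₂ (inj₂ tt)) e = ⊥-elim (1≢0 (begin
    1#               ≡⟨ solve 0 (con (pos 1) := con (pos 1) :* con (pos 1) :* con (pos 1)) refl ⟩
    1# * 1# * 1#     ≡⟨ sym e ⟩
    0# * 0# * 0# + c * 0# * 0# * 0# + 1# * 0# * 0#
                     ≡⟨ solve 1 (λ c → con (pos 0) :* con (pos 0) :* con (pos 0) :+ c :* con (pos 0) :* con (pos 0) :* con (pos 0) :+ con (pos 1) :* con (pos 0) :* con (pos 0)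
                                  := con (pos 0)) refl c ⟩
    0#               ∎))

  on-axis-on-curve : ∀ P → OnAxis P → OnCurve K c P
  on-axis-on-curve P (inj₁ refl) =
    solve 1 (λ c → con (pos 0) :* con (pos 0) :* con (pos 1) :+ c :* con (pos 0) :* con (pos 1) :* con (pos 1) :+ con (pos 0) :* con (pos 0) :* con (pos 1)
                   := con (pos 0) :* con (pos 0) :* con (pos 0)) refl c
  on-axis-on-curve P (inj₂ (inj₁ refl)) =
    solve 1 (λ c → (:- c) :* (:- c) :* con (pos 1) :+ c :* (:- c) :* con (pos 1) :* con (pos 1) :+ con (pos 0) :* (:- c) :* con (pos 1)
                   := con (pos 0) :* con (pos 0) :* con (pos 0)) refl c
  on-axis-on-curve P (inj₂ (inj₂ refl)) =
    solve 1 (λ c → con (pos 1) :* con (pos 1) :* con (pos 0) :+ c :* con (pos 1) :* con (pos 0) :* con (pos 0) :+ con (pos 0) :* con (pos 1) :* con (pos 0)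
                   := con (pos 0) :* con (pos 0) :* con (pos 0)) refl c

  curve-count : ∀ {T} → IsCount (SumProduct a b) T → IsCount (OnCurve K c) (T ℕ.+ 3)
  curve-count cT = count-⇔ (λ P → λ { (inj₁ h) → off-axis-on-curve P h ; (inj₂ h) → on-axis-on-curve P h }) classify
    (count-⊎ (count-off-axis cT) count-on-axis disjoint)
    where
    off-axis-on-curve : ∀ P → OffAxis P → OnCurve K c P
    off-axis-on-curve (inj₁ _) (_ , e) = e
    disjoint : ∀ P → OffAxis P → OnAxis P → ⊥
    disjoint (inj₁ (x , y)) (x≢0 , _) (inj₁ refl) = x≢0 refl
    disjoint (inj₁ (x , y)) (x≢0 , _) (inj₂ (inj₁ refl)) = x≢0 refl
    disjoint (inj₁ (x , y)) (x≢0 , _) (inj₂ (inj₂ ()))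

-- Summing 'triple-count' over all (a , b)
-- with b ≠ 0 (for b = 0 the cubic has the root 0) gives
--   3·I + (q - 1) = (q - 1)³ + 3·q·(q - 1),
-- since the diagonal triples with b ≠ 0 are indexed by t ≠ 0 and the
-- triples (x , y , a - x - y) with b ≠ 0 by (x , y , w) ∈ (K^*)³.
module IrreducibleCount (K : FiniteField) where
  open import Data.Nat as ℕ using (ℕ; suc)
  import Data.Nat.Properties as ℕP
  open import Data.Nat.Tactic.RingSolver using (solve-∀)
  open import Data.List using (List; length)
  open import Data.Integer using () renaming (+_ to pos)
  open import Data.Product using (Σ; _×_; _,_; proj₁; proj₂)
  open import Data.Unit using (⊤; tt)
  open import Relation.Nullary using (¬_; Dec; yes; no; ¬?)
  open import Relation.Nullary.Decidable using (_×-dec_)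
  open import Relation.Binary.PropositionalEquality
  open Field K
  open FiniteFieldFacts K
  open Cubic K
  open Splitting K using (three)
  open TripleCount K
  open Counting
  open ≡-Reasoning

  Coefficients : Set
  Coefficients = Carrier × Carrier × Carrier

  RootFree : Coefficients → Set
  RootFree (a , u , b) = ¬ HasRoot a u b

  rootFree? : ∀ τ → Dec (RootFree τ)
  rootFree? (a , u , b) = ¬? (hasRoot? a u b)

  private
    enum² : Enum (Carrier × Carrier)
    enum² = enum-× enum enum

    b≢0? : ∀ b → Dec (b ≢ 0#)
    b≢0? b = ¬? (b ≟ 0#)

    module _ (a b : Carrier) where
      root-free-count : Σ ℕ (IsCount (λ u → RootFree (a , u , b)))
      root-free-count = count-dec (λ u → rootFree? (a , u , b)) enum
      diagonalNZ-count : Σ ℕ (IsCount (λ t → Diagonal a b t × b ≢ 0#))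
      diagonalNZ-count = count-dec (λ t → (((three * t) ≟ a) ×-dec ((t * t * t) ≟ b)) ×-dec b≢0? b) enum
      sumProductNZ-count : Σ ℕ (IsCount (λ xy → SumProduct a b xy × b ≢ 0#))
      sumProductNZ-count = count-dec (λ { (x , y) → ((x * y * (a - x - y)) ≟ b) ×-dec b≢0? b }) enum²
      nonzero-count : Σ ℕ (IsCount (λ (_ : ⊤) → b ≢ 0#))
      nonzero-count = count-dec (λ (_ : ⊤) → b≢0? b) enum-⊤

    #root-free #diagonal #triples #nonzero : Carrier × Carrier → ℕ
    #root-free (a , b) = proj₁ (root-free-count a b)
    #diagonal (a , b) = proj₁ (diagonalNZ-count a b)
    #triples (a , b) = proj₁ (sumProductNZ-count a b)
    #nonzero (a , b) = proj₁ (nonzero-count a b)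

    -- 'triple-count' for b ≠ 0, and all counts vanish for b = 0.
    per-ab : ∀ ab → 3 ℕ.* #root-free ab ℕ.+ #diagonal ab ≡ #triples ab ℕ.+ 3 ℕ.* #nonzero ab
    per-ab (a , b) = by-cases (b ≟ 0#)
      where
      by-cases : Dec (b ≡ 0#) → 3 ℕ.* #root-free (a , b) ℕ.+ #diagonal (a , b) ≡ #triples (a , b) ℕ.+ 3 ℕ.* #nonzero (a , b)
      by-cases (yes b≡0) = arithmetic
          (count-unique (proj₂ (root-free-count a b)) (count-empty (λ u nr → nr (0# , zero-root u))))
          (count-unique (proj₂ (diagonalNZ-count a b)) (count-empty (λ t h → proj₂ h b≡0)))
          (count-unique (proj₂ (sumProductNZ-count a b)) (count-empty (λ { (x , y) h → proj₂ h b≡0 })))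
          (count-unique (proj₂ (nonzero-count a b)) (count-empty (λ t h → h b≡0)))
        where
        zero-root : ∀ u → cub a u b 0# ≡ 0#
        zero-root u = trans (cong (λ w → cub a u w 0#) b≡0)
          (solve 2 (λ a u → con (pos 0) :* con (pos 0) :* con (pos 0) :- a :* (con (pos 0) :* con (pos 0)) :+ u :* con (pos 0) :- con (pos 0)
                             := con (pos 0)) refl a u)
        arithmetic : ∀ {w x y z} → w ≡ 0 → x ≡ 0 → y ≡ 0 → z ≡ 0 → 3 ℕ.* w ℕ.+ x ≡ y ℕ.+ 3 ℕ.* z
        arithmetic refl refl refl refl = refl
      by-cases (no b≢0) = begin
        3 ℕ.* #root-free (a , b) ℕ.+ #diagonal (a , b)
          ≡⟨ triple-count a b b≢0 (proj₂ (root-free-count a b))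
               (count-⇔ (λ t → proj₁) (λ t h → h , b≢0) (proj₂ (diagonalNZ-count a b)))
               (count-⇔ (λ { (x , y) → proj₁ }) (λ { (x , y) h → h , b≢0 }) (proj₂ (sumProductNZ-count a b))) ⟩
        #triples (a , b) ℕ.+ 3
          ≡⟨ cong (λ n → #triples (a , b) ℕ.+ 3 ℕ.* n) (count-unique (count-single tt (λ _ _ → refl) b≢0) (proj₂ (nonzero-count a b))) ⟩
        #triples (a , b) ℕ.+ 3 ℕ.* #nonzero (a , b) ∎

    DiagonalNZ : (Carrier × Carrier) × Carrier → Set
    DiagonalNZ ((a , b) , t) = Diagonal a b t × b ≢ 0#

    SumProductNZ : (Carrier × Carrier) × (Carrier × Carrier) → Set
    SumProductNZ ((a , b) , xy) = SumProduct a b xy × b ≢ 0#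

    sum-root-free : IsCount RootFree (Σl (proj₁ enum²) #root-free)
    sum-root-free = count-fibers (λ { (a , u , b) → a , b }) #root-free
      (λ { (a , b) → count-bij (λ u → a , u , b) (λ τ → proj₁ (proj₂ τ)) (λ u h → h , refl)
                       (λ { (a' , u , b') (h , refl) → h }) (λ _ _ → refl) (λ { (a' , u , b') (h , refl) → refl })
                       (proj₂ (root-free-count a b)) }) enum²

    sum-diagonal : IsCount DiagonalNZ (Σl (proj₁ enum²) #diagonal)
    sum-diagonal = count-fibers proj₁ #diagonal
      (λ { (a , b) → count-slice (a , b) (λ p h → proj₂ h) (λ { ((a' , b') , t) (h , refl) → h }) (λ t h → h , refl)
                       (proj₂ (diagonalNZ-count a b)) }) enum²

    sum-triples : IsCount SumProductNZ (Σl (proj₁ enum²) #triples)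
    sum-triples = count-fibers proj₁ #triples
      (λ { (a , b) → count-slice (a , b) (λ p h → proj₂ h) (λ { ((a' , b') , xy) (h , refl) → h }) (λ xy h → h , refl)
                       (count-⇔ (λ { (x , y) h → h }) (λ { (x , y) h → h }) (proj₂ (sumProductNZ-count a b))) }) enum²

    sum-nonzero : IsCount (λ (ab : Carrier × Carrier) → proj₂ ab ≢ 0#) (Σl (proj₁ enum²) #nonzero)
    sum-nonzero = count-fibers (λ ab → ab) #nonzero
      (λ { (a , b) → count-bij (λ _ → a , b) (λ _ → tt) (λ _ h → h , refl) (λ { _ (h , refl) → h })
                       (λ { tt _ → refl }) (λ { _ (_ , refl) → refl }) (proj₂ (nonzero-count a b)) }) enum²

    m : ℕ
    m = length units

    count-diagonal : IsCount DiagonalNZ m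
    count-diagonal = count-bij (λ t → (three * t , t * t * t) , t) proj₂
      (λ t t≢0 → (refl , refl) , λ e → t≢0 (^≡0⇒≡0 3 (trans (cube t) e)))
      (λ { ((a , b) , t) ((_ , t³≡b) , b≢0) t≡0 → b≢0 (trans (sym t³≡b) (subst (λ w → w * w * w ≡ 0#) (sym t≡0) zero³)) })
      (λ _ _ → refl)
      (λ { ((a , b) , t) ((e₁ , e₂) , _) → cong (λ z → z , t) (cong₂ _,_ e₁ e₂) })
      count-units
      where
      zero³ : 0# * 0# * 0# ≡ 0#
      zero³ = trans (cong (_* 0#) (zeroˡ 0#)) (zeroˡ 0#)

    nonzero-factors : ∀ x y w → x * y * w ≢ 0# → (x ≢ 0#) × (y ≢ 0#) × (w ≢ 0#)
    nonzero-factors x y w nz =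
      (λ e → nz (trans (cong (λ v → v * y * w) e) (trans (cong (_* w) (zeroˡ y)) (zeroˡ w)))) ,
      (λ e → nz (trans (cong (λ v → x * v * w) e) (trans (cong (_* w) (zeroʳ x)) (zeroˡ w)))) ,
      (λ e → nz (trans (cong (λ v → x * y * v) e) (zeroʳ _)))

    count-triples : IsCount SumProductNZ (m ℕ.* m ℕ.* m)
    count-triples = count-bij to from to-ok from-ok (λ { ((x , y) , w) _ → cong ((x , y) ,_) (third x y w) })
      (λ { ((a , b) , (x , y)) (h , _) → cong (_, (x , y)) (cong₂ _,_ (sum a x y) h) })
      (count-× (count-× count-units count-units) count-units)
      where
      to : (Carrier × Carrier) × Carrier → (Carrier × Carrier) × (Carrier × Carrier)
      to ((x , y) , w) = (x + y + w , x * y * w) , (x , y)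
      from : (Carrier × Carrier) × (Carrier × Carrier) → (Carrier × Carrier) × Carrier
      from ((a , b) , (x , y)) = (x , y) , a - x - y
      third : ∀ x y w → x + y + w - x - y ≡ w
      third = solve 3 (λ x y w → x :+ y :+ w :- x :- y := w) refl
      sum : ∀ a x y → x + y + (a - x - y) ≡ a
      sum = solve 3 (λ a x y → x :+ y :+ (a :- x :- y) := a) refl
      to-ok : ∀ p → ((proj₁ (proj₁ p) ≢ 0#) × (proj₂ (proj₁ p) ≢ 0#)) × (proj₂ p ≢ 0#) → SumProductNZ (to p)
      to-ok ((x , y) , w) ((x≢0 , y≢0) , w≢0) =
        cong (x * y *_) (third x y w) , mul-nz (mul-nz x≢0 y≢0) w≢0
      from-ok : ∀ p → SumProductNZ p → ((proj₁ (proj₁ (from p)) ≢ 0#) × (proj₂ (proj₁ (from p)) ≢ 0#)) × (proj₂ (from p) ≢ 0#)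
      from-ok ((a , b) , (x , y)) (h , b≢0) with nonzero-factors x y (a - x - y) (λ e → b≢0 (trans (sym h) e))
      ... | x≢0 , y≢0 , w≢0 = (x≢0 , y≢0) , w≢0

    count-nonzero : IsCount (λ (ab : Carrier × Carrier) → proj₂ ab ≢ 0#) (card K ℕ.* m)
    count-nonzero = count-⇔ (λ { (a , b) (_ , b≢0) → b≢0 }) (λ { (a , b) b≢0 → tt , b≢0 })
      (count-× (count-all enum) count-units)

  irreducible-count : ∀ {I} → IsCount RootFree I → 3 ℕ.* I ℕ.+ card K ≡ card K ℕ.^ 3
  irreducible-count {I} cI = begin
    3 ℕ.* I ℕ.+ card K                          ≡⟨ cong (3 ℕ.* I ℕ.+_) (sym units-card) ⟩
    3 ℕ.* I ℕ.+ suc m                           ≡⟨ ℕP.+-suc (3 ℕ.* I) m ⟩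
    suc (3 ℕ.* I ℕ.+ m)                         ≡⟨ cong suc summed ⟩
    suc (m ℕ.* m ℕ.* m ℕ.+ 3 ℕ.* (card K ℕ.* m)) ≡⟨ cong (λ q → suc (m ℕ.* m ℕ.* m ℕ.+ 3 ℕ.* (q ℕ.* m))) (sym units-card) ⟩
    suc (m ℕ.* m ℕ.* m ℕ.+ 3 ℕ.* (suc m ℕ.* m)) ≡⟨ binomial m ⟩
    suc m ℕ.^ 3                                 ≡⟨ cong (ℕ._^ 3) units-card ⟩
    card K ℕ.^ 3                                ∎
    where
    L² : List (Carrier × Carrier)
    L² = proj₁ enum²
    binomial : ∀ n → suc (n ℕ.* n ℕ.* n ℕ.+ 3 ℕ.* (suc n ℕ.* n)) ≡ suc n ℕ.* (suc n ℕ.* (suc n ℕ.* 1))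
    binomial = solve-∀
    summed : 3 ℕ.* I ℕ.+ m ≡ m ℕ.* m ℕ.* m ℕ.+ 3 ℕ.* (card K ℕ.* m)
    summed = begin
      3 ℕ.* I ℕ.+ m                                     ≡⟨ cong₂ (λ x y → 3 ℕ.* x ℕ.+ y) (count-unique cI sum-root-free) (count-unique count-diagonal sum-diagonal) ⟩
      3 ℕ.* Σl L² #root-free ℕ.+ Σl L² #diagonal        ≡⟨ cong (ℕ._+ Σl L² #diagonal) (sym (Σl-*ˡ L² #root-free 3)) ⟩
      Σl L² (λ ab → 3 ℕ.* #root-free ab) ℕ.+ Σl L² #diagonal ≡⟨ sym (Σl-+ L² _ _) ⟩
      Σl L² (λ ab → 3 ℕ.* #root-free ab ℕ.+ #diagonal ab) ≡⟨ Σl-ext L² _ _ per-ab ⟩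
      Σl L² (λ ab → #triples ab ℕ.+ 3 ℕ.* #nonzero ab)  ≡⟨ Σl-+ L² _ _ ⟩
      Σl L² #triples ℕ.+ Σl L² (λ ab → 3 ℕ.* #nonzero ab) ≡⟨ cong (Σl L² #triples ℕ.+_) (Σl-*ˡ L² #nonzero 3) ⟩
      Σl L² #triples ℕ.+ 3 ℕ.* Σl L² #nonzero          ≡⟨ cong₂ (λ x y → x ℕ.+ 3 ℕ.* y) (count-unique sum-triples count-triples) (count-unique sum-nonzero count-nonzero) ⟩
      m ℕ.* m ℕ.* m ℕ.+ 3 ℕ.* (card K ℕ.* m)          ∎

-- The cubic extension L/K, |K| = q = p ^ r and |L| = q³, through the
-- Frobenius φ x = x ^ q:
--   * φ is a ring endomorphism of L fixing K, and φ³ = id;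
--   * the fixed points of φ are exactly K (x ^ q - x has at most q roots);
--   * for x ∈ L the elementary symmetric functions of x, φ x, φ² x are
--     fixed, hence lie in K: they are the coefficients 'χ x' of the
--     characteristic polynomial (t - x)(t - φ x)(t - φ² x) of x;
--   * for x ∉ K the three conjugates are distinct, χ x has no root in K,
--     and χ x is the only root-free K-cubic vanishing at x.
module Extension (K L : FiniteField) (emb : Embedding K L) (p r : ℕ) (p-prime : Prime p)
                 (cK : card K ≡ p ℕ.^ r) (cL : card L ≡ card K ℕ.^ 3) where
  open import Data.Nat using (zero; suc; _≤_)
  import Data.Nat.Properties as ℕP
  open import Data.Nat.Tactic.RingSolver using (solve-∀)
  open import Data.List using (length; map)
  open import Data.List.Membership.Propositional using (_∈_)
  open import Data.List.Properties using (length-map)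
  open import Data.List.Membership.Propositional.Properties using (∈-map⁺; ∈-map⁻)
  import Data.List.Relation.Unary.Unique.Propositional.Properties as Unique
  open import Data.Integer using () renaming (+_ to pos)
  open import Data.Sum using (_⊎_; inj₁; inj₂)
  open import Data.Product using (Σ; _×_; _,_; proj₁; proj₂)
  open import Data.Empty using (⊥; ⊥-elim)
  open import Function.Bundles using (mk⇔; Equivalence)
  open import Relation.Nullary using (¬_; Dec; yes; no)
  open import Relation.Binary.PropositionalEquality hiding (_≡_)
  module KF = Field K
  module KC = Cubic K
  open Field L
  open Counting
  open Embedding emb
  open ≡-Reasoning

  ι-neg : ∀ x → ι (KF.- x) ≡ - ι x
  ι-neg x = begin
    ι (KF.- x)                  ≡⟨ solve 2 (λ a b → a := (b :+ a) :- b) refl (ι (KF.- x)) (ι x) ⟩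
    (ι x + ι (KF.- x)) - ι x    ≡⟨ cong (_- ι x) (sym (ι-+ x (KF.- x))) ⟩
    ι (x KF.+ KF.- x) - ι x     ≡⟨ cong (λ z → ι z - ι x) (KF.-‿inverseʳ x) ⟩
    ι KF.0# - ι x               ≡⟨ cong (_- ι x) ι-0 ⟩
    0# - ι x                    ≡⟨ +-identityˡ _ ⟩
    - ι x                       ∎

  ι-sub : ∀ x y → ι (x KF.- y) ≡ ι x - ι y
  ι-sub x y = trans (ι-+ x (KF.- y)) (cong (ι x +_) (ι-neg y))

  ι-pow : ∀ x n → ι (x KF.^ n) ≡ ι x ^ n
  ι-pow x zero = ι-1
  ι-pow x (suc n) = trans (ι-* x (x KF.^ n)) (cong (ι x *_) (ι-pow x n))

  ι-ofℕ : ∀ n → ι (KF.ofℕ n) ≡ ofℕ n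
  ι-ofℕ zero = ι-0
  ι-ofℕ (suc n) = trans (ι-+ KF.1# (KF.ofℕ n)) (cong₂ _+_ ι-1 (ι-ofℕ n))

  ι-inj : ∀ {x y} → ι x ≡ ι y → x ≡ y
  ι-inj {x} {y} h with (x KF.- y) KF.≟ KF.0#
  ... | yes z = KF.sub≡0⇒≡ z
  ... | no nz = ⊥-elim (1≢0 (begin
    1#                                             ≡⟨ sym ι-1 ⟩
    ι KF.1#                                        ≡⟨ cong ι (sym (KF.inverse _ nz)) ⟩
    ι ((x KF.- y) KF.* (x KF.- y) KF.⁻¹)           ≡⟨ ι-* _ _ ⟩
    ι (x KF.- y) * ι ((x KF.- y) KF.⁻¹)            ≡⟨ cong (_* ι ((x KF.- y) KF.⁻¹)) (trans (ι-sub x y) (trans (cong (_- ι y) h) (sub-self (ι y)))) ⟩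
    0# * ι ((x KF.- y) KF.⁻¹)                      ≡⟨ zeroˡ _ ⟩
    0#                                             ∎))

  ι-nz : ∀ {b} → b ≢ KF.0# → ι b ≢ 0#
  ι-nz b≢0 h = b≢0 (ι-inj (trans h (sym ι-0)))

  q : ℕ
  q = card K

  φ : Carrier → Carrier
  φ x = x ^ q

  φ-+ : ∀ x y → φ (x + y) ≡ φ x + φ y
  φ-+ x y = subst (λ n → (x + y) ^ n ≡ x ^ n + y ^ n) (sym cK) (Frobenius.frobenius L p p-prime charL r x y)
    where
    charL : ofℕ p ≡ 0#
    charL = trans (sym (ι-ofℕ p)) (trans (cong ι (FiniteFieldFacts.characteristic K p r cK)) ι-0)

  φ-* : ∀ x y → φ (x * y) ≡ φ x * φ y
  φ-* x y = *-^ x y q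

  φ-ι : ∀ k → φ (ι k) ≡ ι k
  φ-ι k = trans (sym (ι-pow k q)) (cong ι (FiniteFieldFacts.fermat K k))

  φ-0 : φ 0# ≡ 0#
  φ-0 = subst (λ n → 0# ^ n ≡ 0#) (sym (proj₂ (FiniteFieldFacts.card-≥2 K))) (zeroˡ _)

  φ-neg : ∀ x → φ (- x) ≡ - φ x
  φ-neg x = begin
    φ (- x)                    ≡⟨ solve 2 (λ a b → a := (b :+ a) :- b) refl (φ (- x)) (φ x) ⟩
    (φ x + φ (- x)) - φ x      ≡⟨ cong (_- φ x) (sym (φ-+ x (- x))) ⟩
    φ (x + - x) - φ x          ≡⟨ cong (λ z → φ z - φ x) (-‿inverseʳ x) ⟩
    φ 0# - φ x                 ≡⟨ cong (_- φ x) φ-0 ⟩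
    0# - φ x                   ≡⟨ +-identityˡ _ ⟩
    - φ x                      ∎

  φ-sub : ∀ x y → φ (x - y) ≡ φ x - φ y
  φ-sub x y = trans (φ-+ x (- y)) (cong (φ x +_) (φ-neg y))

  φ³ : ∀ x → φ (φ (φ x)) ≡ x
  φ³ x = begin
    ((x ^ q) ^ q) ^ q          ≡⟨ cong (_^ q) (sym (^-* x q q)) ⟩
    (x ^ (q ℕ.* q)) ^ q        ≡⟨ sym (^-* x (q ℕ.* q) q) ⟩
    x ^ (q ℕ.* q ℕ.* q)        ≡⟨ cong (x ^_) (trans (cube-ℕ q) (sym cL)) ⟩
    x ^ card L                 ≡⟨ FiniteFieldFacts.fermat L x ⟩
    x                          ∎
    where
    cube-ℕ : ∀ n → n ℕ.* n ℕ.* n ≡ n ℕ.* (n ℕ.* (n ℕ.* 1))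
    cube-ℕ = solve-∀

  InK : Carrier → Set
  InK x = Σ (Elt K) λ k → ι k ≡ x

  inK? : ∀ x → Dec (InK x)
  inK? x = search (FiniteFieldFacts.enum K) (λ k → ι k ≟ x)

  count-K : IsCount InK q
  count-K = map ι KF.elems , Unique.map⁺ ι-inj KF.elems-unique ,
    (λ x → mk⇔ (image x) (λ { (k , refl) → ∈-map⁺ ι (KF.elems-complete k) })) , length-map ι KF.elems
    where
    image : ∀ x → x ∈ map ι KF.elems → InK x
    image x i with ∈-map⁻ ι i
    ... | k , _ , refl = k , refl

  Fixed : Carrier → Set
  Fixed x = φ x ≡ x

  -- The fixed points are roots of x ^ q - x, so there are at most q of them.
  fixed-bound : ∀ {m} → IsCount Fixed m → m ≤ q
  fixed-bound (l , u , mem , refl) with FiniteFieldFacts.card-≥2 K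
  ... | m , q≡m+2 = subst (length l ≤_) (sym q≡m+2)
    (RootBound.root-bound L (suc (suc m)) (RootBound.power-minus-x L m) l u (λ {y} i → begin
      RootBound.eval L (RootBound.power-minus-x L m) y ≡⟨ RootBound.eval-power-minus-x L m y ⟩
      y ^ suc (suc m) - y                              ≡⟨ cong (λ n → y ^ n - y) (sym q≡m+2) ⟩
      φ y - y                                          ≡⟨ cong (_- y) (Equivalence.to (mem y) i) ⟩
      y - y                                            ≡⟨ sub-self y ⟩
      0#                                               ∎))

  -- K consists of fixed points and has q elements, so it is all of them.
  fixed⇒K : ∀ x → Fixed x → InK x
  fixed⇒K = count-fill enumL inK? (λ { x (k , refl) → φ-ι k }) (λ x → φ x ≟ x) count-K count-fixed
    where
    enumL : Enum Carrier
    enumL = FiniteFieldFacts.enum L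
    fixed-count : Σ ℕ (IsCount Fixed)
    fixed-count = count-dec (λ x → φ x ≟ x) enumL
    count-fixed : IsCount Fixed q
    count-fixed = subst (IsCount Fixed)
      (ℕP.≤-antisym (fixed-bound (proj₂ fixed-count))
                    (count-mono enumL inK? (λ { x (k , refl) → φ-ι k }) (λ x → φ x ≟ x) count-K (proj₂ fixed-count)))
      (proj₂ fixed-count)

  e₁ e₂ e₃ : Carrier → Carrier
  e₁ x = x + φ x + φ (φ x)
  e₂ x = x * φ x + x * φ (φ x) + φ x * φ (φ x)
  e₃ x = x * φ x * φ (φ x)

  e₁-fixed : ∀ x → Fixed (e₁ x)
  e₁-fixed x = begin
    φ (x + φ x + φ (φ x))           ≡⟨ φ-+ (x + φ x) _ ⟩
    φ (x + φ x) + φ (φ (φ x))       ≡⟨ cong₂ _+_ (φ-+ x (φ x)) (φ³ x) ⟩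
    φ x + φ (φ x) + x               ≡⟨ solve 3 (λ a b c → a :+ b :+ c := c :+ a :+ b) refl (φ x) (φ (φ x)) x ⟩
    x + φ x + φ (φ x)               ∎

  e₂-fixed : ∀ x → Fixed (e₂ x)
  e₂-fixed x = begin
    φ (x * φ x + x * φ (φ x) + φ x * φ (φ x))                    ≡⟨ trans (φ-+ _ _) (cong₂ _+_ (φ-+ _ _) refl) ⟩
    φ (x * φ x) + φ (x * φ (φ x)) + φ (φ x * φ (φ x))            ≡⟨ cong₂ _+_ (cong₂ _+_ (φ-* _ _) (φ-* _ _)) (φ-* _ _) ⟩
    φ x * φ (φ x) + φ x * φ (φ (φ x)) + φ (φ x) * φ (φ (φ x))    ≡⟨ cong (λ z → φ x * φ (φ x) + φ x * z + φ (φ x) * z) (φ³ x) ⟩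
    φ x * φ (φ x) + φ x * x + φ (φ x) * x                        ≡⟨ solve 3 (λ a b c → a :* b :+ a :* c :+ b :* c := c :* a :+ c :* b :+ a :* b) refl (φ x) (φ (φ x)) x ⟩
    x * φ x + x * φ (φ x) + φ x * φ (φ x)                        ∎

  e₃-fixed : ∀ x → Fixed (e₃ x)
  e₃-fixed x = begin
    φ (x * φ x * φ (φ x))           ≡⟨ trans (φ-* _ _) (cong (_* φ (φ (φ x))) (φ-* _ _)) ⟩
    φ x * φ (φ x) * φ (φ (φ x))     ≡⟨ cong (φ x * φ (φ x) *_) (φ³ x) ⟩
    φ x * φ (φ x) * x               ≡⟨ solve 3 (λ a b c → a :* b :* c := c :* a :* b) refl (φ x) (φ (φ x)) x ⟩
    x * φ x * φ (φ x)               ∎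

  Coefficients : Set
  Coefficients = Elt K × Elt K × Elt K

  χ₁ χ₂ χ₃ : Carrier → Elt K
  χ₁ x = proj₁ (fixed⇒K (e₁ x) (e₁-fixed x))
  χ₂ x = proj₁ (fixed⇒K (e₂ x) (e₂-fixed x))
  χ₃ x = proj₁ (fixed⇒K (e₃ x) (e₃-fixed x))

  χ : Carrier → Coefficients
  χ x = χ₁ x , χ₂ x , χ₃ x

  ι-χ₁ : ∀ x → ι (χ₁ x) ≡ e₁ x
  ι-χ₁ x = proj₂ (fixed⇒K (e₁ x) (e₁-fixed x))
  ι-χ₂ : ∀ x → ι (χ₂ x) ≡ e₂ x
  ι-χ₂ x = proj₂ (fixed⇒K (e₂ x) (e₂-fixed x))
  ι-χ₃ : ∀ x → ι (χ₃ x) ≡ e₃ x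
  ι-χ₃ x = proj₂ (fixed⇒K (e₃ x) (e₃-fixed x))

  cubL : Coefficients → Carrier → Carrier
  cubL (a , u , b) t = t * t * t - ι a * (t * t) + ι u * t - ι b

  ι-cub : ∀ a u b k → ι (KC.cub a u b k) ≡ cubL (a , u , b) (ι k)
  ι-cub a u b k = begin
    ι (k KF.* k KF.* k KF.- a KF.* (k KF.* k) KF.+ u KF.* k KF.- b)                    ≡⟨ ι-sub _ b ⟩
    ι (k KF.* k KF.* k KF.- a KF.* (k KF.* k) KF.+ u KF.* k) - ι b                    ≡⟨ cong (_- ι b) (ι-+ _ _) ⟩
    ι (k KF.* k KF.* k KF.- a KF.* (k KF.* k)) + ι (u KF.* k) - ι b                  ≡⟨ cong₂ (λ z w → z + w - ι b) (ι-sub _ _) (ι-* u k) ⟩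
    ι (k KF.* k KF.* k) - ι (a KF.* (k KF.* k)) + ι u * ι k - ι b                    ≡⟨ cong₂ (λ z w → z - w + ι u * ι k - ι b)
                                                                                             (trans (ι-* _ _) (cong (_* ι k) (ι-* k k))) (trans (ι-* _ _) (cong (ι a *_) (ι-* k k))) ⟩
    ι k * ι k * ι k - ι a * (ι k * ι k) + ι u * ι k - ι b                            ∎

  χ-factor : ∀ x t → cubL (χ x) t ≡ (t - x) * (t - φ x) * (t - φ (φ x))
  χ-factor x t = begin
    t * t * t - ι (χ₁ x) * (t * t) + ι (χ₂ x) * t - ι (χ₃ x)  ≡⟨ cong₃ (ι-χ₁ x) (ι-χ₂ x) (ι-χ₃ x) ⟩
    t * t * t - e₁ x * (t * t) + e₂ x * t - e₃ x              ≡⟨ solve 4 (λ t x y z → t :* t :* t :- (x :+ y :+ z) :* (t :* t) :+ (x :* y :+ x :* z :+ y :* z) :* t :- x :* y :* z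
                                                                          := (t :- x) :* (t :- y) :* (t :- z)) refl t x (φ x) (φ (φ x)) ⟩
    (t - x) * (t - φ x) * (t - φ (φ x))                       ∎
    where
    cong₃ : ∀ {a a' u u' b b'} → a ≡ a' → u ≡ u' → b ≡ b' →
      t * t * t - a * (t * t) + u * t - b ≡ t * t * t - a' * (t * t) + u' * t - b'
    cong₃ refl refl refl = refl

  Conjugate : Carrier → Carrier → Set
  Conjugate x t = t ≡ x ⊎ t ≡ φ x ⊎ t ≡ φ (φ x)

  conjugate⇒χ-root : ∀ x t → Conjugate x t → cubL (χ x) t ≡ 0#
  conjugate⇒χ-root x t c = trans (χ-factor x t) (vanish c)
    where
    vanish : Conjugate x t → (t - x) * (t - φ x) * (t - φ (φ x)) ≡ 0#
    vanish (inj₁ refl) = solve 3 (λ x y z → (x :- x) :* (x :- y) :* (x :- z) := con (pos 0)) refl x (φ x) (φ (φ x))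
    vanish (inj₂ (inj₁ refl)) = solve 3 (λ x y z → (y :- x) :* (y :- y) :* (y :- z) := con (pos 0)) refl x (φ x) (φ (φ x))
    vanish (inj₂ (inj₂ refl)) = solve 3 (λ x y z → (z :- x) :* (z :- y) :* (z :- z) := con (pos 0)) refl x (φ x) (φ (φ x))

  χ-root⇒conjugate : ∀ x t → cubL (χ x) t ≡ 0# → Conjugate x t
  χ-root⇒conjugate x t h = from-factor (zero-divisor₃ _ _ _ (trans (sym (χ-factor x t)) h))
    where
    from-factor : t - x ≡ 0# ⊎ t - φ x ≡ 0# ⊎ t - φ (φ x) ≡ 0# → Conjugate x t
    from-factor (inj₁ z) = inj₁ (sub≡0⇒≡ z)
    from-factor (inj₂ (inj₁ z)) = inj₂ (inj₁ (sub≡0⇒≡ z))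
    from-factor (inj₂ (inj₂ z)) = inj₂ (inj₂ (sub≡0⇒≡ z))

  module _ (x : Carrier) (x∉K : ¬ InK x) where
    conj₀₁ : x ≢ φ x
    conj₀₁ h = x∉K (fixed⇒K x (sym h))
    conj₀₂ : x ≢ φ (φ x)
    conj₀₂ h = x∉K (fixed⇒K x (trans (cong φ h) (φ³ x)))
    conj₁₂ : φ x ≢ φ (φ x)
    conj₁₂ h = x∉K (fixed⇒K x (trans h (trans (cong φ h) (φ³ x))))

    χ-no-root : ¬ KC.HasRoot (χ₁ x) (χ₂ x) (χ₃ x)
    χ-no-root (k , h) = conjugate-in-K (χ-root⇒conjugate x (ι k) (trans (sym (ι-cub (χ₁ x) (χ₂ x) (χ₃ x) k)) (trans (cong ι h) ι-0)))
      where
      conjugate-in-K : Conjugate x (ι k) → ⊥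
      conjugate-in-K (inj₁ e) = x∉K (k , e)
      conjugate-in-K (inj₂ (inj₁ e)) = x∉K (k , (begin
        ι k              ≡⟨ sym (φ-ι k) ⟩
        φ (ι k)          ≡⟨ cong φ (sym (φ-ι k)) ⟩
        φ (φ (ι k))      ≡⟨ cong (λ z → φ (φ z)) e ⟩
        φ (φ (φ x))      ≡⟨ φ³ x ⟩
        x                ∎))
      conjugate-in-K (inj₂ (inj₂ e)) = x∉K (k , (begin
        ι k              ≡⟨ sym (φ-ι k) ⟩
        φ (ι k)          ≡⟨ cong φ e ⟩
        φ (φ (φ x))      ≡⟨ φ³ x ⟩
        x                ∎))

  module _ (α β γ : Carrier) where
    private
      Q : Carrier → Carrier
      Q t = α * (t * t) + β * t + γ

      -- (Q t₁ - Q t₂) / (t₁ - t₂) = α (t₁ + t₂) + β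
      secant : ∀ {t₁ t₂} → t₁ ≢ t₂ → Q t₁ ≡ 0# → Q t₂ ≡ 0# → α * (t₁ + t₂) + β ≡ 0#
      secant {t₁} {t₂} t₁≢t₂ h₁ h₂ = cancelˡ (sub-nz t₁≢t₂) (begin
        (t₁ - t₂) * (α * (t₁ + t₂) + β)   ≡⟨ solve 5 (λ α β γ t₁ t₂ → (t₁ :- t₂) :* (α :* (t₁ :+ t₂) :+ β)
                                                  := (α :* (t₁ :* t₁) :+ β :* t₁ :+ γ) :- (α :* (t₂ :* t₂) :+ β :* t₂ :+ γ)) refl α β γ t₁ t₂ ⟩
        Q t₁ - Q t₂                       ≡⟨ cong₂ _-_ h₁ h₂ ⟩
        0# - 0#                           ≡⟨ sub-self 0# ⟩
        0#                                ≡⟨ sym (zeroʳ _) ⟩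
        (t₁ - t₂) * 0#                    ∎)

    quadratic-zero : ∀ {t₁ t₂ t₃} → t₁ ≢ t₂ → t₁ ≢ t₃ → t₂ ≢ t₃ →
      Q t₁ ≡ 0# → Q t₂ ≡ 0# → Q t₃ ≡ 0# → (α ≡ 0#) × (β ≡ 0#) × (γ ≡ 0#)
    quadratic-zero {t₁} {t₂} {t₃} t₁≢t₂ t₁≢t₃ t₂≢t₃ h₁ h₂ h₃ = α≡0 , β≡0 , γ≡0
      where
      s₁₂ : α * (t₁ + t₂) + β ≡ 0#
      s₁₂ = secant t₁≢t₂ h₁ h₂
      s₁₃ : α * (t₁ + t₃) + β ≡ 0#
      s₁₃ = secant t₁≢t₃ h₁ h₃
      α≡0 : α ≡ 0#
      α≡0 = cancelˡ (sub-nz t₂≢t₃) (begin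
        (t₂ - t₃) * α                              ≡⟨ solve 5 (λ α β t₁ t₂ t₃ → (t₂ :- t₃) :* α := (α :* (t₁ :+ t₂) :+ β) :- (α :* (t₁ :+ t₃) :+ β)) refl α β t₁ t₂ t₃ ⟩
        (α * (t₁ + t₂) + β) - (α * (t₁ + t₃) + β)  ≡⟨ cong₂ _-_ s₁₂ s₁₃ ⟩
        0# - 0#                                    ≡⟨ sub-self 0# ⟩
        0#                                         ≡⟨ sym (zeroʳ _) ⟩
        (t₂ - t₃) * 0#                             ∎)
      β≡0 : β ≡ 0#
      β≡0 = begin
        β                                          ≡⟨ solve 4 (λ α β t₁ t₂ → β := (α :* (t₁ :+ t₂) :+ β) :- α :* (t₁ :+ t₂)) refl α β t₁ t₂ ⟩
        (α * (t₁ + t₂) + β) - α * (t₁ + t₂)        ≡⟨ cong₂ (λ u v → u - v * (t₁ + t₂)) s₁₂ α≡0 ⟩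
        0# - 0# * (t₁ + t₂)                        ≡⟨ solve 1 (λ z → con (pos 0) :- con (pos 0) :* z := con (pos 0)) refl (t₁ + t₂) ⟩
        0#                                         ∎
      γ≡0 : γ ≡ 0#
      γ≡0 = begin
        γ                                          ≡⟨ solve 4 (λ α β γ t → γ := (α :* (t :* t) :+ β :* t :+ γ) :- α :* (t :* t) :- β :* t) refl α β γ t₁ ⟩
        Q t₁ - α * (t₁ * t₁) - β * t₁              ≡⟨ cong₃ h₁ α≡0 β≡0 ⟩
        0# - 0# * (t₁ * t₁) - 0# * t₁              ≡⟨ solve 1 (λ t → con (pos 0) :- con (pos 0) :* (t :* t) :- con (pos 0) :* t := con (pos 0)) refl t₁ ⟩
        0#                                         ∎
        where
        cong₃ : ∀ {a₁ a₂ b₁ b₂ c₁ c₂} → a₁ ≡ a₂ → b₁ ≡ b₂ → c₁ ≡ c₂ →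
          a₁ - b₁ * (t₁ * t₁) - c₁ * t₁ ≡ a₂ - b₂ * (t₁ * t₁) - c₂ * t₁
        cong₃ refl refl refl = refl

  φ-cub : ∀ τ t → φ (cubL τ t) ≡ cubL τ (φ t)
  φ-cub (a , u , b) t = begin
    φ (t * t * t - ι a * (t * t) + ι u * t - ι b)            ≡⟨ φ-sub _ _ ⟩
    φ (t * t * t - ι a * (t * t) + ι u * t) - φ (ι b)        ≡⟨ cong₂ _-_ (φ-+ _ _) (φ-ι b) ⟩
    φ (t * t * t - ι a * (t * t)) + φ (ι u * t) - ι b        ≡⟨ cong₂ (λ z w → z + w - ι b) (φ-sub _ _) (φ-* _ _) ⟩
    φ (t * t * t) - φ (ι a * (t * t)) + φ (ι u) * φ t - ι b  ≡⟨ cong₃ (trans (φ-* _ _) (cong (_* φ t) (φ-* t t)))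
                                                                        (trans (φ-* _ _) (cong₂ _*_ (φ-ι a) (φ-* t t))) (φ-ι u) ⟩
    φ t * φ t * φ t - ι a * (φ t * φ t) + ι u * φ t - ι b   ∎
    where
    cong₃ : ∀ {x₁ x₂ y₁ y₂ z₁ z₂} → x₁ ≡ x₂ → y₁ ≡ y₂ → z₁ ≡ z₂ → x₁ - y₁ + z₁ * φ t - ι b ≡ x₂ - y₂ + z₂ * φ t - ι b
    cong₃ refl refl refl = refl

  φ-root : ∀ τ t → cubL τ t ≡ 0# → cubL τ (φ t) ≡ 0#
  φ-root τ t h = trans (sym (φ-cub τ t)) (trans (cong φ h) φ-0)

  -- A root y ∈ L of a root-free K-cubic τ lies outside K and has χ y = τ:
  -- χ y - τ is a quadratic vanishing at the three distinct conjugates of y.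
  root⇒χ : ∀ a u b y → ¬ KC.HasRoot a u b → cubL (a , u , b) y ≡ 0# → ¬ InK y × χ y ≡ (a , u , b)
  root⇒χ a u b y no-root h = y∉K , coefficients (ι-inj (sub≡0⇒≡ (neg≡0⇒≡0 (proj₁ vanishes))))
                                                 (ι-inj (sub≡0⇒≡ (proj₁ (proj₂ vanishes))))
                                                 (ι-inj (sub≡0⇒≡ (neg≡0⇒≡0 (proj₂ (proj₂ vanishes)))))
    where
    τ : Coefficients
    τ = (a , u , b)
    y∉K : ¬ InK y
    y∉K (k , refl) = no-root (k , ι-inj (trans (ι-cub a u b k) (trans h (sym ι-0))))
    α β γ : Carrier
    α = ι (χ₁ y) - ι a
    β = ι (χ₂ y) - ι u
    γ = ι (χ₃ y) - ι b
    difference : ∀ t → cubL (χ y) t ≡ 0# → cubL τ t ≡ 0# → (- α) * (t * t) + β * t + (- γ) ≡ 0#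
    difference t h₁ h₂ = begin
      (- α) * (t * t) + β * t + (- γ)  ≡⟨ solve 7 (λ t A U B a u b → (:- (A :- a)) :* (t :* t) :+ (U :- u) :* t :+ (:- (B :- b))
                                                := (t :* t :* t :- A :* (t :* t) :+ U :* t :- B) :- (t :* t :* t :- a :* (t :* t) :+ u :* t :- b))
                                               refl t (ι (χ₁ y)) (ι (χ₂ y)) (ι (χ₃ y)) (ι a) (ι u) (ι b) ⟩
      cubL (χ y) t - cubL τ t          ≡⟨ cong₂ _-_ h₁ h₂ ⟩
      0# - 0#                          ≡⟨ sub-self 0# ⟩
      0#                               ∎
    vanishes : ((- α) ≡ 0#) × (β ≡ 0#) × ((- γ) ≡ 0#)
    vanishes = quadratic-zero (- α) β (- γ) (conj₀₁ y y∉K) (conj₀₂ y y∉K) (conj₁₂ y y∉K)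
      (difference y (conjugate⇒χ-root y y (inj₁ refl)) h)
      (difference (φ y) (conjugate⇒χ-root y (φ y) (inj₂ (inj₁ refl))) (φ-root τ y h))
      (difference (φ (φ y)) (conjugate⇒χ-root y (φ (φ y)) (inj₂ (inj₂ refl))) (φ-root τ (φ y) (φ-root τ y h)))
    coefficients : ∀ {a₁ a₂ u₁ u₂ b₁ b₂ : Elt K} → a₁ ≡ a₂ → u₁ ≡ u₂ → b₁ ≡ b₂ → (a₁ , u₁ , b₁) ≡ (a₂ , u₂ , b₂)
    coefficients refl refl refl = refl

-- An element x ∈ L^* with trace a and norm b either lies in K, and then
-- x = t with 3t = a, t³ = b (ε of them), or lies outside K, and then its
-- characteristic polynomial x³ - a x² + u x - b is root-free over K.
-- Conversely every root-free K-cubic splits in L (by counting: both the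
-- root-free cubics and the cubics with a root in L number (q³ - q)/3) and
-- then has exactly three roots outside K.
module NormTrace (K L : FiniteField) (emb : Embedding K L) (p r : ℕ) (p-prime : Prime p)
                 (cK : card K ≡ p ℕ.^ r) (cL : card L ≡ card K ℕ.^ 3) where
  import Data.Nat.Properties as ℕP
  open import Data.List using ([]; _∷_)
  open import Data.List.Membership.Propositional using (_∈_)
  open import Data.List.Relation.Unary.Any using (here; there)
  open import Data.List.Relation.Unary.All using ([]; _∷_)
  open import Data.List.Relation.Unary.AllPairs using ([]; _∷_)
  open import Data.Integer using () renaming (+_ to pos)
  open import Data.Sum using (_⊎_; inj₁; inj₂)
  open import Data.Product using (Σ; _×_; _,_; proj₁; proj₂)
  open import Data.Empty using (⊥-elim)
  open import Relation.Nullary using (¬_; Dec; yes; no)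
  open import Relation.Nullary.Decidable using (_×-dec_)
  open import Relation.Binary.PropositionalEquality hiding (_≡_)
  open Extension K L emb p r p-prime cK cL
  open IrreducibleCount K using (RootFree; rootFree?; irreducible-count)
  open TripleCount K using (Diagonal)
  open Splitting K using (three)
  open Field L
  open Counting
  open Embedding emb
  open ≡-Reasoning

  HasCharPoly : Coefficients → Carrier → Set
  HasCharPoly τ x = ¬ InK x × χ x ≡ τ

  SplitsInL : Coefficients → Set
  SplitsInL τ = RootFree τ × Σ Carrier λ y → cubL τ y ≡ 0#

  enumC : Enum Coefficients
  enumC = enum-× (FiniteFieldFacts.enum K) (enum-× (FiniteFieldFacts.enum K) (FiniteFieldFacts.enum K))

  splitsInL? : ∀ τ → Dec (SplitsInL τ)
  splitsInL? τ = rootFree? τ ×-dec search (FiniteFieldFacts.enum L) (λ y → cubL τ y ≟ 0#)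

  charpoly-split : ∀ τ → SplitsInL τ → IsCount (HasCharPoly τ) 3
  charpoly-split τ@(a , u , b) (no-root , y , hy) = count-list (y ∷ φ y ∷ φ (φ y) ∷ [])
    ((conj₀₁ y y∉K ∷ conj₀₂ y y∉K ∷ []) ∷ (conj₁₂ y y∉K ∷ []) ∷ [] ∷ [])
    (λ { x (here refl) → root⇒χ a u b y no-root hy
       ; x (there (here refl)) → root⇒χ a u b (φ y) no-root hy′
       ; x (there (there (here refl))) → root⇒χ a u b (φ (φ y)) no-root hy″ })
    (λ x hx → as-member x (χ-root⇒conjugate y x (subst (λ σ → cubL σ x ≡ 0#) (trans (proj₂ hx) (sym χy≡τ))
                                                        (conjugate⇒χ-root x x (inj₁ refl)))))
    where
    y∉K : ¬ InK y
    y∉K = proj₁ (root⇒χ a u b y no-root hy)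
    χy≡τ : χ y ≡ τ
    χy≡τ = proj₂ (root⇒χ a u b y no-root hy)
    hy′ : cubL τ (φ y) ≡ 0#
    hy′ = φ-root τ y hy
    hy″ : cubL τ (φ (φ y)) ≡ 0#
    hy″ = φ-root τ (φ y) hy′
    as-member : ∀ x → Conjugate y x → x ∈ y ∷ φ y ∷ φ (φ y) ∷ []
    as-member x (inj₁ e) = here e
    as-member x (inj₂ (inj₁ e)) = there (here e)
    as-member x (inj₂ (inj₂ e)) = there (there (here e))

  -- Every x ∉ K has a split root-free characteristic polynomial.
  charpoly-not-split : ∀ τ → ¬ SplitsInL τ → IsCount (HasCharPoly τ) 0
  charpoly-not-split τ not-split = count-empty (λ x hx →
    not-split (subst SplitsInL (proj₂ hx) (χ-no-root x (proj₁ hx) , x , conjugate⇒χ-root x x (inj₁ refl))))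

  #split : ℕ
  #split = Σl (proj₁ enumC) (λ τ → ind (splitsInL? τ))

  count-splitting : IsCount SplitsInL #split
  count-splitting = count-indicator (λ τ → τ) splitsInL?
    (λ τ s → count-single τ (λ _ → proj₂) (s , refl)) (λ τ ns → count-empty (λ { τ' (s , refl) → ns s })) enumC

  count-outside-K : IsCount (λ x → ¬ InK x) (3 ℕ.* #split)
  count-outside-K = subst (IsCount _) (Σl-*ˡ (proj₁ enumC) _ 3) (count-fibers χ (λ τ → 3 ℕ.* ind (splitsInL? τ)) fibre enumC)
    where
    fibre : ∀ τ → IsCount (λ x → ¬ InK x × χ x ≡ τ) (3 ℕ.* ind (splitsInL? τ))
    fibre τ = by-cases (splitsInL? τ)
      where
      by-cases : (d : Dec (SplitsInL τ)) → IsCount (HasCharPoly τ) (3 ℕ.* ind d)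
      by-cases (yes s) = charpoly-split τ s
      by-cases (no ns) = charpoly-not-split τ ns

  -- Counting L = K ⊔ (L ∖ K) against 3·I + q = q³ shows that all
  -- root-free cubics split in L.
  all-split : ∀ τ → RootFree τ → SplitsInL τ
  all-split = count-fill enumC splitsInL? (λ τ → proj₁) rootFree? count-splitting
    (subst (IsCount RootFree) (sym #split≡I) (proj₂ root-free-count))
    where
    root-free-count : Σ ℕ (IsCount RootFree)
    root-free-count = count-dec rootFree? enumC
    partition : 3 ℕ.* #split ℕ.+ q ≡ card L
    partition = trans (ℕP.+-comm _ q)
      (count-split inK? (count-⇔ (λ x i → _ , i) (λ x → proj₂) count-K)
                        (count-⇔ (λ x n → _ , n) (λ x → proj₂) count-outside-K)
                        (count-all (FiniteFieldFacts.enum L)))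
    #split≡I : #split ≡ proj₁ root-free-count
    #split≡I = ℕP.*-cancelˡ-≡ _ _ 3 (ℕP.+-cancelʳ-≡ q _ _
      (trans partition (trans cL (sym (irreducible-count (proj₂ root-free-count))))))

  Tr≡e₁ : ∀ x → Tr K L x ≡ e₁ x
  Tr≡e₁ x = cong (λ z → x + φ x + z) (^-* x q q)

  Nm≡e₃ : ∀ x → Nm K L x ≡ e₃ x
  Nm≡e₃ x = begin
    x ^ (1 ℕ.+ q ℕ.+ q ℕ.* q)            ≡⟨ ^-+ x (1 ℕ.+ q) (q ℕ.* q) ⟩
    x ^ (1 ℕ.+ q) * x ^ (q ℕ.* q)        ≡⟨ cong₂ _*_ (^-+ x 1 q) (^-* x q q) ⟩
    x ^ 1 * x ^ q * (x ^ q) ^ q          ≡⟨ cong (λ z → z * x ^ q * (x ^ q) ^ q) (*-identityʳ x) ⟩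
    x * φ x * φ (φ x)                    ∎

  e₁-ι : ∀ k → e₁ (ι k) ≡ ι (three KF.* k)
  e₁-ι k = begin
    ι k + φ (ι k) + φ (φ (ι k))       ≡⟨ cong₂ (λ u v → ι k + u + v) (φ-ι k) (trans (cong φ (φ-ι k)) (φ-ι k)) ⟩
    ι k + ι k + ι k                   ≡⟨ sym (trans (ι-+ _ _) (cong₂ _+_ (ι-+ _ _) refl)) ⟩
    ι (k KF.+ k KF.+ k)               ≡⟨ cong ι (KF.solve 1 (λ k → k KF.:+ k KF.:+ k KF.:= KF.con (pos 3) KF.:* k) refl k) ⟩
    ι (three KF.* k)                  ∎

  e₃-ι : ∀ k → e₃ (ι k) ≡ ι (k KF.* k KF.* k)
  e₃-ι k = begin
    ι k * φ (ι k) * φ (φ (ι k))       ≡⟨ cong₂ (λ u v → ι k * u * v) (φ-ι k) (trans (cong φ (φ-ι k)) (φ-ι k)) ⟩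
    ι k * ι k * ι k                   ≡⟨ sym (trans (ι-* _ _) (cong (_* ι k) (ι-* k k))) ⟩
    ι (k KF.* k KF.* k)               ∎

  TraceNorm : Elt K → Elt K → Carrier → Set
  TraceNorm a b x = (x ≢ 0#) × (Tr K L x ≡ ι a) × (Nm K L x ≡ ι b)

  toK : Carrier → Elt K
  toK x with inK? x
  ... | yes (k , _) = k
  ... | no _ = KF.0#

  toK-ι : ∀ x → InK x → ι (toK x) ≡ x
  toK-ι x x∈K with inK? x
  ... | yes (k , h) = h
  ... | no x∉K = ⊥-elim (x∉K x∈K)

  module _ (a b : Elt K) (b≢0 : b ≢ KF.0#) where
    count-inside : ∀ {ε} → IsCount (Diagonal a b) ε → IsCount (λ x → TraceNorm a b x × InK x) ε
    count-inside = count-bij ι toK into back (λ k _ → ι-inj (toK-ι (ι k) (k , refl))) (λ x h → toK-ι x (proj₂ h))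
      where
      into : ∀ k → Diagonal a b k → TraceNorm a b (ι k) × InK (ι k)
      into k (3k≡a , k³≡b) = (ι-nz k≢0 , trans (Tr≡e₁ (ι k)) (trans (e₁-ι k) (cong ι 3k≡a)) ,
                                          trans (Nm≡e₃ (ι k)) (trans (e₃-ι k) (cong ι k³≡b))) , (k , refl)
        where
        k≢0 : k ≢ KF.0#
        k≢0 k≡0 = b≢0 (trans (sym k³≡b) (trans (cong (λ w → w KF.* w KF.* w) k≡0)
                                              (trans (cong (KF._* KF.0#) (KF.zeroˡ KF.0#)) (KF.zeroˡ KF.0#))))
      back : ∀ x → TraceNorm a b x × InK x → Diagonal a b (toK x)
      back x ((_ , tr , nm) , x∈K) =
        ι-inj (trans (sym (e₁-ι (toK x))) (trans (cong e₁ (toK-ι x x∈K)) (trans (sym (Tr≡e₁ x)) tr))) ,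
        ι-inj (trans (sym (e₃-ι (toK x))) (trans (cong e₃ (toK-ι x x∈K)) (trans (sym (Nm≡e₃ x)) nm)))

    fibre-outside : ∀ u → IsCount (λ x → (TraceNorm a b x × ¬ InK x) × χ₂ x ≡ u) (3 ℕ.* ind (rootFree? (a , u , b)))
    fibre-outside u = count-⇔ to from (by-cases (rootFree? (a , u , b)))
      where
      by-cases : (d : Dec (RootFree (a , u , b))) → IsCount (HasCharPoly (a , u , b)) (3 ℕ.* ind d)
      by-cases (yes rf) = charpoly-split (a , u , b) (all-split (a , u , b) rf)
      by-cases (no nrf) = charpoly-not-split (a , u , b) (λ s → nrf (proj₁ s))
      to : ∀ x → HasCharPoly (a , u , b) x → (TraceNorm a b x × ¬ InK x) × χ₂ x ≡ u
      to x (x∉K , χx≡τ) = ((x≢0 , tr , nm) , x∉K) , cong (λ t → proj₁ (proj₂ t)) χx≡τ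
        where
        tr : Tr K L x ≡ ι a
        tr = trans (Tr≡e₁ x) (trans (sym (ι-χ₁ x)) (cong (λ t → ι (proj₁ t)) χx≡τ))
        nm : Nm K L x ≡ ι b
        nm = trans (Nm≡e₃ x) (trans (sym (ι-χ₃ x)) (cong (λ t → ι (proj₂ (proj₂ t))) χx≡τ))
        x≢0 : x ≢ 0#
        x≢0 x≡0 = ι-nz b≢0 (trans (sym nm) (trans (Nm≡e₃ x)
          (trans (cong (λ z → z * φ x * φ (φ x)) x≡0) (trans (cong (_* φ (φ x)) (zeroˡ _)) (zeroˡ _)))))
      to-coefficients : ∀ {a₁ a₂ u₁ u₂ b₁ b₂ : Elt K} → a₁ ≡ a₂ → u₁ ≡ u₂ → b₁ ≡ b₂ → (a₁ , u₁ , b₁) ≡ (a₂ , u₂ , b₂)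
      to-coefficients refl refl refl = refl
      from : ∀ x → (TraceNorm a b x × ¬ InK x) × χ₂ x ≡ u → HasCharPoly (a , u , b) x
      from x (((_ , tr , nm) , x∉K) , χ₂x≡u) = x∉K ,
        to-coefficients (ι-inj (trans (ι-χ₁ x) (trans (sym (Tr≡e₁ x)) tr))) χ₂x≡u
                        (ι-inj (trans (ι-χ₃ x) (trans (sym (Nm≡e₃ x)) nm)))

    private
      #root-free : ℕ
      #root-free = Σl KF.elems (λ u → ind (rootFree? (a , u , b)))

      count-root-free : IsCount (λ u → ¬ Cubic.HasRoot K a u b) #root-free
      count-root-free = count-indicator (λ u → u) (λ u → rootFree? (a , u , b))
        (λ u rf → count-single u (λ _ → proj₂) (rf , refl)) (λ u nrf → count-empty (λ { u' (rf , refl) → nrf rf }))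
        (FiniteFieldFacts.enum K)

      count-outside : IsCount (λ x → TraceNorm a b x × ¬ InK x) (3 ℕ.* #root-free)
      count-outside = subst (IsCount _) (Σl-*ˡ KF.elems _ 3)
        (count-fibers χ₂ (λ u → 3 ℕ.* ind (rootFree? (a , u , b))) fibre-outside (FiniteFieldFacts.enum K))

    trace-norm-count : ∀ {P ε} → IsCount (λ u → ¬ Cubic.HasRoot K a u b) P → IsCount (Diagonal a b) ε →
      IsCount (TraceNorm a b) (3 ℕ.* P ℕ.+ ε)
    trace-norm-count cP cε = subst (λ n → IsCount (TraceNorm a b) (3 ℕ.* n ℕ.+ _)) (count-unique count-root-free cP)
      (count-⇔ (λ x → λ { (inj₁ h) → proj₁ h ; (inj₂ h) → proj₁ h }) split
        (count-⊎ count-outside (count-inside cε) (λ x h₁ h₂ → proj₂ h₁ (proj₂ h₂))))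
      where
      split : ∀ x → TraceNorm a b x → (TraceNorm a b x × ¬ InK x) ⊎ (TraceNorm a b x × InK x)
      split x h with inK? x
      ... | yes x∈K = inj₂ (h , x∈K)
      ... | no x∉K = inj₁ (h , x∉K)

module CharacteristicThree (F : FiniteField) (p : ℕ) (p-prime : Prime p) (char : FiniteField.ofℕ F p ≡ FiniteField.0# F) where
  open import Data.Nat using (zero; suc)
  open import Data.Nat.Primality using (prime⇒irreducible)
  open import Data.Nat.DivMod using (_%_; _/_; m≡m%n+[m/n]*n; m%n<n)
  open import Data.Nat.Divisibility using (m%n≡0⇒n∣m)
  open import Data.Sum using (inj₁; inj₂)
  open import Data.Empty using (⊥-elim)
  open import Relation.Binary.PropositionalEquality hiding (_≡_; _≢_)
  open Field F
  open ≡-Reasoning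

  three≡0⇒p≡3 : ofℕ 3 ≡ 0# → p ≡ 3
  three≡0⇒p≡3 3≡0 = by-remainder (p % 3) refl (m%n<n p 3)
    where
    -- p ≡ p % 3 (mod 3), so p % 3 vanishes in F
    remainder≡0 : ofℕ (p % 3) ≡ 0#
    remainder≡0 = begin
      ofℕ (p % 3)                              ≡⟨ sym (+-identityʳ _) ⟩
      ofℕ (p % 3) + 0#                         ≡⟨ cong (ofℕ (p % 3) +_) (sym (trans (cong (ofℕ (p / 3) *_) 3≡0) (zeroʳ _))) ⟩
      ofℕ (p % 3) + ofℕ (p / 3) * ofℕ 3        ≡⟨ cong (ofℕ (p % 3) +_) (sym (ofℕ-* (p / 3) 3)) ⟩
      ofℕ (p % 3) + ofℕ (p / 3 ℕ.* 3)          ≡⟨ sym (ofℕ-+ (p % 3) (p / 3 ℕ.* 3)) ⟩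
      ofℕ (p % 3 ℕ.+ p / 3 ℕ.* 3)              ≡⟨ cong ofℕ (sym (m≡m%n+[m/n]*n p 3)) ⟩
      ofℕ p                                    ≡⟨ char ⟩
      0#                                       ∎
    by-remainder : ∀ n → n ≡ p % 3 → n ℕ.< 3 → p ≡ 3
    by-remainder zero e _ with prime⇒irreducible p-prime (m%n≡0⇒n∣m p 3 (sym e))
    ... | inj₁ ()
    ... | inj₂ p≡3 = sym p≡3
    by-remainder (suc zero) e _ = ⊥-elim (1≢0 (trans (sym (+-identityʳ 1#)) (trans (cong ofℕ e) remainder≡0)))
    by-remainder (suc (suc zero)) e _ = ⊥-elim (1≢0 (begin
      1#                 ≡⟨ sym (+-identityʳ 1#) ⟩
      1# + 0#            ≡⟨ cong (1# +_) (sym (trans (cong ofℕ e) remainder≡0)) ⟩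
      ofℕ 3              ≡⟨ 3≡0 ⟩
      0#                 ∎))
    by-remainder (suc (suc (suc n))) _ (ℕ.s≤s (ℕ.s≤s (ℕ.s≤s ())))

-- The diagonal count ε = #{t | 3t = a, t³ = b} is 1 if p ≠ 3 and
-- b / a³ = 1/27 (then t = a/3), and 0 otherwise (for p = 3, 3t = 0 ≠ a).
module DiagonalCount (K : FiniteField) (p r : ℕ) (p-prime : Prime p) (cK : card K ≡ p ℕ.^ r)
                     (a b : Elt K) (a≢0 : a ≢ FiniteField.0# K) where
  open import Data.Integer using () renaming (+_ to pos)
  open import Data.Product using (_×_; _,_)
  open import Relation.Nullary using (¬_; yes; no)
  open import Relation.Binary.PropositionalEquality hiding (_≡_; _≢_)
  open Field K
  open Counting
  open Splitting K using (three)
  open TripleCount K using (Diagonal)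
  open ≡-Reasoning

  c : Carrier
  c = b * (a ^ 3) ⁻¹

  Special : Set
  Special = p ≢ 3 × c ≡ (ofℕ 27) ⁻¹

  char : ofℕ p ≡ 0#
  char = FiniteFieldFacts.characteristic K p r cK

  three≡ofℕ3 : three ≡ ofℕ 3
  three≡ofℕ3 = numeral≡ofℕ 3

  27≡three³ : ofℕ 27 ≡ three * three * three
  27≡three³ = trans (sym (numeral≡ofℕ 27)) (solve 0 (con (pos 27) := con (pos 3) :* con (pos 3) :* con (pos 3)) refl)

  diagonal-special : Special → IsCount (Diagonal a b) 1
  diagonal-special (p≢3 , c≡1/27) = count-single t₀ unique (3t₀≡a , t₀³≡b)
    where
    three≢0 : three ≢ 0#
    three≢0 3≡0 = p≢3 (CharacteristicThree.three≡0⇒p≡3 K p p-prime char (trans (sym three≡ofℕ3) 3≡0))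
    i t₀ : Carrier
    i = three ⁻¹
    t₀ = a * i
    3i≡1 : three * i ≡ 1#
    3i≡1 = inverse three three≢0
    3t₀≡a : three * t₀ ≡ a
    3t₀≡a = trans (solve 3 (λ t a i → t :* (a :* i) := a :* (t :* i)) refl three a i) (trans (cong (a *_) 3i≡1) (*-identityʳ a))
    1/27≡i³ : (ofℕ 27) ⁻¹ ≡ i * i * i
    1/27≡i³ = inverse-unique (begin
      ofℕ 27 * (i * i * i)                      ≡⟨ cong (_* (i * i * i)) 27≡three³ ⟩
      three * three * three * (i * i * i)       ≡⟨ solve 2 (λ t i → t :* t :* t :* (i :* i :* i) := (t :* i) :* (t :* i) :* (t :* i)) refl three i ⟩
      (three * i) * (three * i) * (three * i)   ≡⟨ cong (λ z → z * z * z) 3i≡1 ⟩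
      1# * 1# * 1#                              ≡⟨ trans (*-identityʳ _) (*-identityʳ _) ⟩
      1#                                        ∎)
    t₀³≡b : t₀ * t₀ * t₀ ≡ b
    t₀³≡b = begin
      t₀ * t₀ * t₀               ≡⟨ solve 2 (λ a i → (a :* i) :* (a :* i) :* (a :* i) := (i :* i :* i) :* (a :* (a :* (a :* con (pos 1))))) refl a i ⟩
      (i * i * i) * a ^ 3        ≡⟨ cong (_* a ^ 3) (trans (sym 1/27≡i³) (sym c≡1/27)) ⟩
      c * a ^ 3                  ≡⟨ *-assoc _ _ _ ⟩
      b * ((a ^ 3) ⁻¹ * a ^ 3)   ≡⟨ cong (b *_) (inverseˡ _ (^-nz 3 a≢0)) ⟩
      b * 1#                     ≡⟨ *-identityʳ b ⟩
      b                          ∎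
    unique : ∀ t → Diagonal a b t → t ≡ t₀
    unique t (3t≡a , _) = cancelˡ three≢0 (trans 3t≡a (sym 3t₀≡a))

  diagonal-not-special : ¬ Special → IsCount (Diagonal a b) 0
  diagonal-not-special not-special = count-empty no-diagonal
    where
    no-diagonal : ∀ t → ¬ Diagonal a b t
    no-diagonal t (3t≡a , t³≡b) with p ℕ.≟ 3
    ... | yes refl = a≢0 (trans (sym 3t≡a) (trans (cong (_* t) (trans three≡ofℕ3 char)) (zeroˡ t)))
    ... | no p≢3 = not-special (p≢3 , sym (inverse-unique (begin
      ofℕ 27 * (b * (a ^ 3) ⁻¹)      ≡⟨ sym (*-assoc _ _ _) ⟩
      (ofℕ 27 * b) * (a ^ 3) ⁻¹      ≡⟨ cong (_* (a ^ 3) ⁻¹) 27b≡a³ ⟩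
      a ^ 3 * (a ^ 3) ⁻¹             ≡⟨ inverse _ (^-nz 3 a≢0) ⟩
      1#                             ∎)))
      where
      27b≡a³ : ofℕ 27 * b ≡ a ^ 3
      27b≡a³ = begin
        ofℕ 27 * b                              ≡⟨ cong₂ _*_ 27≡three³ (sym t³≡b) ⟩
        three * three * three * (t * t * t)     ≡⟨ solve 2 (λ h t → h :* h :* h :* (t :* t :* t) := (h :* t) :* ((h :* t) :* ((h :* t) :* con (pos 1)))) refl three t ⟩
        (three * t) ^ 3                         ≡⟨ cong (_^ 3) 3t≡a ⟩
        a ^ 3                                   ∎

open import Data.Nat using (ℕ; _+_; _*_; _^_)
open import Data.Nat.Properties using (+-identityʳ)
open import Data.Nat.Primality using (Prime)
open import Data.Product using (_×_; _,_; proj₁; proj₂)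
open import Relation.Nullary using (¬_)
open import Relation.Binary.PropositionalEquality

theorem5p1 : (p r : ℕ) → Prime p →
    (K L : FiniteField) → card K ≡ p ^ r → card L ≡ (p ^ r) ^ 3 →
    (e : Embedding K L) →
    (a b : Elt K) → a ≢ FiniteField.0# K → b ≢ FiniteField.0# K →
    let c = FiniteField._*_ K b (FiniteField._⁻¹ K (FiniteField._^_ K a 3)) in
    (nN nP nX : ℕ) → N₃-is K L e a b nN → P₃-is K a b nP → #X-is K c nX →
    (nN ≡ nX)
    × ((p ≢ 3 × c ≡ FiniteField._⁻¹ K (FiniteField.ofℕ K 27)) → 3 * nP + 1 ≡ nX)
    × (¬ (p ≢ 3 × c ≡ FiniteField._⁻¹ K (FiniteField.ofℕ K 27)) → 3 * nP ≡ nX)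
theorem5p1 p r p-prime K L cK cL e a b a≢0 b≢0 nN nP nX cN cP cX =
  trans N≡3P+ε 3P+ε≡X , special , not-special
  where
  open TripleCount K using (diagonal-count; sumProduct-count; triple-count)
  open DiagonalCount K p r p-prime cK a b a≢0 using (Special; diagonal-special; diagonal-not-special)
  open Counting using (count-⇔; count-unique)

  ε : ℕ
  ε = proj₁ (diagonal-count a b)

  T : ℕ
  T = proj₁ (sumProduct-count a b)

  root-free : IsCount (λ u → ¬ Cubic.HasRoot K a u b) nP
  root-free = count-⇔ (λ u → Cubic.irreducible⇒no-root K a u b) (λ u → Cubic.no-root⇒irreducible K a u b) cP

  3P+ε≡X : 3 * nP + ε ≡ nX
  3P+ε≡X = trans (triple-count a b b≢0 root-free (proj₂ (diagonal-count a b)) (proj₂ (sumProduct-count a b)))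
                 (count-unique (Curve.curve-count K a b a≢0 b≢0 (proj₂ (sumProduct-count a b))) cX)

  N≡3P+ε : nN ≡ 3 * nP + ε
  N≡3P+ε = count-unique cN (NormTrace.trace-norm-count K L e p r p-prime cK (trans cL (cong (_^ 3) (sym cK)))
                                                      a b b≢0 root-free (proj₂ (diagonal-count a b)))

  special : Special → 3 * nP + 1 ≡ nX
  special s = subst (λ n → 3 * nP + n ≡ nX) (count-unique (proj₂ (diagonal-count a b)) (diagonal-special s)) 3P+ε≡X

  not-special : ¬ Special → 3 * nP ≡ nX
  not-special ns = trans (sym (+-identityʳ (3 * nP)))
    (subst (λ n → 3 * nP + n ≡ nX) (count-unique (proj₂ (diagonal-count a b)) (diagonal-not-special ns)) 3P+ε≡X)
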